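{- If $s$ is a deterministic higher-order pattern (DHP) and $\theta$ is a substitution such that every term in $\mathrm{im}(\theta)$ is a DHP, then $s\theta$ is a DHP.
   Context: Terms are simply-typed $\lambda$-terms in $\beta\eta$-long normal form. Types are sorts $a$ or $(\sigma_1,\dots,\sigma_n)\to a$. There are typed variables $\mathcal{V}$, infinitely many of each type, and typed function symbols $\mathcal{F}$. Terms are generated as follows. If $h\in\mathcal{F}\cup\mathcal{V}$ has type $(\sigma_1,\dots,\sigma_n)\to a$ and $t_i:\sigma_i$, then $h(t_1,\dots,t_n):a$. If $t:a$ and $x_i:\sigma_i$, then $x_1,\dots,x_n.t:(\sigma_1,\dots,\sigma_n)\to a$. Terms are taken modulo $\alpha$-renaming, and bound variables are distinct and never free. $\mathrm{fv}$ denotes free variables. $x{\downarrow}=y_1,\dots,y_n.x(y_1{\downarrow},\dots,y_n{\downarrow})$ is the $\eta$-expansion of $x:(\sigma_1,\dots,\sigma_n)\to a$. Subterms: $\vec x.h(s_1,\dots,s_m)\trianglerighteq t$ iff the two are equal or $\vec x.s_i\trianglerighteq t$ for some $i$, with binder prefixes concatenated. Substitutions are finite type-preserving maps from variables to terms, and $\mathrm{im}(\theta)$ is the set of terms in the range. Application is hereditary and capture-avoiding: - $x(\vec t)\theta=w\{\vec z\mapsto\vec t\theta\}$ if $\theta(x)=\vec z.w$; - $h(\vec t)\theta=h(\vec t\theta)$ if $h\notin\mathrm{dom}(\theta)$; - $(\vec x.t)\theta=\vec z.(t\{\vec x\mapsto\vec z\}\theta)$ for fresh $\vec z$. Expanded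 terms: $\vec x.s$ is expanded if it equals $\vec x,y_1,\dots,y_k.h(s_1,\dots,s_m,y_1{\downarrow},\dots,y_k{\downarrow})$ with $(\bigcup_i\mathrm{fv}(s_i)\cup\{h\})\cap\{\vec y\}=\varnothing$. Expanded subterms: for $\vec x=x_1,\dots,x_n$, a term $\vec x.s$, and an expanded term $\vec x.t=\vec x,y_1,\dots,y_k.h(t_1,\dots,t_m,\vec y{\downarrow})$, we write $\vec x.s\trianglerighteq_E\vec x.t$ iff there are $n'\ge n$ and terms $x_1,\dots,x_{n'}.t_{m+j}$ ($1\le j\le k$) with $\vec x.s\trianglerighteq x_1,\dots,x_{n'}.h(t_1,\dots,t_{m+k})$. DHPs: a term $s$ is a DHP if every subterm $\vec x.y(t_1,\dots,t_m)$ of $s$ with $y\notin\{\vec x\}$ satisfies, for all $1\le i\le m$: - (i) $\varnothing\ne\mathrm{fv}(t_i)\subseteq\{\vec x\}$; - (ii) $\vec x.t_i$ is expanded; - (iii) $\vec x.t_i\not\trianglerighteq_E\vec x.t_j$ for all $j\ne i$. -}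

module Defs where

open import Data.List using (List; []; _∷_; _++_; length; lookup)
open import Data.Fin using (Fin)
open import Data.Maybe using (Maybe; just; nothing)
import Data.Maybe
open import Data.Product using (Σ; _×_; _,_)
open import Data.Empty using (⊥)
open import Data.Sum as Sum using (_⊎_; inj₁; inj₂)
open import Data.List.Properties using (++-assoc)
open import Relation.Nullary using (¬_)
open import Relation.Binary.PropositionalEquality using (_≡_; _≢_; refl; subst; sym)

-- Simple types over a set S of sorts:  (σ₁,…,σₙ) → a ;  a sort a is [] ⇒ a.

data Ty (S : Set) : Set where
  _⇒_ : List (Ty S) → S → Ty S

-- Terms in βη-long normal form (intrinsically typed, de Bruijn),
-- over sorts S and typed function symbols F.

module Terms (S : Set) (F : Ty S → Set) where

  Type : Set
  Type = Ty S

  Ctx : Set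
  Ctx = List Type

  infix 4 _∋_
  data _∋_ : Ctx → Type → Set where
    here  : ∀ {Γ τ} → (τ ∷ Γ) ∋ τ
    there : ∀ {Γ σ τ} → Γ ∋ τ → (σ ∷ Γ) ∋ τ

  data Head (Γ : Ctx) (τ : Type) : Set where
    var : Γ ∋ τ → Head Γ τ
    fun : F τ → Head Γ τ

  -- Tm Γ ((σ₁,…,σₙ) ⇒ a) : terms x₁,…,xₙ.t   (x₁ is de Bruijn index 0)
  -- Bd Γ a               : bodies h(t₁,…,tₘ) of sort a
  -- Args Γ σs            : argument lists
  data Tm (Γ : Ctx) : Type → Set
  data Bd (Γ : Ctx) : S → Set
  data Args (Γ : Ctx) : List Type → Set

  data Tm Γ where
    lam : ∀ {σs a} → Bd (σs ++ Γ) a → Tm Γ (σs ⇒ a)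

  infix 5 _∙_
  data Bd Γ where
    _∙_ : ∀ {σs a} → Head Γ (σs ⇒ a) → Args Γ σs → Bd Γ a

  infixr 6 _∷ₐ_
  data Args Γ where
    nil  : Args Γ []
    _∷ₐ_ : ∀ {σ σs} → Tm Γ σ → Args Γ σs → Args Γ (σ ∷ σs)

  infixr 5 _++ₐ_
  _++ₐ_ : ∀ {Γ σs ρs} → Args Γ σs → Args Γ ρs → Args Γ (σs ++ ρs)
  nil ++ₐ us = us
  (t ∷ₐ ts) ++ₐ us = t ∷ₐ (ts ++ₐ us)

  _!_ : ∀ {Γ σs} → Args Γ σs → (i : Fin (length σs)) → Tm Γ (lookup σs i)
  (t ∷ₐ ts) ! Fin.zero  = t
  (t ∷ₐ ts) ! Fin.suc i = ts ! i

  infix 4 _∈ₐ_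
  data _∈ₐ_ {Γ} : ∀ {σ σs} → Tm Γ σ → Args Γ σs → Set where
    hereₐ  : ∀ {σ σs} {t : Tm Γ σ} {ts : Args Γ σs} → t ∈ₐ (t ∷ₐ ts)
    thereₐ : ∀ {σ ρ σs} {t : Tm Γ σ} {u : Tm Γ ρ} {ts : Args Γ σs} →
             t ∈ₐ ts → t ∈ₐ (u ∷ₐ ts)

  Ren : Ctx → Ctx → Set
  Ren Γ Δ = ∀ {τ} → Γ ∋ τ → Δ ∋ τ

  liftR : ∀ {Γ Δ} (σs : Ctx) → Ren Γ Δ → Ren (σs ++ Γ) (σs ++ Δ)
  liftR []       ρ x         = ρ x
  liftR (σ ∷ σs) ρ here      = here
  liftR (σ ∷ σs) ρ (there x) = there (liftR σs ρ x)

  wkR : ∀ {Γ} (σs : Ctx) → Ren Γ (σs ++ Γ)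
  wkR []       x = x
  wkR (σ ∷ σs) x = there (wkR σs x)

  injL : ∀ {Γ} (σs : Ctx) → Ren σs (σs ++ Γ)
  injL (σ ∷ σs) here      = here
  injL (σ ∷ σs) (there x) = there (injL σs x)

  renH : ∀ {Γ Δ τ} → Ren Γ Δ → Head Γ τ → Head Δ τ
  renH ρ (var x) = var (ρ x)
  renH ρ (fun f) = fun f

  renT : ∀ {Γ Δ τ} → Ren Γ Δ → Tm Γ τ → Tm Δ τ
  renB : ∀ {Γ Δ a} → Ren Γ Δ → Bd Γ a → Bd Δ a
  renA : ∀ {Γ Δ σs} → Ren Γ Δ → Args Γ σs → Args Δ σs
  renT ρ (lam {σs} b) = lam (renB (liftR σs ρ) b)
  renB ρ (h ∙ ts) = renH ρ h ∙ renA ρ ts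
  renA ρ nil = nil
  renA ρ (t ∷ₐ ts) = renT ρ t ∷ₐ renA ρ ts

  -- η-expansion  x↓ = y₁,…,yₙ. x(y₁↓,…,yₙ↓)

  η  : ∀ {Γ τ} → Γ ∋ τ → Tm Γ τ
  ηs : ∀ {Γ} (σs : Ctx) → Ren σs Γ → Args Γ σs
  η {Γ} {σs ⇒ a} x = lam (var (wkR σs x) ∙ ηs σs (injL σs))
  ηs []       f = nil
  ηs (σ ∷ σs) f = η (f here) ∷ₐ ηs σs (λ x → f (there x))

  -- Hereditary substitution (single variable, Keller–Altenkirch style).
  -- Del Ξ σ Ξ' : Ξ' is Ξ with one variable of type σ (the one being
  -- substituted) removed.

  data Del : Ctx → Type → Ctx → Set where
    dhere  : ∀ {σ Γ} → Del (σ ∷ Γ) σ Γ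
    dthere : ∀ {ψ σ Ξ Ξ'} → Del Ξ σ Ξ' → Del (ψ ∷ Ξ) σ (ψ ∷ Ξ')

  delLift : ∀ (σs : Ctx) {σ Ξ Ξ'} → Del Ξ σ Ξ' → Del (σs ++ Ξ) σ (σs ++ Ξ')
  delLift []       d = d
  delLift (ψ ∷ σs) d = dthere (delLift σs d)

  classify : ∀ {Ξ σ Ξ' τ} → Del Ξ σ Ξ' → Ξ ∋ τ → (Ξ' ∋ τ) ⊎ (τ ≡ σ)
  classify dhere      here      = inj₂ refl
  classify dhere      (there x) = inj₁ x
  classify (dthere d) here      = inj₁ here
  classify (dthere d) (there x) = Sum.map₁ there (classify d x)

  -- sub1B d b u : b{x ↦ u} where x is the variable deleted by d;
  -- inst σs w us : w{z⃗ ↦ u⃗} for the block z⃗ : σs of innermost variables of w.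
  sub1T : ∀ {Ξ σ Ξ' τ} → Del Ξ σ Ξ' → Tm Ξ τ → Tm Ξ' σ → Tm Ξ' τ
  sub1B : ∀ {Ξ σ Ξ' a} → Del Ξ σ Ξ' → Bd Ξ a → Tm Ξ' σ → Bd Ξ' a
  sub1A : ∀ {Ξ σ Ξ' σs} → Del Ξ σ Ξ' → Args Ξ σs → Tm Ξ' σ → Args Ξ' σs
  sub1H : ∀ {Ξ' σ τs a} → (Ξ' ∋ (τs ⇒ a)) ⊎ ((τs ⇒ a) ≡ σ) →
          Args Ξ' τs → Tm Ξ' σ → Bd Ξ' a
  inst  : ∀ {Γ} (σs : Ctx) {a} → Bd (σs ++ Γ) a → Args Γ σs → Bd Γ a

  sub1T d (lam {σs} b) u = lam (sub1B (delLift σs d) b (renT (wkR σs) u))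
  sub1B d (fun f ∙ ts) u = fun f ∙ sub1A d ts u
  sub1B d (var x ∙ ts) u = sub1H (classify d x) (sub1A d ts u) u
  sub1A d nil       u = nil
  sub1A d (t ∷ₐ ts) u = sub1T d t u ∷ₐ sub1A d ts u
  sub1H (inj₁ y) ts u = var y ∙ ts
  sub1H {σ = τs ⇒ a} (inj₂ refl) ts (lam w) = inst τs w ts

  inst []       w nil       = w
  inst (σ ∷ σs) w (t ∷ₐ ts) = inst σs (sub1B dhere w (renT (wkR σs) t)) ts

  -- Working over a
  -- context Γ containing all variables involved, a substitution assigns to
  -- each variable either nothing (x ∉ dom θ) or a term (x ∈ dom θ).

  Subst : Ctx → Set
  Subst Γ = ∀ {τ} → Γ ∋ τ → Maybe (Tm Γ τ)

  liftS : ∀ {Γ} (σs : Ctx) → Subst Γ → Subst (σs ++ Γ)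
  liftS []       θ x         = θ x
  liftS (σ ∷ σs) θ here      = nothing
  liftS (σ ∷ σs) θ (there x) = Data.Maybe.map (renT there) (liftS σs θ x)

  appH : ∀ {Γ τs a} → Γ ∋ (τs ⇒ a) → Maybe (Tm Γ (τs ⇒ a)) → Args Γ τs → Bd Γ a
  appH x nothing        ts = var x ∙ ts
  appH x (just (lam w)) ts = inst _ w ts

  _[_]T : ∀ {Γ τ} → Tm Γ τ → Subst Γ → Tm Γ τ
  _[_]B : ∀ {Γ a} → Bd Γ a → Subst Γ → Bd Γ a
  _[_]A : ∀ {Γ σs} → Args Γ σs → Subst Γ → Args Γ σs
  lam {σs} b [ θ ]T = lam (b [ liftS σs θ ]B)
  (fun f ∙ ts) [ θ ]B = fun f ∙ (ts [ θ ]A)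
  (var x ∙ ts) [ θ ]B = appH x (θ x) (ts [ θ ]A)
  nil [ θ ]A = nil
  (t ∷ₐ ts) [ θ ]A = (t [ θ ]T) ∷ₐ (ts [ θ ]A)

  data FvT : ∀ {Γ ρ τ} → Γ ∋ ρ → Tm Γ τ → Set
  data FvB : ∀ {Γ ρ a} → Γ ∋ ρ → Bd Γ a → Set
  data FvT where
    lamF : ∀ {Γ ρ σs a} {z : Γ ∋ ρ} {b : Bd (σs ++ Γ) a} →
           FvB (wkR σs z) b → FvT z (lam b)
  data FvB where
    headF : ∀ {Γ ρs a} {z : Γ ∋ (ρs ⇒ a)} {ts : Args Γ ρs} → FvB z (var z ∙ ts)
    argF  : ∀ {Γ ρ σ σs a} {z : Γ ∋ ρ} {h : Head Γ (σs ⇒ a)} {ts : Args Γ σs}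
              {t : Tm Γ σ} → t ∈ₐ ts → FvT z t → FvB z (h ∙ ts)

  -- Binder prefixes and subterms.
  -- Γ ⊑ Ξ : Ξ is Γ extended by (blocks of) bound variables x⃗.

  infix 4 _⊑_
  data _⊑_ (Γ : Ctx) : Ctx → Set where
    base : Γ ⊑ Γ
    step : ∀ {Ξ} (σs : Ctx) → Γ ⊑ Ξ → Γ ⊑ (σs ++ Ξ)

  _⊙_ : ∀ {Γ Γ' Ξ} → Γ ⊑ Γ' → Γ' ⊑ Ξ → Γ ⊑ Ξ
  e ⊙ base       = e
  e ⊙ step σs e' = step σs (e ⊙ e')

  wkE : ∀ {Γ Ξ} → Γ ⊑ Ξ → Ren Γ Ξ
  wkE base         x = x
  wkE (step σs e)  x = wkR σs (wkE e x)

  -- OccT s e c : x⃗.c is a subterm of s (in the sense of ⊵), where the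
  -- binder prefix x⃗ (all binders above c, including those of s) is
  -- recorded by e.
  data OccT {Γ} : ∀ {τ} → Tm Γ τ → ∀ {Ξ a} → Γ ⊑ Ξ → Bd Ξ a → Set
  data OccB {Γ} : ∀ {a} → Bd Γ a → ∀ {Ξ a'} → Γ ⊑ Ξ → Bd Ξ a' → Set
  data OccT {Γ} where
    lamO : ∀ {σs a Ξ a'} {b : Bd (σs ++ Γ) a} {e : (σs ++ Γ) ⊑ Ξ} {c : Bd Ξ a'} →
           OccB b e c → OccT (lam b) (step σs base ⊙ e) c
  data OccB {Γ} where
    hereO : ∀ {a} {b : Bd Γ a} → OccB b base b
    argO  : ∀ {σ σs a Ξ a'} {h : Head Γ (σs ⇒ a)} {ts : Args Γ σs} {t : Tm Γ σ}
              {e : Γ ⊑ Ξ} {c : Bd Ξ a'} → t ∈ₐ ts → OccT t e c → OccB (h ∙ ts) e c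

  -- Expanded terms:  x⃗,y⃗. h(s₁,…,sₘ, y₁↓,…,y_k↓)  with h, s⃗ not mentioning y⃗
  -- (expressed by h, s⃗ living in the context without y⃗, weakened).

  expandedForm : ∀ {Ξ σs} (ρs : Ctx) {a} → Head Ξ ((σs ++ ρs) ⇒ a) → Args Ξ σs →
                 Tm Ξ (ρs ⇒ a)
  expandedForm ρs h ss =
    lam (renH (wkR ρs) h ∙ (renA (wkR ρs) ss ++ₐ ηs ρs (injL ρs)))

  Expanded : ∀ {Ξ τ} → Tm Ξ τ → Set
  Expanded {Ξ} {ρs ⇒ a} t =
    Σ Ctx λ σs → Σ (Head Ξ ((σs ++ ρs) ⇒ a)) λ h → Σ (Args Ξ σs) λ ss →
      t ≡ expandedForm ρs h ss

  infix 4 _⊵E_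
  _⊵E_ : ∀ {Ξ σ τ} → Tm Ξ σ → Tm Ξ τ → Set
  _⊵E_ {Ξ} {σ} {ρs ⇒ a} s t =
    Σ Ctx λ σs → Σ (Head Ξ ((σs ++ ρs) ⇒ a)) λ h → Σ (Args Ξ σs) λ ss →
      (t ≡ expandedForm ρs h ss) ×
      (Σ Ctx λ Ξ' → Σ (Ξ ⊑ Ξ') λ e → Σ (Args Ξ' ρs) λ rest →
         OccT s e (renH (wkE e) h ∙ (renA (wkE e) ss ++ₐ rest)))

  -- conditions (i)–(iii) on the arguments t⃗ of a subterm x⃗.y(t⃗)
  -- (x⃗ recorded by e : Γ ⊑ Ξ, so the variables outside x⃗ are wkE e z)
  DHPArgs : ∀ {Γ Ξ σs} → Γ ⊑ Ξ → Args Ξ σs → Set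
  DHPArgs {Γ} {Ξ} {σs} e ts = ∀ (i : Fin (length σs)) →
      -- (i)  ∅ ≠ fv(tᵢ) ⊆ {x⃗}
      ((Σ Type λ ρ → Σ (Ξ ∋ ρ) λ z → FvT z (ts ! i)) ×
       (∀ {ρ} (z : Γ ∋ ρ) → ¬ FvT (wkE e z) (ts ! i)))
    × Expanded (ts ! i)
    × (∀ (j : Fin (length σs)) → i ≢ j → ¬ ((ts ! i) ⊵E (ts ! j)))

  -- every subterm x⃗.y(t⃗) of s with y ∉ x⃗ satisfies (i)–(iii)
  DHP : ∀ {Γ τ} → Tm Γ τ → Set
  DHP {Γ} s = ∀ {Ξ σs a} (e : Γ ⊑ Ξ) (y : Γ ∋ (σs ⇒ a)) (ts : Args Ξ σs) →
              OccT s e (var (wkE e y) ∙ ts) → DHPArgs e ts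

{-# OPTIONS --safe #-}
-- Let y(t⃗) be a subterm of s with y ∈ dom θ and θ(y) = z⃗.w.  By the DHP conditions the t_k
-- mention only bound variables, so θ leaves them unchanged, and they are expanded, i.e. each t_k
-- is the expansion of a partial application p_k = h_k(s⃗_k).  Hereditary substitution of such
-- expansions for z⃗ in w creates no redex: it replaces every head z_k by p_k and appends the
-- arguments.  So every subterm of y(t⃗)θ with a free head is the image of a subterm of w with a
-- free head (it cannot lie inside a p_k, whose free variables are all bound), and conditions
-- (i)-(iii) transfer from w: (i) since each p_k has free variables, all of them bound; (ii) since
-- images of expanded terms are expanded; (iii) since z⃗ ↦ p⃗ is injective on terms and reflects
-- embeddings of expanded terms, which is condition (iii) for t⃗ together with the size argument
-- that no p_k embeds into one of its own arguments.

module Submission where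

open import Data.Empty using (⊥; ⊥-elim)
open import Data.Fin using (Fin; zero; suc)
import Data.Fin.Properties as Fin
open import Data.List using (List; []; _∷_; _++_; length; lookup)
open import Data.List.Properties using (++-assoc; ++-identityʳ; ++-cancelʳ; ∷-injectiveˡ; ∷-injectiveʳ)
open import Data.Maybe using (just; nothing)
open import Data.Maybe.Properties using (just-injective)
open import Data.Nat as ℕ using (ℕ; _+_; _≤_; s≤s)
open import Data.Nat.Properties using (≤-refl; ≤-trans; ≤-reflexive; m≤m+n; m≤n+m; n≤1+n; <-irrefl)
open import Data.Product using (Σ; _×_; _,_; proj₁; proj₂; map₂)
open import Data.Sum as Sum using (_⊎_; inj₁; inj₂)
open import Relation.Nullary using (¬_)
open import Relation.Binary.PropositionalEquality
open import Relation.Binary.HeterogeneousEquality as H using (_≅_)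

open import Defs

module _ (S : Set) (F : Ty S → Set) where
  open Terms S F

  infix 4 _≗R_
  _≗R_ : ∀ {Γ Δ} → Ren Γ Δ → Ren Γ Δ → Set
  ρ ≗R ρ' = ∀ {τ} (x : _ ∋ τ) → ρ x ≡ ρ' x

  idR : ∀ {Γ} → Ren Γ Γ
  idR x = x

  _∘R_ : ∀ {Γ Δ Θ} → Ren Δ Θ → Ren Γ Δ → Ren Γ Θ
  (ρ₂ ∘R ρ₁) x = ρ₂ (ρ₁ x)

  liftR-ext : ∀ {Γ Δ} (σs : Ctx) {ρ ρ' : Ren Γ Δ} → ρ ≗R ρ' → liftR σs ρ ≗R liftR σs ρ'
  liftR-ext [] eq x = eq x
  liftR-ext (σ ∷ σs) eq here = refl
  liftR-ext (σ ∷ σs) eq (there x) = cong there (liftR-ext σs eq x)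

  renH-ext : ∀ {Γ Δ τ} {ρ ρ' : Ren Γ Δ} → ρ ≗R ρ' → (h : Head Γ τ) → renH ρ h ≡ renH ρ' h
  renH-ext eq (var x) = cong var (eq x)
  renH-ext eq (fun f) = refl

  renT-ext : ∀ {Γ Δ τ} {ρ ρ' : Ren Γ Δ} → ρ ≗R ρ' → (t : Tm Γ τ) → renT ρ t ≡ renT ρ' t
  renB-ext : ∀ {Γ Δ a} {ρ ρ' : Ren Γ Δ} → ρ ≗R ρ' → (b : Bd Γ a) → renB ρ b ≡ renB ρ' b
  renA-ext : ∀ {Γ Δ σs} {ρ ρ' : Ren Γ Δ} → ρ ≗R ρ' → (ts : Args Γ σs) → renA ρ ts ≡ renA ρ' ts
  renT-ext eq (lam {σs} b) = cong lam (renB-ext (liftR-ext σs eq) b)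
  renB-ext eq (h ∙ ts) = cong₂ _∙_ (renH-ext eq h) (renA-ext eq ts)
  renA-ext eq nil = refl
  renA-ext eq (t ∷ₐ ts) = cong₂ _∷ₐ_ (renT-ext eq t) (renA-ext eq ts)

  liftR-id : ∀ {Γ} (σs : Ctx) {ρ : Ren Γ Γ} → ρ ≗R idR → liftR σs ρ ≗R idR
  liftR-id [] eq x = eq x
  liftR-id (σ ∷ σs) eq here = refl
  liftR-id (σ ∷ σs) eq (there x) = cong there (liftR-id σs eq x)

  renH-id : ∀ {Γ τ} {ρ : Ren Γ Γ} → ρ ≗R idR → (h : Head Γ τ) → renH ρ h ≡ h
  renH-id eq (var x) = cong var (eq x)
  renH-id eq (fun f) = refl

  renT-id : ∀ {Γ τ} {ρ : Ren Γ Γ} → ρ ≗R idR → (t : Tm Γ τ) → renT ρ t ≡ t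
  renB-id : ∀ {Γ a} {ρ : Ren Γ Γ} → ρ ≗R idR → (b : Bd Γ a) → renB ρ b ≡ b
  renA-id : ∀ {Γ σs} {ρ : Ren Γ Γ} → ρ ≗R idR → (ts : Args Γ σs) → renA ρ ts ≡ ts
  renT-id eq (lam {σs} b) = cong lam (renB-id (liftR-id σs eq) b)
  renB-id eq (h ∙ ts) = cong₂ _∙_ (renH-id eq h) (renA-id eq ts)
  renA-id eq nil = refl
  renA-id eq (t ∷ₐ ts) = cong₂ _∷ₐ_ (renT-id eq t) (renA-id eq ts)

  liftR-comp : ∀ {Γ Δ Θ} (σs : Ctx) (ρ₂ : Ren Δ Θ) (ρ₁ : Ren Γ Δ) →
               liftR σs (ρ₂ ∘R ρ₁) ≗R (liftR σs ρ₂ ∘R liftR σs ρ₁)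
  liftR-comp [] ρ₂ ρ₁ x = refl
  liftR-comp (σ ∷ σs) ρ₂ ρ₁ here = refl
  liftR-comp (σ ∷ σs) ρ₂ ρ₁ (there x) = cong there (liftR-comp σs ρ₂ ρ₁ x)

  renH-comp : ∀ {Γ Δ Θ τ} (ρ₂ : Ren Δ Θ) (ρ₁ : Ren Γ Δ) (h : Head Γ τ) →
              renH ρ₂ (renH ρ₁ h) ≡ renH (ρ₂ ∘R ρ₁) h
  renH-comp ρ₂ ρ₁ (var x) = refl
  renH-comp ρ₂ ρ₁ (fun f) = refl

  renT-comp : ∀ {Γ Δ Θ τ} (ρ₂ : Ren Δ Θ) (ρ₁ : Ren Γ Δ) (t : Tm Γ τ) →
              renT ρ₂ (renT ρ₁ t) ≡ renT (ρ₂ ∘R ρ₁) t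
  renB-comp : ∀ {Γ Δ Θ a} (ρ₂ : Ren Δ Θ) (ρ₁ : Ren Γ Δ) (b : Bd Γ a) →
              renB ρ₂ (renB ρ₁ b) ≡ renB (ρ₂ ∘R ρ₁) b
  renA-comp : ∀ {Γ Δ Θ σs} (ρ₂ : Ren Δ Θ) (ρ₁ : Ren Γ Δ) (ts : Args Γ σs) →
              renA ρ₂ (renA ρ₁ ts) ≡ renA (ρ₂ ∘R ρ₁) ts
  renT-comp ρ₂ ρ₁ (lam {σs} b) =
    cong lam (trans (renB-comp (liftR σs ρ₂) (liftR σs ρ₁) b)
                    (sym (renB-ext (liftR-comp σs ρ₂ ρ₁) b)))
  renB-comp ρ₂ ρ₁ (h ∙ ts) = cong₂ _∙_ (renH-comp ρ₂ ρ₁ h) (renA-comp ρ₂ ρ₁ ts)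
  renA-comp ρ₂ ρ₁ nil = refl
  renA-comp ρ₂ ρ₁ (t ∷ₐ ts) = cong₂ _∷ₐ_ (renT-comp ρ₂ ρ₁ t) (renA-comp ρ₂ ρ₁ ts)

  liftR-wkR : ∀ {Γ Δ} (σs : Ctx) (ρ : Ren Γ Δ) {τ} (x : Γ ∋ τ) →
              liftR σs ρ (wkR σs x) ≡ wkR σs (ρ x)
  liftR-wkR [] ρ x = refl
  liftR-wkR (σ ∷ σs) ρ x = cong there (liftR-wkR σs ρ x)

  liftR-injL : ∀ {Γ Δ} (σs : Ctx) (ρ : Ren Γ Δ) {τ} (x : σs ∋ τ) →
               liftR σs ρ (injL σs x) ≡ injL σs x
  liftR-injL (σ ∷ σs) ρ here = refl
  liftR-injL (σ ∷ σs) ρ (there x) = cong there (liftR-injL σs ρ x)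

  renA-++ : ∀ {Γ Δ σs ρs} (ρ : Ren Γ Δ) (as : Args Γ σs) (bs : Args Γ ρs) →
            renA ρ (as ++ₐ bs) ≡ renA ρ as ++ₐ renA ρ bs
  renA-++ ρ nil bs = refl
  renA-++ ρ (a ∷ₐ as) bs = cong (renT ρ a ∷ₐ_) (renA-++ ρ as bs)

  ηs-ext : ∀ {Γ} (σs : Ctx) {f g : Ren σs Γ} → f ≗R g → ηs σs f ≡ ηs σs g
  ηs-ext [] eq = refl
  ηs-ext (σ ∷ σs) eq = cong₂ _∷ₐ_ (cong η (eq here)) (ηs-ext σs (λ x → eq (there x)))

  renT-η : ∀ {Γ Δ} τ (ρ : Ren Γ Δ) (x : Γ ∋ τ) → renT ρ (η x) ≡ η (ρ x)
  renA-ηs : ∀ {Γ Δ} (σs : Ctx) (ρ : Ren Γ Δ) (f : Ren σs Γ) → renA ρ (ηs σs f) ≡ ηs σs (ρ ∘R f)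
  renT-η (σs ⇒ a) ρ x =
    cong lam (cong₂ _∙_ (cong var (liftR-wkR σs ρ x))
      (trans (renA-ηs σs (liftR σs ρ) (injL σs)) (ηs-ext σs (liftR-injL σs ρ))))
  renA-ηs [] ρ f = refl
  renA-ηs (σ ∷ σs) ρ f = cong₂ _∷ₐ_ (renT-η σ ρ (f here)) (renA-ηs σs ρ (λ x → f (there x)))

  data BlockView (σs : Ctx) {Δ τ} : σs ++ Δ ∋ τ → Set where
    inBlock : (i : σs ∋ τ) → BlockView σs (injL σs i)
    inOuter : (x : Δ ∋ τ) → BlockView σs (wkR σs x)

  blockView : ∀ (σs : Ctx) {Δ τ} (z : σs ++ Δ ∋ τ) → BlockView σs z
  blockView [] z = inOuter z
  blockView (σ ∷ σs) here = inBlock here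
  blockView (σ ∷ σs) (there z) with blockView σs z
  ... | inBlock i = inBlock (there i)
  ... | inOuter x = inOuter x

  ∙-≅ : ∀ {Γ a} {L L' : Ctx} {h : Head Γ (L ⇒ a)} {h' : Head Γ (L' ⇒ a)}
          {as : Args Γ L} {as' : Args Γ L'} → L ≡ L' → h ≅ h' → as ≅ as' → h ∙ as ≡ h' ∙ as'
  ∙-≅ refl H.refl H.refl = refl

  ∷ₐ-≅ : ∀ {Γ σ} {L L' : Ctx} {t : Tm Γ σ} {as : Args Γ L} {as' : Args Γ L'} →
         L ≡ L' → as ≅ as' → (t ∷ₐ as) ≅ (t ∷ₐ as')
  ∷ₐ-≅ refl H.refl = H.refl

  ++ₐ-assoc : ∀ {Γ σs ρs πs} (as : Args Γ σs) (bs : Args Γ ρs) (cs : Args Γ πs) →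
              ((as ++ₐ bs) ++ₐ cs) ≅ (as ++ₐ (bs ++ₐ cs))
  ++ₐ-assoc nil bs cs = H.refl
  ++ₐ-assoc {σs = σ ∷ σs} {ρs} {πs} (a ∷ₐ as) bs cs = ∷ₐ-≅ (++-assoc σs ρs πs) (++ₐ-assoc as bs cs)

  castH : ∀ {Γ a} {L L' : Ctx} → L ≡ L' → Head Γ (L ⇒ a) → Head Γ (L' ⇒ a)
  castH refl h = h

  castH-≅ : ∀ {Γ a} {L L' : Ctx} (eq : L ≡ L') (h : Head Γ (L ⇒ a)) → castH eq h ≅ h
  castH-≅ refl h = H.refl

  renH-castH : ∀ {Γ Δ a} {L L' : Ctx} (ρ : Ren Γ Δ) (eq : L ≡ L') (h : Head Γ (L ⇒ a)) →
               renH ρ (castH eq h) ≡ castH eq (renH ρ h)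
  renH-castH ρ refl h = refl

  -- η-laws of hereditary substitution

  classify-delLift-wkR : ∀ (σs : Ctx) {Ξ σ Ξ' τ} (d : Del Ξ σ Ξ') (x : Ξ ∋ τ) →
    classify (delLift σs d) (wkR σs x) ≡ Sum.map₁ (wkR σs) (classify d x)
  classify-delLift-wkR [] d x with classify d x
  ... | inj₁ y = refl
  ... | inj₂ e = refl
  classify-delLift-wkR (σ ∷ σs) d x rewrite classify-delLift-wkR σs d x with classify d x
  ... | inj₁ y = refl
  ... | inj₂ e = refl

  classify-delLift-injL : ∀ (σs : Ctx) {Ξ σ Ξ' τ} (d : Del Ξ σ Ξ') (x : σs ∋ τ) →
    classify (delLift σs d) (injL σs x) ≡ inj₁ (injL σs x)
  classify-delLift-injL (σ ∷ σs) d here = refl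
  classify-delLift-injL (σ ∷ σs) d (there x) = cong (Sum.map₁ there) (classify-delLift-injL σs d x)

  Avoids : ∀ {Δ Ξ σ Ξ'} → Del Ξ σ Ξ' → Ren Δ Ξ → Ren Δ Ξ' → Set
  Avoids d ρ ρ' = ∀ {τ} (x : _ ∋ τ) → classify d (ρ x) ≡ inj₁ (ρ' x)

  avoids-lift : ∀ (σs : Ctx) {Δ Ξ σ Ξ'} {d : Del Ξ σ Ξ'} {ρ : Ren Δ Ξ} {ρ' : Ren Δ Ξ'} →
    Avoids d ρ ρ' → Avoids (delLift σs d) (liftR σs ρ) (liftR σs ρ')
  avoids-lift [] hyp x = hyp x
  avoids-lift (σ ∷ σs) hyp here = refl
  avoids-lift (σ ∷ σs) hyp (there x) = cong (Sum.map₁ there) (avoids-lift σs hyp x)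

  sub1T-avoiding : ∀ {Δ Ξ σ Ξ' τ} (d : Del Ξ σ Ξ') (ρ : Ren Δ Ξ) (ρ' : Ren Δ Ξ') → Avoids d ρ ρ' →
         (t : Tm Δ τ) (u : Tm Ξ' σ) → sub1T d (renT ρ t) u ≡ renT ρ' t
  sub1B-avoiding : ∀ {Δ Ξ σ Ξ' a} (d : Del Ξ σ Ξ') (ρ : Ren Δ Ξ) (ρ' : Ren Δ Ξ') → Avoids d ρ ρ' →
         (b : Bd Δ a) (u : Tm Ξ' σ) → sub1B d (renB ρ b) u ≡ renB ρ' b
  sub1A-avoiding : ∀ {Δ Ξ σ Ξ' σs} (d : Del Ξ σ Ξ') (ρ : Ren Δ Ξ) (ρ' : Ren Δ Ξ') → Avoids d ρ ρ' →
         (ts : Args Δ σs) (u : Tm Ξ' σ) → sub1A d (renA ρ ts) u ≡ renA ρ' ts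
  sub1T-avoiding d ρ ρ' hyp (lam {σs} b) u =
    cong lam (sub1B-avoiding (delLift σs d) (liftR σs ρ) (liftR σs ρ') (avoids-lift σs hyp) b _)
  sub1B-avoiding d ρ ρ' hyp (fun f ∙ ts) u = cong (fun f ∙_) (sub1A-avoiding d ρ ρ' hyp ts u)
  sub1B-avoiding d ρ ρ' hyp (var x ∙ ts) u rewrite hyp x = cong (var (ρ' x) ∙_) (sub1A-avoiding d ρ ρ' hyp ts u)
  sub1A-avoiding d ρ ρ' hyp nil u = refl
  sub1A-avoiding d ρ ρ' hyp (t ∷ₐ ts) u = cong₂ _∷ₐ_ (sub1T-avoiding d ρ ρ' hyp t u)
      (sub1A-avoiding d ρ ρ' hyp ts u)

  sub1A-++ : ∀ {Ξ σ Ξ' σs ρs} (d : Del Ξ σ Ξ') (as : Args Ξ σs) (bs : Args Ξ ρs) (u : Tm Ξ' σ) →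
             sub1A d (as ++ₐ bs) u ≡ sub1A d as u ++ₐ sub1A d bs u
  sub1A-++ d nil bs u = refl
  sub1A-++ d (a ∷ₐ as) bs u = cong (sub1T d a u ∷ₐ_) (sub1A-++ d as bs u)

  sub1A-ηs : ∀ (σs : Ctx) {Ξ σ Ξ'} (d : Del Ξ σ Ξ') (u : Tm (σs ++ Ξ') σ) →
            sub1A (delLift σs d) (ηs σs (injL σs)) u ≡ ηs σs (injL σs)
  sub1A-ηs σs d u =
    trans (cong (λ z → sub1A (delLift σs d) z u) (sym (renA-ηs σs (injL σs) idR)))
    (trans (sub1A-avoiding (delLift σs d) (injL σs) (injL σs) (classify-delLift-injL σs d) (ηs σs idR) u)
           (renA-ηs σs (injL σs) idR))

  resolve : ∀ {Ξ' σ τ} → (Ξ' ∋ τ) ⊎ (τ ≡ σ) → Ξ' ∋ σ → Ξ' ∋ τ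
  resolve (inj₁ x) y = x
  resolve (inj₂ refl) y = y

  redirect : ∀ {Ξ σ Ξ'} → Del Ξ σ Ξ' → Ξ' ∋ σ → Ren Ξ Ξ'
  redirect d y x = resolve (classify d x) y

  resolve-map : ∀ {Ξ' Ξ'' σ τ} (f : Ren Ξ' Ξ'') (c : (Ξ' ∋ τ) ⊎ (τ ≡ σ)) (y : Ξ' ∋ σ) →
               resolve (Sum.map₁ f c) (f y) ≡ f (resolve c y)
  resolve-map f (inj₁ x) y = refl
  resolve-map f (inj₂ refl) y = refl

  redirect-lift : ∀ (σs : Ctx) {Ξ σ Ξ'} (d : Del Ξ σ Ξ') (y : Ξ' ∋ σ) →
              redirect (delLift σs d) (wkR σs y) ≗R liftR σs (redirect d y)
  redirect-lift [] d y x = refl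
  redirect-lift (σ ∷ σs) d y here = refl
  redirect-lift (σ ∷ σs) d y (there x) =
    trans (resolve-map there (classify (delLift σs d) x) (wkR σs y)) (cong there (redirect-lift σs d y x))

  collapse : ∀ (σs : Ctx) {Δ} → Ren σs Δ → Ren (σs ++ Δ) Δ
  collapse [] f x = x
  collapse (σ ∷ σs) f here = f here
  collapse (σ ∷ σs) f (there x) = collapse σs (λ z → f (there z)) x

  collapse-wkR : ∀ (σs : Ctx) {Δ} (f : Ren σs Δ) {τ} (x : Δ ∋ τ) → collapse σs f (wkR σs x) ≡ x
  collapse-wkR [] f x = refl
  collapse-wkR (σ ∷ σs) f x = collapse-wkR σs (λ z → f (there z)) x

  collapse-injL : ∀ (σs : Ctx) {Δ} (f : Ren σs Δ) {τ} (x : σs ∋ τ) → collapse σs f (injL σs x) ≡ f x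
  collapse-injL (σ ∷ σs) f here = refl
  collapse-injL (σ ∷ σs) f (there x) = collapse-injL σs (λ z → f (there z)) x

  sub1B-wkR-head : ∀ {Ξ L a τ} (τs : Ctx) (h : Head Ξ (L ⇒ a)) (args : Args ((τ ∷ τs) ++ Ξ) L)
                   (u : Tm (τs ++ Ξ) τ) →
            sub1B dhere (renH (wkR (τ ∷ τs)) h ∙ args) u ≡ renH (wkR τs) h ∙ sub1A dhere args u
  sub1B-wkR-head τs (var x) args u = refl
  sub1B-wkR-head τs (fun f) args u = refl

  sub1T-η-deleted : ∀ σ {Ξ Ξ'} (d : Del Ξ σ Ξ') (x : Ξ ∋ σ) → classify d x ≡ inj₂ refl →
       (u : Tm Ξ' σ) → sub1T d (η x) u ≡ u
  inst-ηs : ∀ (σs : Ctx) {Δ a} (b : Bd (σs ++ Δ) a) (f : Ren σs Δ) →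
       inst σs b (ηs σs f) ≡ renB (collapse σs f) b
  sub1T-η : ∀ τ {Ξ Ξ' τ'} (d : Del Ξ τ Ξ') (y : Ξ' ∋ τ) (t : Tm Ξ τ') → sub1T d t (η y) ≡ renT (redirect d y) t
  sub1B-η : ∀ τ {Ξ Ξ' a} (d : Del Ξ τ Ξ') (y : Ξ' ∋ τ) (b : Bd Ξ a) → sub1B d b (η y) ≡ renB (redirect d y) b
  sub1A-η : ∀ τ {Ξ Ξ' σs} (d : Del Ξ τ Ξ') (y : Ξ' ∋ τ) (ts : Args Ξ σs) →
            sub1A d ts (η y) ≡ renA (redirect d y) ts
  inst-expandedForm : ∀ (τs : Ctx) {Ξ σs a} (h : Head Ξ ((σs ++ τs) ⇒ a)) (ss : Args Ξ σs) (qs : Args Ξ τs) →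
       inst τs (renH (wkR τs) h ∙ (renA (wkR τs) ss ++ₐ ηs τs (injL τs))) qs ≡ h ∙ (ss ++ₐ qs)

  sub1T-η-deleted (σs ⇒ a) d x eq (lam w)
    rewrite classify-delLift-wkR σs d x | eq
          | sub1A-ηs σs d (renT (wkR σs) (lam w)) =
    cong lam (trans (inst-ηs σs (renB (liftR σs (wkR σs)) w) (injL σs))
             (trans (renB-comp (collapse σs (injL σs)) (liftR σs (wkR σs)) w)
                    (renB-id pt w)))
    where
    pt : (collapse σs (injL σs) ∘R liftR σs (wkR σs)) ≗R idR
    pt z with blockView σs z
    ... | inBlock i = trans (cong (collapse σs (injL σs)) (liftR-injL σs (wkR σs) i))
        (collapse-injL σs (injL σs) i)
    ... | inOuter x = trans (cong (collapse σs (injL σs)) (liftR-wkR σs (wkR σs) x))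
        (collapse-wkR σs (injL σs) (wkR σs x))

  inst-ηs [] b f = sym (renB-id (λ x → refl) b)
  inst-ηs (σ ∷ σs) b f
    rewrite renT-η σ (wkR σs) (f here)
          | sub1B-η σ dhere (wkR σs (f here)) b =
    trans (inst-ηs σs (renB (redirect dhere (wkR σs (f here))) b) (λ z → f (there z)))
    (trans (renB-comp (collapse σs (λ z → f (there z))) (redirect dhere (wkR σs (f here))) b)
           (renB-ext pt b))
    where
    pt : (collapse σs (λ z → f (there z)) ∘R redirect dhere (wkR σs (f here))) ≗R collapse (σ ∷ σs) f
    pt here = collapse-wkR σs (λ z → f (there z)) (f here)
    pt (there x) = refl

  sub1T-η τ d y (lam {σs} b)
    rewrite renT-η τ (wkR σs) y =
    cong lam (trans (sub1B-η τ (delLift σs d) (wkR σs y) b) (renB-ext (redirect-lift σs d y) b))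
  sub1B-η τ d y (fun f ∙ ts) = cong (fun f ∙_) (sub1A-η τ d y ts)
  sub1B-η τ d y (var x ∙ ts) with classify d x
  ... | inj₁ x' = cong (var x' ∙_) (sub1A-η τ d y ts)
  sub1B-η (τs ⇒ a) d y (var x ∙ ts) | inj₂ refl
    rewrite sub1A-η (τs ⇒ a) d y ts = inst-expandedForm τs (var y) nil (renA (redirect d y) ts)
  sub1A-η τ d y nil = refl
  sub1A-η τ d y (t ∷ₐ ts) = cong₂ _∷ₐ_ (sub1T-η τ d y t) (sub1A-η τ d y ts)

  inst-expandedForm [] h ss nil =
    cong₂ _∙_ (renH-id (λ x → refl) h) (cong (_++ₐ nil) (renA-id (λ x → refl) ss))
  inst-expandedForm (τ ∷ τs) {Ξ} {σs} {a} h ss (q ∷ₐ qs) =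
    trans (cong (λ z → inst τs z qs) peel)
    (trans (cong (λ z → inst τs z qs) regroup)
    (trans (inst-expandedForm τs hAssoc (ss ++ₐ (q ∷ₐ nil)) qs)
           (∙-≅ (++-assoc σs (τ ∷ []) τs) (castH-≅ eqL h) (++ₐ-assoc ss (q ∷ₐ nil) qs))))
    where
    q' = renT (wkR τs) q
    eqL : σs ++ (τ ∷ τs) ≡ (σs ++ (τ ∷ [])) ++ τs
    eqL = sym (++-assoc σs (τ ∷ []) τs)
    hAssoc : Head Ξ (((σs ++ (τ ∷ [])) ++ τs) ⇒ a)
    hAssoc = castH eqL h
    peelArgs : sub1A dhere (renA (wkR (τ ∷ τs)) ss ++ₐ ηs (τ ∷ τs) (injL (τ ∷ τs))) q'
             ≡ renA (wkR τs) ss ++ₐ (q' ∷ₐ ηs τs (injL τs))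
    peelArgs = trans (sub1A-++ dhere (renA (wkR (τ ∷ τs)) ss) _ q')
             (cong₂ _++ₐ_ (sub1A-avoiding dhere (wkR (τ ∷ τs)) (wkR τs) (λ x → refl) ss q')
                (cong₂ _∷ₐ_ (sub1T-η-deleted τ dhere here refl q')
                   (trans (cong (λ z → sub1A dhere z q') (sym (renA-ηs τs there (injL τs))))
                   (trans (sub1A-avoiding dhere there idR (λ x → refl) (ηs τs (injL τs)) q')
                          (renA-id (λ x → refl) _)))))
    peel : sub1B dhere (renH (wkR (τ ∷ τs)) h ∙
              (renA (wkR (τ ∷ τs)) ss ++ₐ ηs (τ ∷ τs) (injL (τ ∷ τs)))) q'
            ≡ renH (wkR τs) h ∙ (renA (wkR τs) ss ++ₐ (q' ∷ₐ ηs τs (injL τs)))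
    peel = trans (sub1B-wkR-head τs h _ q') (cong (renH (wkR τs) h ∙_) peelArgs)
    regroup : renH (wkR τs) h ∙ (renA (wkR τs) ss ++ₐ (q' ∷ₐ ηs τs (injL τs)))
            ≡ renH (wkR τs) hAssoc ∙ (renA (wkR τs) (ss ++ₐ (q ∷ₐ nil)) ++ₐ ηs τs (injL τs))
    regroup = ∙-≅ eqL
              (H.sym (H.trans (H.≡-to-≅ (renH-castH (wkR τs) eqL h)) (castH-≅ eqL _)))
              (H.sym (H.trans (H.≡-to-≅ (cong (_++ₐ ηs τs (injL τs)) (renA-++ (wkR τs) ss (q ∷ₐ nil))))
                              (++ₐ-assoc (renA (wkR τs) ss) (q' ∷ₐ nil) (ηs τs (injL τs)))))

  -- Partial applications

  -- papp h s⃗ stands for the expanded term y⃗.h(s⃗, y⃗↓) (see expand); substituting partial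
  -- applications for variables (hrT) never creates a redex.
  data PApp (Δ : Ctx) : Type → Set where
    papp : ∀ {σs τs a} → Head Δ ((σs ++ τs) ⇒ a) → Args Δ σs → PApp Δ (τs ⇒ a)

  PSub : Ctx → Ctx → Set
  PSub Δ Δ' = ∀ {τ} → Δ ∋ τ → PApp Δ' τ

  infix 4 _≗P_
  _≗P_ : ∀ {Δ Δ'} → PSub Δ Δ' → PSub Δ Δ' → Set
  R ≗P R' = ∀ {τ} (x : _ ∋ τ) → R x ≡ R' x

  varP : ∀ {Δ τ} → Δ ∋ τ → PApp Δ τ
  varP {τ = τs ⇒ a} x = papp {σs = []} (var x) nil

  headP : ∀ {Δ τ} → Head Δ τ → PApp Δ τ
  headP {τ = τs ⇒ a} h = papp {σs = []} h nil

  appP : ∀ {Δ τs a} → PApp Δ (τs ⇒ a) → Args Δ τs → Bd Δ a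
  appP (papp h ss) ts = h ∙ (ss ++ₐ ts)

  renP : ∀ {Δ Δ' τ} → Ren Δ Δ' → PApp Δ τ → PApp Δ' τ
  renP ρ (papp h ss) = papp (renH ρ h) (renA ρ ss)

  liftP : ∀ {Δ Δ'} (σs : Ctx) → PSub Δ Δ' → PSub (σs ++ Δ) (σs ++ Δ')
  liftP [] R x = R x
  liftP (σ ∷ σs) R here = varP here
  liftP (σ ∷ σs) R (there x) = renP there (liftP σs R x)

  hrH : ∀ {Δ Δ' τ} → PSub Δ Δ' → Head Δ τ → PApp Δ' τ
  hrH R (var x) = R x
  hrH R (fun f) = headP (fun f)

  hrT : ∀ {Δ Δ' τ} → PSub Δ Δ' → Tm Δ τ → Tm Δ' τ
  hrB : ∀ {Δ Δ' a} → PSub Δ Δ' → Bd Δ a → Bd Δ' a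
  hrA : ∀ {Δ Δ' σs} → PSub Δ Δ' → Args Δ σs → Args Δ' σs
  hrT R (lam {σs} b) = lam (hrB (liftP σs R) b)
  hrB R (h ∙ ts) = appP (hrH R h) (hrA R ts)
  hrA R nil = nil
  hrA R (t ∷ₐ ts) = hrT R t ∷ₐ hrA R ts

  supplyP : ∀ {Δ σs τs a} → PApp Δ ((σs ++ τs) ⇒ a) → Args Δ σs → PApp Δ (τs ⇒ a)
  supplyP {σs = σs} {τs} (papp {σs₂} h₂ ss₂) ss = papp (castH (sym (++-assoc σs₂ σs τs)) h₂) (ss₂ ++ₐ ss)

  hrP : ∀ {Δ Δ' τ} → PSub Δ Δ' → PApp Δ τ → PApp Δ' τ
  hrP R (papp h ss) = supplyP (hrH R h) (hrA R ss)

  expand : ∀ {Δ τ} → PApp Δ τ → Tm Δ τ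
  expand (papp {τs = τs} h ss) = expandedForm τs h ss

  papp-≅ : ∀ {Δ τs a} {σs σs' : Ctx} {h : Head Δ ((σs ++ τs) ⇒ a)} {h' : Head Δ ((σs' ++ τs) ⇒ a)}
            {ss : Args Δ σs} {ss' : Args Δ σs'} → σs ≡ σs' → h ≅ h' → ss ≅ ss' → papp h ss ≡ papp h' ss'
  papp-≅ refl H.refl H.refl = refl

  ++ₐ-identityʳ : ∀ {Δ σs} (ss : Args Δ σs) → (ss ++ₐ nil) ≅ ss
  ++ₐ-identityʳ nil = H.refl
  ++ₐ-identityʳ {σs = σ ∷ σs} (s ∷ₐ ss) = ∷ₐ-≅ (++-identityʳ σs) (++ₐ-identityʳ ss)

  supplyP-nil : ∀ {Δ τs a} (p : PApp Δ (([] ++ τs) ⇒ a)) → supplyP {σs = []} p nil ≡ p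
  supplyP-nil {τs = τs} (papp {σs₂} h₂ ss₂) =
    papp-≅ (++-identityʳ σs₂) (castH-≅ (sym (++-assoc σs₂ [] τs)) h₂) (++ₐ-identityʳ ss₂)

  appP-supplyP : ∀ {Δ σs τs a} (p : PApp Δ ((σs ++ τs) ⇒ a)) (ss : Args Δ σs) (ts : Args Δ τs) →
               appP (supplyP p ss) ts ≡ appP p (ss ++ₐ ts)
  appP-supplyP {σs = σs} {τs} (papp {σs₂} h₂ ss₂) ss ts =
    ∙-≅ (++-assoc σs₂ σs τs) (castH-≅ (sym (++-assoc σs₂ σs τs)) h₂) (++ₐ-assoc ss₂ ss ts)

  hrA-++ : ∀ {Δ Δ' σs ρs} (R : PSub Δ Δ') (as : Args Δ σs) (bs : Args Δ ρs) →
           hrA R (as ++ₐ bs) ≡ hrA R as ++ₐ hrA R bs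
  hrA-++ R nil bs = refl
  hrA-++ R (a ∷ₐ as) bs = cong (hrT R a ∷ₐ_) (hrA-++ R as bs)

  hrB-appP : ∀ {Δ Δ' τs a} (R : PSub Δ Δ') (p : PApp Δ (τs ⇒ a)) (ts : Args Δ τs) →
             hrB R (appP p ts) ≡ appP (hrP R p) (hrA R ts)
  hrB-appP R (papp h ss) ts =
    trans (cong (appP (hrH R h)) (hrA-++ R ss ts)) (sym (appP-supplyP (hrH R h) (hrA R ss) (hrA R ts)))

  hrB-var : ∀ {Δ Δ' L a} {R : PSub Δ Δ'} {x : Δ ∋ (L ⇒ a)} {p : PApp Δ' (L ⇒ a)} (as : Args Δ L) →
            R x ≡ p → hrB R (var x ∙ as) ≡ appP p (hrA R as)
  hrB-var {R = R} as eq = cong (λ p → appP p (hrA R as)) eq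

  appP-hrP-var : ∀ {Δ Δ' σs τs a} {R : PSub Δ Δ'} {x : Δ ∋ ((σs ++ τs) ⇒ a)} {p : PApp Δ' ((σs ++ τs) ⇒ a)}
                 (ss : Args Δ σs) (ts : Args Δ' τs) →
                 R x ≡ p → appP (hrP R (papp (var x) ss)) ts ≡ appP p (hrA R ss ++ₐ ts)
  appP-hrP-var {R = R} {x} ss ts eq =
    trans (appP-supplyP (R x) (hrA R ss) ts) (cong (λ p → appP p (hrA R ss ++ₐ ts)) eq)

  renB-appP : ∀ {Δ Δ' τs a} (ρ : Ren Δ Δ') (p : PApp Δ (τs ⇒ a)) (ts : Args Δ τs) →
              renB ρ (appP p ts) ≡ appP (renP ρ p) (renA ρ ts)
  renB-appP ρ (papp h ss) ts = cong (renH ρ h ∙_) (renA-++ ρ ss ts)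

  renP-ext : ∀ {Δ Δ' τ} {ρ ρ' : Ren Δ Δ'} → ρ ≗R ρ' → (p : PApp Δ τ) → renP ρ p ≡ renP ρ' p
  renP-ext eq (papp h ss) = cong₂ papp (renH-ext eq h) (renA-ext eq ss)

  renP-comp : ∀ {Δ Δ' Δ'' τ} (ρ₂ : Ren Δ' Δ'') (ρ₁ : Ren Δ Δ') (p : PApp Δ τ) →
              renP ρ₂ (renP ρ₁ p) ≡ renP (ρ₂ ∘R ρ₁) p
  renP-comp ρ₂ ρ₁ (papp h ss) = cong₂ papp (renH-comp ρ₂ ρ₁ h) (renA-comp ρ₂ ρ₁ ss)

  renP-id : ∀ {Δ τ} {ρ : Ren Δ Δ} → ρ ≗R idR → (p : PApp Δ τ) → renP ρ p ≡ p
  renP-id eq (papp h ss) = cong₂ papp (renH-id eq h) (renA-id eq ss)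

  renP-supplyP : ∀ {Δ Δ' σs τs a} (ρ : Ren Δ Δ') (p : PApp Δ ((σs ++ τs) ⇒ a)) (ss : Args Δ σs) →
               renP ρ (supplyP p ss) ≡ supplyP (renP ρ p) (renA ρ ss)
  renP-supplyP {σs = σs} {τs} ρ (papp {σs₂} h₂ ss₂) ss =
    cong₂ papp (renH-castH ρ (sym (++-assoc σs₂ σs τs)) h₂) (renA-++ ρ ss₂ ss)

  liftP-ext : ∀ {Δ Δ'} (σs : Ctx) {R R' : PSub Δ Δ'} → R ≗P R' → liftP σs R ≗P liftP σs R'
  liftP-ext [] eq x = eq x
  liftP-ext ((τs₀ ⇒ a₀) ∷ σs) eq here = refl
  liftP-ext (σ ∷ σs) eq (there x) = cong (renP there) (liftP-ext σs eq x)

  hrH-ext : ∀ {Δ Δ' τ} {R R' : PSub Δ Δ'} → R ≗P R' → (h : Head Δ τ) → hrH R h ≡ hrH R' h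
  hrH-ext eq (var x) = eq x
  hrH-ext eq (fun f) = refl

  hrT-ext : ∀ {Δ Δ' τ} {R R' : PSub Δ Δ'} → R ≗P R' → (t : Tm Δ τ) → hrT R t ≡ hrT R' t
  hrB-ext : ∀ {Δ Δ' a} {R R' : PSub Δ Δ'} → R ≗P R' → (b : Bd Δ a) → hrB R b ≡ hrB R' b
  hrA-ext : ∀ {Δ Δ' σs} {R R' : PSub Δ Δ'} → R ≗P R' → (ts : Args Δ σs) → hrA R ts ≡ hrA R' ts
  hrT-ext eq (lam {σs} b) = cong lam (hrB-ext (liftP-ext σs eq) b)
  hrB-ext eq (h ∙ ts) = cong₂ appP (hrH-ext eq h) (hrA-ext eq ts)
  hrA-ext eq nil = refl
  hrA-ext eq (t ∷ₐ ts) = cong₂ _∷ₐ_ (hrT-ext eq t) (hrA-ext eq ts)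

  hrP-ext : ∀ {Δ Δ' τ} {R R' : PSub Δ Δ'} → R ≗P R' → (p : PApp Δ τ) → hrP R p ≡ hrP R' p
  hrP-ext eq (papp h ss) = cong₂ supplyP (hrH-ext eq h) (hrA-ext eq ss)

  liftP-id : ∀ {Δ} (σs : Ctx) {R : PSub Δ Δ} → R ≗P varP → liftP σs R ≗P varP
  liftP-id [] eq x = eq x
  liftP-id ((τs₀ ⇒ a₀) ∷ σs) eq here = refl
  liftP-id (σ ∷ σs) {R} eq (there {τ = τs ⇒ a} x) = cong (renP there) (liftP-id σs eq x)

  hrT-id : ∀ {Δ τ} {R : PSub Δ Δ} → R ≗P varP → (t : Tm Δ τ) → hrT R t ≡ t
  hrB-id : ∀ {Δ a} {R : PSub Δ Δ} → R ≗P varP → (b : Bd Δ a) → hrB R b ≡ b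
  hrA-id : ∀ {Δ σs} {R : PSub Δ Δ} → R ≗P varP → (ts : Args Δ σs) → hrA R ts ≡ ts
  hrT-id eq (lam {σs} b) = cong lam (hrB-id (liftP-id σs eq) b)
  hrB-id eq (var x ∙ ts) rewrite eq x = cong (var x ∙_) (hrA-id eq ts)
  hrB-id eq (fun f ∙ ts) = cong (fun f ∙_) (hrA-id eq ts)
  hrA-id eq nil = refl
  hrA-id eq (t ∷ₐ ts) = cong₂ _∷ₐ_ (hrT-id eq t) (hrA-id eq ts)

  hrP-id : ∀ {Δ τ} {R : PSub Δ Δ} → R ≗P varP → (p : PApp Δ τ) → hrP R p ≡ p
  hrP-id eq (papp (var x) ss) rewrite eq x = cong (papp (var x)) (hrA-id eq ss)
  hrP-id eq (papp (fun f) ss) = cong (papp (fun f)) (hrA-id eq ss)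

  _∘PR_ : ∀ {Δ Δ' Δ''} → PSub Δ' Δ'' → Ren Δ Δ' → PSub Δ Δ''
  (R ∘PR ρ) x = R (ρ x)

  liftP-liftR : ∀ {Δ Δ' Δ''} (σs : Ctx) (R : PSub Δ' Δ'') (ρ : Ren Δ Δ') →
                (liftP σs R ∘PR liftR σs ρ) ≗P liftP σs (R ∘PR ρ)
  liftP-liftR [] R ρ x = refl
  liftP-liftR ((τs₀ ⇒ a₀) ∷ σs) R ρ here = refl
  liftP-liftR (σ ∷ σs) R ρ (there x) = cong (renP there) (liftP-liftR σs R ρ x)

  hrH-ren : ∀ {Δ Δ' Δ'' τ} (R : PSub Δ' Δ'') (ρ : Ren Δ Δ') (h : Head Δ τ) →
            hrH R (renH ρ h) ≡ hrH (R ∘PR ρ) h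
  hrH-ren R ρ (var x) = refl
  hrH-ren R ρ (fun f) = refl

  hrT-ren : ∀ {Δ Δ' Δ'' τ} (R : PSub Δ' Δ'') (ρ : Ren Δ Δ') (t : Tm Δ τ) →
            hrT R (renT ρ t) ≡ hrT (R ∘PR ρ) t
  hrB-ren : ∀ {Δ Δ' Δ'' a} (R : PSub Δ' Δ'') (ρ : Ren Δ Δ') (b : Bd Δ a) →
            hrB R (renB ρ b) ≡ hrB (R ∘PR ρ) b
  hrA-ren : ∀ {Δ Δ' Δ'' σs} (R : PSub Δ' Δ'') (ρ : Ren Δ Δ') (ts : Args Δ σs) →
            hrA R (renA ρ ts) ≡ hrA (R ∘PR ρ) ts
  hrT-ren R ρ (lam {σs} b) =
    cong lam (trans (hrB-ren (liftP σs R) (liftR σs ρ) b) (hrB-ext (liftP-liftR σs R ρ) b))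
  hrB-ren R ρ (h ∙ ts) = cong₂ appP (hrH-ren R ρ h) (hrA-ren R ρ ts)
  hrA-ren R ρ nil = refl
  hrA-ren R ρ (t ∷ₐ ts) = cong₂ _∷ₐ_ (hrT-ren R ρ t) (hrA-ren R ρ ts)

  hrP-ren : ∀ {Δ Δ' Δ'' τ} (R : PSub Δ' Δ'') (ρ : Ren Δ Δ') (p : PApp Δ τ) →
            hrP R (renP ρ p) ≡ hrP (R ∘PR ρ) p
  hrP-ren R ρ (papp h ss) = cong₂ supplyP (hrH-ren R ρ h) (hrA-ren R ρ ss)

  _∘RP_ : ∀ {Δ Δ' Δ''} → Ren Δ' Δ'' → PSub Δ Δ' → PSub Δ Δ''
  (ρ ∘RP R) x = renP ρ (R x)

  liftR-liftP : ∀ {Δ Δ' Δ''} (σs : Ctx) (ρ : Ren Δ' Δ'') (R : PSub Δ Δ') →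
                (liftR σs ρ ∘RP liftP σs R) ≗P liftP σs (ρ ∘RP R)
  liftR-liftP [] ρ R x = refl
  liftR-liftP ((τs₀ ⇒ a₀) ∷ σs) ρ R here = refl
  liftR-liftP (σ ∷ σs) ρ R (there x) =
    trans (renP-comp (liftR (σ ∷ σs) ρ) there (liftP σs R x))
    (trans (sym (renP-comp there (liftR σs ρ) (liftP σs R x)))
           (cong (renP there) (liftR-liftP σs ρ R x)))

  renH-hrH : ∀ {Δ Δ' Δ'' τ} (ρ : Ren Δ' Δ'') (R : PSub Δ Δ') (h : Head Δ τ) →
             renP ρ (hrH R h) ≡ hrH (ρ ∘RP R) h
  renH-hrH ρ R (var x) = refl
  renH-hrH {τ = τs ⇒ a} ρ R (fun f) = refl

  renT-hr : ∀ {Δ Δ' Δ'' τ} (ρ : Ren Δ' Δ'') (R : PSub Δ Δ') (t : Tm Δ τ) →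
            renT ρ (hrT R t) ≡ hrT (ρ ∘RP R) t
  renB-hr : ∀ {Δ Δ' Δ'' a} (ρ : Ren Δ' Δ'') (R : PSub Δ Δ') (b : Bd Δ a) →
            renB ρ (hrB R b) ≡ hrB (ρ ∘RP R) b
  renA-hr : ∀ {Δ Δ' Δ'' σs} (ρ : Ren Δ' Δ'') (R : PSub Δ Δ') (ts : Args Δ σs) →
            renA ρ (hrA R ts) ≡ hrA (ρ ∘RP R) ts
  renT-hr ρ R (lam {σs} b) =
    cong lam (trans (renB-hr (liftR σs ρ) (liftP σs R) b) (hrB-ext (liftR-liftP σs ρ R) b))
  renB-hr ρ R (h ∙ ts) =
    trans (renB-appP ρ (hrH R h) (hrA R ts)) (cong₂ appP (renH-hrH ρ R h) (renA-hr ρ R ts))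
  renA-hr ρ R nil = refl
  renA-hr ρ R (t ∷ₐ ts) = cong₂ _∷ₐ_ (renT-hr ρ R t) (renA-hr ρ R ts)

  renP-hrP : ∀ {Δ Δ' Δ'' τ} (ρ : Ren Δ' Δ'') (R : PSub Δ Δ') (p : PApp Δ τ) →
             renP ρ (hrP R p) ≡ hrP (ρ ∘RP R) p
  renP-hrP ρ R (papp h ss) =
    trans (renP-supplyP ρ (hrH R h) (hrA R ss)) (cong₂ supplyP (renH-hrH ρ R h) (renA-hr ρ R ss))

  _∘PP_ : ∀ {Δ Δ' Δ''} → PSub Δ' Δ'' → PSub Δ Δ' → PSub Δ Δ''
  (R₂ ∘PP R₁) x = hrP R₂ (R₁ x)

  liftP-liftP : ∀ {Δ Δ' Δ''} (σs : Ctx) (R₂ : PSub Δ' Δ'') (R₁ : PSub Δ Δ') →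
                (liftP σs R₂ ∘PP liftP σs R₁) ≗P liftP σs (R₂ ∘PP R₁)
  liftP-liftP [] R₂ R₁ x = refl
  liftP-liftP ((τs₀ ⇒ a₀) ∷ σs) R₂ R₁ here = refl
  liftP-liftP (σ ∷ σs) R₂ R₁ (there x) =
    trans (hrP-ren (liftP (σ ∷ σs) R₂) there (liftP σs R₁ x))
    (trans (sym (renP-hrP there (liftP σs R₂) (liftP σs R₁ x)))
           (cong (renP there) (liftP-liftP σs R₂ R₁ x)))

  hrH-hrH : ∀ {Δ Δ' Δ'' τ} (R₂ : PSub Δ' Δ'') (R₁ : PSub Δ Δ') (h : Head Δ τ) →
            hrP R₂ (hrH R₁ h) ≡ hrH (R₂ ∘PP R₁) h
  hrH-hrH R₂ R₁ (var x) = refl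
  hrH-hrH {τ = τs ⇒ a} R₂ R₁ (fun f) = refl

  hrT-hr : ∀ {Δ Δ' Δ'' τ} (R₂ : PSub Δ' Δ'') (R₁ : PSub Δ Δ') (t : Tm Δ τ) →
           hrT R₂ (hrT R₁ t) ≡ hrT (R₂ ∘PP R₁) t
  hrB-hr : ∀ {Δ Δ' Δ'' a} (R₂ : PSub Δ' Δ'') (R₁ : PSub Δ Δ') (b : Bd Δ a) →
           hrB R₂ (hrB R₁ b) ≡ hrB (R₂ ∘PP R₁) b
  hrA-hr : ∀ {Δ Δ' Δ'' σs} (R₂ : PSub Δ' Δ'') (R₁ : PSub Δ Δ') (ts : Args Δ σs) →
           hrA R₂ (hrA R₁ ts) ≡ hrA (R₂ ∘PP R₁) ts
  hrT-hr R₂ R₁ (lam {σs} b) =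
    cong lam (trans (hrB-hr (liftP σs R₂) (liftP σs R₁) b) (hrB-ext (liftP-liftP σs R₂ R₁) b))
  hrB-hr R₂ R₁ (h ∙ ts) =
    trans (hrB-appP R₂ (hrH R₁ h) (hrA R₁ ts)) (cong₂ appP (hrH-hrH R₂ R₁ h) (hrA-hr R₂ R₁ ts))
  hrA-hr R₂ R₁ nil = refl
  hrA-hr R₂ R₁ (t ∷ₐ ts) = cong₂ _∷ₐ_ (hrT-hr R₂ R₁ t) (hrA-hr R₂ R₁ ts)

  renT-expand : ∀ {Δ Δ' τ} (ρ : Ren Δ Δ') (p : PApp Δ τ) →
                     renT ρ (expand p) ≡ expand (renP ρ p)
  renT-expand ρ (papp {σs} {τs} h ss) =
    cong lam (cong₂ _∙_
      (trans (renH-comp (liftR τs ρ) (wkR τs) h)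
        (trans (renH-ext (liftR-wkR τs ρ) h) (sym (renH-comp (wkR τs) ρ h))))
      (trans (renA-++ (liftR τs ρ) (renA (wkR τs) ss) (ηs τs (injL τs)))
        (cong₂ _++ₐ_
          (trans (renA-comp (liftR τs ρ) (wkR τs) ss)
            (trans (renA-ext (liftR-wkR τs ρ) ss) (sym (renA-comp (wkR τs) ρ ss))))
          (trans (renA-ηs τs (liftR τs ρ) (injL τs)) (ηs-ext τs (liftR-injL τs ρ))))))

  resolveP : ∀ {Ξ' σ τ} → (Ξ' ∋ τ) ⊎ (τ ≡ σ) → PApp Ξ' σ → PApp Ξ' τ
  resolveP (inj₁ x) p = varP x
  resolveP (inj₂ refl) p = p

  sub1P : ∀ {Ξ σ Ξ'} → Del Ξ σ Ξ' → PApp Ξ' σ → PSub Ξ Ξ'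
  sub1P d p x = resolveP (classify d x) p

  resolveP-map : ∀ {Ξ' Ξ'' σ τ} (f : Ren Ξ' Ξ'') (c : (Ξ' ∋ τ) ⊎ (τ ≡ σ)) (q : PApp Ξ' σ) →
                resolveP (Sum.map₁ f c) (renP f q) ≡ renP f (resolveP c q)
  resolveP-map {τ = τs ⇒ a} f (inj₁ x) q = refl
  resolveP-map f (inj₂ refl) q = refl

  sub1P-lift : ∀ (σs : Ctx) {Ξ σ Ξ'} (d : Del Ξ σ Ξ') (p : PApp Ξ' σ) →
            sub1P (delLift σs d) (renP (wkR σs) p) ≗P liftP σs (sub1P d p)
  sub1P-lift [] d p x = cong (resolveP (classify d x)) (renP-id (λ z → refl) p)
  sub1P-lift ((τs ⇒ a) ∷ σs) d p here = refl
  sub1P-lift (σ ∷ σs) d p (there x) =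
    trans (cong (resolveP (Sum.map₁ there (classify (delLift σs d) x))) (sym (renP-comp there (wkR σs) p)))
    (trans (resolveP-map there (classify (delLift σs d) x) (renP (wkR σs) p))
           (cong (renP there) (sub1P-lift σs d p x)))

  sub1T-expand : ∀ {Ξ σ Ξ' τ} (d : Del Ξ σ Ξ') (p : PApp Ξ' σ) (t : Tm Ξ τ) →
              sub1T d t (expand p) ≡ hrT (sub1P d p) t
  sub1B-expand : ∀ {Ξ σ Ξ' a} (d : Del Ξ σ Ξ') (p : PApp Ξ' σ) (b : Bd Ξ a) →
              sub1B d b (expand p) ≡ hrB (sub1P d p) b
  sub1A-expand : ∀ {Ξ σ Ξ' σs} (d : Del Ξ σ Ξ') (p : PApp Ξ' σ) (ts : Args Ξ σs) →
              sub1A d ts (expand p) ≡ hrA (sub1P d p) ts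
  sub1T-expand d p (lam {σs} b)
    rewrite renT-expand (wkR σs) p =
    cong lam (trans (sub1B-expand (delLift σs d) (renP (wkR σs) p) b) (hrB-ext (sub1P-lift σs d p) b))
  sub1B-expand d p (fun f ∙ ts) = cong (fun f ∙_) (sub1A-expand d p ts)
  sub1B-expand d p (var x ∙ ts) with classify d x
  ... | inj₁ x' = cong (var x' ∙_) (sub1A-expand d p ts)
  sub1B-expand d (papp h ss) (var x ∙ ts) | inj₂ refl
    rewrite sub1A-expand d (papp h ss) ts = inst-expandedForm _ h ss _
  sub1A-expand d p nil = refl
  sub1A-expand d p (t ∷ₐ ts) = cong₂ _∷ₐ_ (sub1T-expand d p t) (sub1A-expand d p ts)

  infixr 6 _∷ₚ_
  data PArgs (Δ : Ctx) : List Type → Set where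
    pnil : PArgs Δ []
    _∷ₚ_ : ∀ {σ σs} → PApp Δ σ → PArgs Δ σs → PArgs Δ (σ ∷ σs)

  expandAll : ∀ {Δ σs} → PArgs Δ σs → Args Δ σs
  expandAll pnil = nil
  expandAll (p ∷ₚ ps) = expand p ∷ₐ expandAll ps

  instP : ∀ {Δ τs} → PArgs Δ τs → PSub (τs ++ Δ) Δ
  instP pnil x = varP x
  instP (p ∷ₚ ps) here = p
  instP (p ∷ₚ ps) (there x) = instP ps x

  instP-wkR : ∀ {Δ τs} (ps : PArgs Δ τs) → (instP ps ∘PR wkR τs) ≗P varP
  instP-wkR pnil x = refl
  instP-wkR (p ∷ₚ ps) x = instP-wkR ps x

  inst-expandAll : ∀ (τs : Ctx) {Δ a} (w : Bd (τs ++ Δ) a) (ps : PArgs Δ τs) →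
             inst τs w (expandAll ps) ≡ hrB (instP ps) w
  inst-expandAll [] w pnil = sym (hrB-id (λ x → refl) w)
  inst-expandAll (τ ∷ τs) w (p ∷ₚ ps)
    rewrite renT-expand (wkR τs) p
          | sub1B-expand dhere (renP (wkR τs) p) w =
    trans (inst-expandAll τs (hrB (sub1P dhere (renP (wkR τs) p)) w) ps)
    (trans (hrB-hr (instP ps) (sub1P dhere (renP (wkR τs) p)) w) (hrB-ext pt w))
    where
    pt : (instP ps ∘PP sub1P dhere (renP (wkR τs) p)) ≗P instP (p ∷ₚ ps)
    pt here = trans (hrP-ren (instP ps) (wkR τs) p) (hrP-id (instP-wkR ps) p)
    pt (there {τ = ρs ⇒ b} x) = supplyP-nil (instP ps x)

  -- Binder prefixes, occurrences and free variables

  ⊙-idˡ : ∀ {Γ Ξ} (e : Γ ⊑ Ξ) → base ⊙ e ≡ e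
  ⊙-idˡ base = refl
  ⊙-idˡ (step σs e) = cong (step σs) (⊙-idˡ e)

  ⊙-assoc : ∀ {Γ₁ Γ₂ Γ₃ Γ₄} (e₁ : Γ₁ ⊑ Γ₂) (e₂ : Γ₂ ⊑ Γ₃) (e₃ : Γ₃ ⊑ Γ₄) →
            (e₁ ⊙ e₂) ⊙ e₃ ≡ e₁ ⊙ (e₂ ⊙ e₃)
  ⊙-assoc e₁ e₂ base = refl
  ⊙-assoc e₁ e₂ (step σs e₃) = cong (step σs) (⊙-assoc e₁ e₂ e₃)

  wkE-⊙ : ∀ {Γ₁ Γ₂ Γ₃} (e₁ : Γ₁ ⊑ Γ₂) (e₂ : Γ₂ ⊑ Γ₃) {τ} (x : Γ₁ ∋ τ) →
          wkE (e₁ ⊙ e₂) x ≡ wkE e₂ (wkE e₁ x)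
  wkE-⊙ e₁ base x = refl
  wkE-⊙ e₁ (step σs e₂) x = cong (wkR σs) (wkE-⊙ e₁ e₂ x)

  InjectiveR : ∀ {Γ Δ} → Ren Γ Δ → Set
  InjectiveR ρ = ∀ {τ} {x y : _ ∋ τ} → ρ x ≡ ρ y → x ≡ y

  there-injective : ∀ {Γ σ τ} {x y : Γ ∋ τ} → there {σ = σ} x ≡ there y → x ≡ y
  there-injective refl = refl

  wkR-injective : ∀ {Γ} (σs : Ctx) → InjectiveR (wkR {Γ} σs)
  wkR-injective [] eq = eq
  wkR-injective (σ ∷ σs) eq = wkR-injective σs (there-injective eq)

  wkE-injective : ∀ {Γ Ξ} (e : Γ ⊑ Ξ) → InjectiveR (wkE e)
  wkE-injective base eq = eq
  wkE-injective (step σs e) eq = wkE-injective e (wkR-injective σs eq)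

  injL≢wkR : ∀ (σs : Ctx) {Δ τ} (i : σs ∋ τ) (x : Δ ∋ τ) → injL σs i ≢ wkR σs x
  injL≢wkR (σ ∷ σs) here x ()
  injL≢wkR (σ ∷ σs) (there i) x eq = injL≢wkR σs i x (there-injective eq)

  liftR-injective : ∀ {Γ Δ} (σs : Ctx) {ρ : Ren Γ Δ} → InjectiveR ρ → InjectiveR (liftR σs ρ)
  liftR-injective [] inj eq = inj eq
  liftR-injective (σ ∷ σs) inj {x = here} {here} eq = refl
  liftR-injective (σ ∷ σs) inj {x = here} {there y} ()
  liftR-injective (σ ∷ σs) inj {x = there x} {here} ()
  liftR-injective (σ ∷ σs) inj {x = there x} {there y} eq = cong there
      (liftR-injective σs inj (there-injective eq))

  ∙Eq : ∀ {Γ a} {L L' : Ctx} → L ≡ L' → Head Γ (L ⇒ a) → Head Γ (L' ⇒ a) → Args Γ L → Args Γ L' → Set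
  ∙Eq refl h h' as as' = (h ≡ h') × (as ≡ as')

  ∙-injective : ∀ {Γ a} {L L' : Ctx} {h : Head Γ (L ⇒ a)} {h' : Head Γ (L' ⇒ a)} {as : Args Γ L} {as' : Args Γ L'} →
          h ∙ as ≡ h' ∙ as' → Σ (L ≡ L') λ e → ∙Eq e h h' as as'
  ∙-injective refl = refl , refl , refl

  ∷ₐ-injective : ∀ {Γ σ σs} {t t' : Tm Γ σ} {ts ts' : Args Γ σs} → (t ∷ₐ ts) ≡ (t' ∷ₐ ts') →
                 (t ≡ t') × (ts ≡ ts')
  ∷ₐ-injective refl = refl , refl

  lam-injective : ∀ {Γ σs a} {b b' : Bd (σs ++ Γ) a} → _≡_ {A = Tm Γ (σs ⇒ a)} (lam b) (lam b') → b ≡ b'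
  lam-injective refl = refl

  splitArgs : ∀ {Γ} (L : Ctx) {M : Ctx} (xs : Args Γ (L ++ M)) →
           Σ (Args Γ L) λ as → Σ (Args Γ M) λ bs → xs ≡ as ++ₐ bs
  splitArgs [] xs = nil , xs , refl
  splitArgs (σ ∷ L) (x ∷ₐ xs) with splitArgs L xs
  ... | as , bs , refl = (x ∷ₐ as) , bs , refl

  ++ₐ-cancel : ∀ {Γ L M} (as as' : Args Γ L) (bs bs' : Args Γ M) → as ++ₐ bs ≡ as' ++ₐ bs' →
               (as ≡ as') × (bs ≡ bs')
  ++ₐ-cancel nil nil bs bs' eq = refl , eq
  ++ₐ-cancel (a ∷ₐ as) (a' ∷ₐ as') bs bs' eq with ∷ₐ-injective eq
  ... | refl , eq' with ++ₐ-cancel as as' bs bs' eq'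
  ... | refl , refl = refl , refl

  var-injective : ∀ {Δ τ} {x y : Δ ∋ τ} → Head.var {Δ} x ≡ var y → x ≡ y
  var-injective refl = refl

  fun≢var : ∀ {Δ τ} {f : F τ} {x : Δ ∋ τ} → Head.fun {Δ} f ≢ var x
  fun≢var ()

  fun∙≢var∙ : ∀ {Δ a} {L L' : Ctx} {f : F (L ⇒ a)} {v : Δ ∋ (L' ⇒ a)} {X : Args Δ L} {Y : Args Δ L'} →
              fun f ∙ X ≡ var v ∙ Y → ⊥
  fun∙≢var∙ eq with ∙-injective eq
  ... | refl , () , _

  fun-injective : ∀ {Δ τ} {f f' : F τ} → Head.fun {Δ} f ≡ fun f' → f ≡ f'
  fun-injective refl = refl

  renH-injective : ∀ {Γ Δ τ} {ρ : Ren Γ Δ} → InjectiveR ρ → {h h' : Head Γ τ} → renH ρ h ≡ renH ρ h' → h ≡ h'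
  renH-injective inj {var x} {var y} eq with inj (var-injective eq)
  ... | refl = refl
  renH-injective inj {fun f} {fun .f} refl = refl

  renT-injective : ∀ {Γ Δ τ} {ρ : Ren Γ Δ} → InjectiveR ρ → (t t' : Tm Γ τ) → renT ρ t ≡ renT ρ t' → t ≡ t'
  renB-injective : ∀ {Γ Δ a} {ρ : Ren Γ Δ} → InjectiveR ρ → (b b' : Bd Γ a) → renB ρ b ≡ renB ρ b' → b ≡ b'
  renA-injective : ∀ {Γ Δ σs} {ρ : Ren Γ Δ} → InjectiveR ρ → (ts ts' : Args Γ σs) →
                   renA ρ ts ≡ renA ρ ts' → ts ≡ ts'
  renT-injective inj (lam {σs} b) (lam b') eq = cong lam
      (renB-injective (liftR-injective σs inj) b b' (lam-injective eq))
  renB-injective inj (h ∙ as) (h' ∙ as') eq with ∙-injective eq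
  ... | refl , eh , ea rewrite renH-injective inj eh | renA-injective inj as as' ea = refl
  renA-injective inj nil nil eq = refl
  renA-injective inj (t ∷ₐ ts) (t' ∷ₐ ts') eq with ∷ₐ-injective eq
  ... | e1 , e2 = cong₂ _∷ₐ_ (renT-injective inj t t' e1) (renA-injective inj ts ts' e2)

  ∈-++ : ∀ {Γ σ σs ρs} {t : Tm Γ σ} (as : Args Γ σs) (bs : Args Γ ρs) → t ∈ₐ (as ++ₐ bs) → (t ∈ₐ as) ⊎ (t ∈ₐ bs)
  ∈-++ nil bs m = inj₂ m
  ∈-++ (a ∷ₐ as) bs hereₐ = inj₁ hereₐ
  ∈-++ (a ∷ₐ as) bs (thereₐ m) = Sum.map₁ thereₐ (∈-++ as bs m)

  ∈-++ˡ : ∀ {Γ σ σs ρs} {t : Tm Γ σ} {as : Args Γ σs} (bs : Args Γ ρs) → t ∈ₐ as → t ∈ₐ (as ++ₐ bs)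
  ∈-++ˡ bs hereₐ = hereₐ
  ∈-++ˡ bs (thereₐ m) = thereₐ (∈-++ˡ bs m)

  ∈-++ʳ : ∀ {Γ σ σs ρs} {t : Tm Γ σ} (as : Args Γ σs) {bs : Args Γ ρs} → t ∈ₐ bs → t ∈ₐ (as ++ₐ bs)
  ∈-++ʳ nil m = m
  ∈-++ʳ (a ∷ₐ as) m = thereₐ (∈-++ʳ as m)

  ∈-renA⁻ : ∀ {Γ Δ σ σs} (ρ : Ren Γ Δ) {t' : Tm Δ σ} (ts : Args Γ σs) → t' ∈ₐ renA ρ ts →
           Σ (Tm Γ σ) λ t → (t ∈ₐ ts) × (t' ≡ renT ρ t)
  ∈-renA⁻ ρ (t ∷ₐ ts) hereₐ = t , hereₐ , refl
  ∈-renA⁻ ρ (t ∷ₐ ts) (thereₐ m) with ∈-renA⁻ ρ ts m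
  ... | u , m' , eq = u , thereₐ m' , eq

  ∈-renA⁺ : ∀ {Γ Δ σ σs} (ρ : Ren Γ Δ) {t : Tm Γ σ} {ts : Args Γ σs} → t ∈ₐ ts → renT ρ t ∈ₐ renA ρ ts
  ∈-renA⁺ ρ hereₐ = hereₐ
  ∈-renA⁺ ρ (thereₐ m) = thereₐ (∈-renA⁺ ρ m)

  ∈-hrA⁻ : ∀ {Γ Δ σ σs} (R : PSub Γ Δ) {t' : Tm Δ σ} (ts : Args Γ σs) → t' ∈ₐ hrA R ts →
          Σ (Tm Γ σ) λ t → (t ∈ₐ ts) × (t' ≡ hrT R t)
  ∈-hrA⁻ R (t ∷ₐ ts) hereₐ = t , hereₐ , refl
  ∈-hrA⁻ R (t ∷ₐ ts) (thereₐ m) with ∈-hrA⁻ R ts m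
  ... | u , m' , eq = u , thereₐ m' , eq

  ∈-hrA⁺ : ∀ {Γ Δ σ σs} (R : PSub Γ Δ) {t : Tm Γ σ} {ts : Args Γ σs} → t ∈ₐ ts → hrT R t ∈ₐ hrA R ts
  ∈-hrA⁺ R hereₐ = hereₐ
  ∈-hrA⁺ R (thereₐ m) = thereₐ (∈-hrA⁺ R m)

  occT-trans : ∀ {Γ τ Ξ₁ a₁ Ξ₂ a₂} {t : Tm Γ τ} {e₁ : Γ ⊑ Ξ₁} {c₁ : Bd Ξ₁ a₁} {e₂ : Ξ₁ ⊑ Ξ₂} {c₂ : Bd Ξ₂ a₂} →
               OccT t e₁ c₁ → OccB c₁ e₂ c₂ → OccT t (e₁ ⊙ e₂) c₂
  occB-trans : ∀ {Γ a Ξ₁ a₁ Ξ₂ a₂} {b : Bd Γ a} {e₁ : Γ ⊑ Ξ₁} {c₁ : Bd Ξ₁ a₁} {e₂ : Ξ₁ ⊑ Ξ₂} {c₂ : Bd Ξ₂ a₂} →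
               OccB b e₁ c₁ → OccB c₁ e₂ c₂ → OccB b (e₁ ⊙ e₂) c₂
  occT-trans {e₂ = e₂} (lamO {σs = σs} {e = e} o) o₂ =
    subst (λ z → OccT _ z _) (sym (⊙-assoc (step σs base) e e₂)) (lamO (occB-trans o o₂))
  occB-trans {e₂ = e₂} hereO o₂ = subst (λ z → OccB _ z _) (sym (⊙-idˡ e₂)) o₂
  occB-trans (argO m o) o₂ = argO m (occT-trans o o₂)

  occT-fv : ∀ {Γ τ Ξ a ρ} {t : Tm Γ τ} {e : Γ ⊑ Ξ} {c : Bd Ξ a} (v : Γ ∋ ρ) →
            OccT t e c → FvB (wkE e v) c → FvT v t
  occB-fv : ∀ {Γ a' Ξ a ρ} {b : Bd Γ a'} {e : Γ ⊑ Ξ} {c : Bd Ξ a} (v : Γ ∋ ρ) →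
            OccB b e c → FvB (wkE e v) c → FvB v b
  occT-fv v (lamO {σs = σs} {e = e} o) f =
    lamF (occB-fv (wkR σs v) o (subst (λ z → FvB z _) (wkE-⊙ (step σs base) e v) f))
  occB-fv v hereO f = f
  occB-fv v (argO m o) f = argF m (occT-fv v o f)

  fvT-renT⁺ : ∀ {Γ Δ τ ρ'} (ρ : Ren Γ Δ) {v : Γ ∋ ρ'} {t : Tm Γ τ} → FvT v t → FvT (ρ v) (renT ρ t)
  fvB-renB⁺ : ∀ {Γ Δ a ρ'} (ρ : Ren Γ Δ) {v : Γ ∋ ρ'} {b : Bd Γ a} → FvB v b → FvB (ρ v) (renB ρ b)
  fvT-renT⁺ ρ {v} (lamF {σs = σs} f) =
    lamF (subst (λ z → FvB z _) (liftR-wkR σs ρ v) (fvB-renB⁺ (liftR σs ρ) f))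
  fvB-renB⁺ ρ headF = headF
  fvB-renB⁺ ρ (argF m f) = argF (∈-renA⁺ ρ m) (fvT-renT⁺ ρ f)

  liftR-wkR⁻ : ∀ (σs : Ctx) {Γ Δ τ} (ρ : Ren Γ Δ) (z : σs ++ Γ ∋ τ) (v : Δ ∋ τ) →
               liftR σs ρ z ≡ wkR σs v → Σ (Γ ∋ τ) λ v₀ → (z ≡ wkR σs v₀) × (ρ v₀ ≡ v)
  liftR-wkR⁻ σs ρ z v eq with blockView σs z
  ... | inBlock i = ⊥-elim (injL≢wkR σs i v (trans (sym (liftR-injL σs ρ i)) eq))
  ... | inOuter x = x , refl , wkR-injective σs (trans (sym (liftR-wkR σs ρ x)) eq)

  fvT-renT⁻ : ∀ {Γ Δ τ ρ'} (ρ : Ren Γ Δ) {v : Δ ∋ ρ'} (t : Tm Γ τ) → FvT v (renT ρ t) →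
                 Σ (Γ ∋ ρ') λ v₀ → (v ≡ ρ v₀) × FvT v₀ t
  fvB-renB⁻ : ∀ {Γ Δ a ρ'} (ρ : Ren Γ Δ) {v : Δ ∋ ρ'} (b : Bd Γ a) → FvB v (renB ρ b) →
                 Σ (Γ ∋ ρ') λ v₀ → (v ≡ ρ v₀) × FvB v₀ b
  fvA-renA⁻ : ∀ {Γ Δ σ σs ρ'} (ρ : Ren Γ Δ) {v : Δ ∋ ρ'} (ts : Args Γ σs) {t' : Tm Δ σ} →
                 t' ∈ₐ renA ρ ts → FvT v t' →
                 Σ (Γ ∋ ρ') λ v₀ → (v ≡ ρ v₀) × Σ (Tm Γ σ) λ t → (t ∈ₐ ts) × FvT v₀ t
  fvT-renT⁻ ρ {v} (lam {σs} b) (lamF f) with fvB-renB⁻ (liftR σs ρ) b f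
  ... | z , eq , f' with liftR-wkR⁻ σs ρ z v (sym eq)
  ... | v₀ , refl , refl = v₀ , refl , lamF f'
  fvB-renB⁻ ρ (var x ∙ ts) headF = x , refl , headF
  fvB-renB⁻ ρ (h ∙ ts) (argF m f) with fvA-renA⁻ ρ ts m f
  ... | v₀ , eq , t , m' , f' = v₀ , eq , argF m' f'
  fvA-renA⁻ ρ (t ∷ₐ ts) hereₐ f with fvT-renT⁻ ρ t f
  ... | v₀ , eq , f' = v₀ , eq , t , hereₐ , f'
  fvA-renA⁻ ρ (t ∷ₐ ts) (thereₐ m) f with fvA-renA⁻ ρ ts m f
  ... | v₀ , eq , u , m' , f' = v₀ , eq , u , thereₐ m' , f'

  sizeT : ∀ {Γ τ} → Tm Γ τ → ℕ
  sizeB : ∀ {Γ a} → Bd Γ a → ℕ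
  sizeA : ∀ {Γ σs} → Args Γ σs → ℕ
  sizeT (lam b) = sizeB b
  sizeB (h ∙ ts) = ℕ.suc (sizeA ts)
  sizeA nil = ℕ.zero
  sizeA (t ∷ₐ ts) = sizeT t + sizeA ts

  sizeT-ren : ∀ {Γ Δ τ} (ρ : Ren Γ Δ) (t : Tm Γ τ) → sizeT (renT ρ t) ≡ sizeT t
  sizeB-ren : ∀ {Γ Δ a} (ρ : Ren Γ Δ) (b : Bd Γ a) → sizeB (renB ρ b) ≡ sizeB b
  sizeA-ren : ∀ {Γ Δ σs} (ρ : Ren Γ Δ) (ts : Args Γ σs) → sizeA (renA ρ ts) ≡ sizeA ts
  sizeT-ren ρ (lam {σs} b) = sizeB-ren (liftR σs ρ) b
  sizeB-ren ρ (h ∙ ts) = cong ℕ.suc (sizeA-ren ρ ts)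
  sizeA-ren ρ nil = refl
  sizeA-ren ρ (t ∷ₐ ts) = cong₂ _+_ (sizeT-ren ρ t) (sizeA-ren ρ ts)

  ∈-size : ∀ {Γ σ σs} {t : Tm Γ σ} {ts : Args Γ σs} → t ∈ₐ ts → sizeT t ≤ sizeA ts
  ∈-size {ts = t ∷ₐ ts} hereₐ = m≤m+n (sizeT t) (sizeA ts)
  ∈-size {ts = u ∷ₐ ts} (thereₐ m) = ≤-trans (∈-size m) (m≤n+m (sizeA ts) (sizeT u))

  occT-size : ∀ {Γ τ Ξ a} {t : Tm Γ τ} {e : Γ ⊑ Ξ} {c : Bd Ξ a} → OccT t e c → sizeB c ≤ sizeT t
  occB-size : ∀ {Γ a' Ξ a} {b : Bd Γ a'} {e : Γ ⊑ Ξ} {c : Bd Ξ a} → OccB b e c → sizeB c ≤ sizeB b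
  occT-size (lamO o) = occB-size o
  occB-size hereO = ≤-refl
  occB-size (argO m o) = ≤-trans (occT-size o) (≤-trans (∈-size m) (n≤1+n _))

  no-occ-with-larger-argument : ∀ {Γ τ Ξ a σ σs} {t : Tm Γ τ} {e : Γ ⊑ Ξ} (h : Head Ξ (σs ⇒ a))
                                (args : Args Ξ σs) {u : Tm Ξ σ} →
                OccT t e (h ∙ args) → u ∈ₐ args → sizeT t ≤ sizeT u → ⊥
  no-occ-with-larger-argument h args o m le =
    <-irrefl refl (≤-trans (s≤s (≤-trans le (∈-size m))) (occT-size o))

  data LiftR {Δ Δ' : Ctx} : Ren Δ Δ' → ∀ {Ω Ω'} → Δ ⊑ Ω → Δ' ⊑ Ω' → Ren Ω Ω' → Set where
    lbase : ∀ {ρ : Ren Δ Δ'} → LiftR ρ base base ρ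
    lstep : ∀ {ρ : Ren Δ Δ'} {Ω Ω'} {e : Δ ⊑ Ω} {e' : Δ' ⊑ Ω'} {ρ' : Ren Ω Ω'} (σs : Ctx) →
            LiftR ρ e e' ρ' → LiftR ρ (step σs e) (step σs e') (liftR σs ρ')

  LiftR-⊙ : ∀ {Δ Δ' Ω₁ Ω₁' Ω₂ Ω₂'} {ρ : Ren Δ Δ'} {e₁ : Δ ⊑ Ω₁} {e₁' : Δ' ⊑ Ω₁'} {ρ₁ : Ren Ω₁ Ω₁'}
            {e₂ : Ω₁ ⊑ Ω₂} {e₂' : Ω₁' ⊑ Ω₂'} {ρ₂ : Ren Ω₂ Ω₂'} →
            LiftR ρ e₁ e₁' ρ₁ → LiftR ρ₁ e₂ e₂' ρ₂ → LiftR ρ (e₁ ⊙ e₂) (e₁' ⊙ e₂') ρ₂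
  LiftR-⊙ l₁ lbase = l₁
  LiftR-⊙ l₁ (lstep σs l₂) = lstep σs (LiftR-⊙ l₁ l₂)

  LiftR-wkE : ∀ {Δ Δ' Ω Ω'} {ρ : Ren Δ Δ'} {e : Δ ⊑ Ω} {e' : Δ' ⊑ Ω'} {ρ' : Ren Ω Ω'} →
               LiftR ρ e e' ρ' → ∀ {τ} (x : Δ ∋ τ) → ρ' (wkE e x) ≡ wkE e' (ρ x)
  LiftR-wkE lbase x = refl
  LiftR-wkE (lstep {e = e} σs l) x = trans (liftR-wkR σs _ (wkE e x)) (cong (wkR σs) (LiftR-wkE l x))

  LiftR-injective : ∀ {Δ Δ' Ω Ω'} {ρ : Ren Δ Δ'} {e : Δ ⊑ Ω} {e' : Δ' ⊑ Ω'} {ρ' : Ren Ω Ω'} →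
                    LiftR ρ e e' ρ' → InjectiveR ρ → InjectiveR ρ'
  LiftR-injective lbase inj = inj
  LiftR-injective (lstep σs l) inj = liftR-injective σs (LiftR-injective l inj)

  record RenOcc⁻ {Δ Δ' Ω' a'} (ρ : Ren Δ Δ') (e' : Δ' ⊑ Ω') (c' : Bd Ω' a')
               (occ : ∀ {Ω} → Δ ⊑ Ω → Bd Ω a' → Set) : Set where
    constructor renOcc⁻
    field
      {Ω} : Ctx
      e : Δ ⊑ Ω
      ρ' : Ren Ω Ω'
      c : Bd Ω a'
      lift : LiftR ρ e e' ρ'
      occ' : occ e c
      eqc : c' ≡ renB ρ' c

  occT-renT⁻ : ∀ {Δ Δ' τ Ω' a'} (ρ : Ren Δ Δ') (t : Tm Δ τ) {e' : Δ' ⊑ Ω'} {c' : Bd Ω' a'} →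
          OccT (renT ρ t) e' c' → RenOcc⁻ ρ e' c' (OccT t)
  occB-renB⁻ : ∀ {Δ Δ' a Ω' a'} (ρ : Ren Δ Δ') (b : Bd Δ a) {e' : Δ' ⊑ Ω'} {c' : Bd Ω' a'} →
          OccB (renB ρ b) e' c' → RenOcc⁻ ρ e' c' (OccB b)
  occA-renA⁻ : ∀ {Δ Δ' σs σ Ω' a' L a} (ρ : Ren Δ Δ') (h : Head Δ (L ⇒ a)) (ts : Args Δ σs) (ts₀ : Args Δ L)
          (sub : ∀ {σ'} {u : Tm Δ σ'} → u ∈ₐ ts → u ∈ₐ ts₀) {t' : Tm Δ' σ}
          {e' : Δ' ⊑ Ω'} {c' : Bd Ω' a'} → t' ∈ₐ renA ρ ts →
          OccT t' e' c' → RenOcc⁻ ρ e' c' (OccB (h ∙ ts₀))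
  occT-renT⁻ ρ (lam {σs} b) (lamO o) with occB-renB⁻ (liftR σs ρ) b o
  ... | renOcc⁻ e ρ' c l o' eq = renOcc⁻ (step σs base ⊙ e) ρ' c (LiftR-⊙ (lstep σs lbase) l) (lamO o') eq
  occB-renB⁻ ρ (h ∙ ts) hereO = renOcc⁻ base ρ (h ∙ ts) lbase hereO refl
  occB-renB⁻ ρ (h ∙ ts) (argO m o) = occA-renA⁻ ρ h ts ts (λ m → m) m o
  occA-renA⁻ ρ h (t ∷ₐ ts) ts₀ sub hereₐ o with occT-renT⁻ ρ t o
  ... | renOcc⁻ e ρ' c l o' eq = renOcc⁻ e ρ' c l (argO (sub hereₐ) o') eq
  occA-renA⁻ ρ h (t ∷ₐ ts) ts₀ sub (thereₐ m) o = occA-renA⁻ ρ h ts ts₀ (λ m' → sub (thereₐ m')) m o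

  renB-appP⁻ : ∀ {Γ Δ τs a} {ρ : Ren Γ Δ} → InjectiveR ρ →
               (c : Bd Γ a) (q : PApp Γ (τs ⇒ a)) (rest : Args Δ τs) →
                 renB ρ c ≡ appP (renP ρ q) rest → Σ (Args Γ τs) λ rest₀ → c ≡ appP q rest₀
  renB-appP⁻ {τs = τs} {ρ = ρ} inj (h ∙ as) (papp {σs} hq ssq) rest eq with ∙-injective eq
  ... | refl , eh , ea with splitArgs σs as
  ... | as₁ , as₂ , refl with ++ₐ-cancel (renA ρ as₁) (renA ρ ssq) (renA ρ as₂) rest
      (trans (sym (renA-++ ρ as₁ as₂)) ea)
  ... | e₁ , e₂ rewrite renH-injective inj eh | renA-injective inj as₁ ssq e₁ = as₂ , refl

  -- Contains t p: a subterm of t is p, weakened under the binders passed, applied to further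
  -- arguments; this is t ⊵E expand p (contains⇒⊵E).
  Contains : ∀ {Δ τ ρs a} → Tm Δ τ → PApp Δ (ρs ⇒ a) → Set
  Contains {Δ} {ρs = ρs} t p =
    Σ Ctx λ Ω → Σ (Δ ⊑ Ω) λ e → Σ (Args Ω ρs) λ rest → OccT t e (appP (renP (wkE e) p) rest)

  contains-renT⁻ : ∀ {Δ Δ' τ ρs a} {ρ : Ren Δ Δ'} → InjectiveR ρ → (t : Tm Δ τ) (p : PApp Δ (ρs ⇒ a)) →
            Contains (renT ρ t) (renP ρ p) → Contains t p
  contains-renT⁻ {ρ = ρ} inj t p (Ω' , e' , rest , o) with occT-renT⁻ ρ t o
  ... | renOcc⁻ e ρ' c l o' eq with renB-appP⁻ (LiftR-injective l inj) c (renP (wkE e) p) rest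
            (trans (sym eq) (cong (λ z → appP z rest)
              (trans (renP-comp (wkE e') ρ p)
                (trans (renP-ext (λ x → sym (LiftR-wkE l x)) p) (sym (renP-comp ρ' (wkE e) p))))))
  ... | rest₀ , refl = _ , e , rest₀ , o'

  data VarEq {Δ : Ctx} {ρ : Type} (v : Δ ∋ ρ) : ∀ {ρ'} → Δ ∋ ρ' → Set where
    vrefl : VarEq v v

  varEq-type : ∀ {Δ ρ ρ'} {v : Δ ∋ ρ} {y : Δ ∋ ρ'} → VarEq v y → ρ ≡ ρ'
  varEq-type vrefl = refl

  varEq-≡ : ∀ {Δ ρ} {v y : Δ ∋ ρ} → VarEq v y → v ≡ y
  varEq-≡ vrefl = refl

  varEq-map : ∀ {Δ Δ' ρ ρ'} (f : Ren Δ Δ') {v : Δ ∋ ρ} {y : Δ ∋ ρ'} → VarEq v y → VarEq (f v) (f y)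
  varEq-map f vrefl = vrefl

  varEq-injective : ∀ {Δ Δ' ρ ρ'} {f : Ren Δ Δ'} → InjectiveR f → {v : Δ ∋ ρ} {y : Δ ∋ ρ'} →
                    VarEq (f v) (f y) → VarEq v y
  varEq-injective {f = f} inj {v} {y} e with varEq-type e
  ... | refl with inj (varEq-≡ e)
  ... | refl = vrefl

  data FvP {Δ : Ctx} {ρ : Type} (v : Δ ∋ ρ) : ∀ {τ} → PApp Δ τ → Set where
    fvHead : ∀ {σs τs a} {y : Δ ∋ ((σs ++ τs) ⇒ a)} {ss : Args Δ σs} → VarEq v y → FvP v (papp (var y) ss)
    fvArg  : ∀ {σs τs a σ} {h : Head Δ ((σs ++ τs) ⇒ a)} {ss : Args Δ σs} {s : Tm Δ σ} →
             s ∈ₐ ss → FvT v s → FvP v (papp h ss)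

  data _∈P_ {Δ : Ctx} {σ : Type} (s : Tm Δ σ) : ∀ {τ} → PApp Δ τ → Set where
    inP : ∀ {σs τs a} {h : Head Δ ((σs ++ τs) ⇒ a)} {ss : Args Δ σs} → s ∈ₐ ss → s ∈P papp h ss

  fvP-renP⁺ : ∀ {Δ Δ' ρ τ} (f : Ren Δ Δ') {v : Δ ∋ ρ} (p : PApp Δ τ) → FvP v p → FvP (f v) (renP f p)
  fvP-renP⁺ f (papp (var y) ss) (fvHead e) = fvHead (varEq-map f e)
  fvP-renP⁺ f (papp h ss) (fvArg m fv) = fvArg (∈-renA⁺ f m) (fvT-renT⁺ f fv)

  fvP-renP⁻ : ∀ {Δ Δ' ρ τ} {f : Ren Δ Δ'} → InjectiveR f → {v : Δ ∋ ρ} (p : PApp Δ τ) →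
              FvP (f v) (renP f p) → FvP v p
  fvP-renP⁻ {f = f} inj (papp (var y) ss) (fvHead e) = fvHead (varEq-injective inj e)
  fvP-renP⁻ {f = f} inj {v} (papp h ss) (fvArg m fv) with ∈-renA⁻ f ss m
  ... | s , m' , refl with fvT-renT⁻ f s fv
  ... | v₀ , eq , fv' with inj eq
  ... | refl = fvArg m' fv'

  fvP⇒fvT-expand : ∀ {Δ ρ τ} {v : Δ ∋ ρ} (p : PApp Δ τ) → FvP v p → FvT v (expand p)
  fvP⇒fvT-expand {v = v} (papp {τs = τs} (var y) ss) (fvHead vrefl) = lamF headF
  fvP⇒fvT-expand {v = v} (papp {τs = τs} h ss) (fvArg m fv) =
    lamF (argF (∈-++ˡ (ηs τs (injL τs)) (∈-renA⁺ (wkR τs) m)) (fvT-renT⁺ (wkR τs) fv))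

  fvB-∙⁻ : ∀ {Δ ρ L a} {z : Δ ∋ ρ} {h : Head Δ (L ⇒ a)} {ts : Args Δ L} → FvB z (h ∙ ts) →
           (Σ (Δ ∋ (L ⇒ a)) λ y → (h ≡ var y) × VarEq z y) ⊎ (Σ Type λ σ → Σ (Tm Δ σ) λ t → (t ∈ₐ ts) × FvT z t)
  fvB-∙⁻ headF = inj₁ (_ , refl , vrefl)
  fvB-∙⁻ (argF m f) = inj₂ (_ , _ , m , f)

  fvT-η : ∀ {Γ ρ τ} (w : Γ ∋ ρ) (x : Γ ∋ τ) → FvT w (η x) → VarEq w x
  fvA-ηs : ∀ {Γ ρ σ} (πs : Ctx) (w : Γ ∋ ρ) (f : Ren πs Γ) {s : Tm Γ σ} → s ∈ₐ ηs πs f → FvT w s →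
         Σ Type λ π → Σ (πs ∋ π) λ i → VarEq w (f i)
  fvT-η {τ = πs ⇒ a} w x (lamF f) with fvB-∙⁻ f
  ... | inj₁ (y , eq , e) rewrite sym (var-injective eq) = varEq-injective (wkR-injective πs) e
  ... | inj₂ (σ , t , m , f') with fvA-ηs πs (wkR πs w) (injL πs) m f'
  ... | π , i , e with varEq-type e
  ... | refl = ⊥-elim (injL≢wkR πs i w (sym (varEq-≡ e)))
  fvA-ηs (π ∷ πs) w f hereₐ fv = π , here , fvT-η w (f here) fv
  fvA-ηs (π ∷ πs) w f (thereₐ m) fv with fvA-ηs πs w (λ z → f (there z)) m fv
  ... | π' , i , e = π' , there i , e

  fvT-expand⇒fvP : ∀ {Δ ρ τ} {v : Δ ∋ ρ} (p : PApp Δ τ) → FvT v (expand p) → FvP v p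
  fvT-expand⇒fvP {v = v} (papp {τs = τs} h ss) (lamF f) with fvB-∙⁻ f
  fvT-expand⇒fvP {v = v} (papp {τs = τs} (var y) ss) (lamF f) | inj₁ (y' , eq , e)
    rewrite sym (var-injective eq) = fvHead (varEq-injective (wkR-injective τs) e)
  fvT-expand⇒fvP {v = v} (papp {τs = τs} (fun g) ss) (lamF f) | inj₁ (y' , () , e)
  ... | inj₂ (σ , t , m , f') with ∈-++ (renA (wkR τs) ss) (ηs τs (injL τs)) m
  ... | inj₁ m₁ with ∈-renA⁻ (wkR τs) ss m₁
  ... | s , m₂ , refl with fvT-renT⁻ (wkR τs) s f'
  ... | v₀ , eq , f'' rewrite wkR-injective τs eq = fvArg m₂ f''
  fvT-expand⇒fvP {v = v} (papp {τs = τs} h ss) (lamF f) | inj₂ (σ , t , m , f') | inj₂ m₁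
    with fvA-ηs τs (wkR τs v) (injL τs) m₁ f'
  ... | π , i , e with varEq-type e
  ... | refl = ⊥-elim (injL≢wkR τs i v (sym (varEq-≡ e)))

  liftP-wkR : ∀ {Δ Δ'} (σs : Ctx) (R : PSub Δ Δ') {τ} (x : Δ ∋ τ) →
              liftP σs R (wkR σs x) ≡ renP (wkR σs) (R x)
  liftP-wkR [] R x = sym (renP-id (λ z → refl) (R x))
  liftP-wkR (σ ∷ σs) R x = trans (cong (renP there) (liftP-wkR σs R x)) (renP-comp there (wkR σs) (R x))

  liftP-injL : ∀ {Δ Δ'} (σs : Ctx) (R : PSub Δ Δ') {τ} (i : σs ∋ τ) →
               liftP σs R (injL σs i) ≡ varP (injL σs i)
  liftP-injL ((τs ⇒ a) ∷ σs) R here = refl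
  liftP-injL (σ ∷ σs) R (there {τ = τs ⇒ a} i) = cong (renP there) (liftP-injL σs R i)

  renP-varP : ∀ {Δ Δ' τ} (f : Ren Δ Δ') (y : Δ ∋ τ) → renP f (varP y) ≡ varP (f y)
  renP-varP {τ = τs ⇒ a} f y = refl

  fvP-varP : ∀ {Δ ρ τ} {v : Δ ∋ ρ} (y : Δ ∋ τ) → FvP v (varP y) → VarEq v y
  fvP-varP {τ = τs ⇒ a} y (fvHead e) = e
  fvP-varP {τ = τs ⇒ a} y (fvArg () f)

  hrT-η : ∀ {Δ Δ' τ} (R : PSub Δ Δ') (x : Δ ∋ τ) (y : Δ' ∋ τ) → R x ≡ varP y → hrT R (η x) ≡ η y
  hrA-ηs : ∀ {Δ Δ'} (πs : Ctx) (R : PSub Δ Δ') (f : Ren πs Δ) (g : Ren πs Δ') →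
           (∀ {π} (i : πs ∋ π) → R (f i) ≡ varP (g i)) → hrA R (ηs πs f) ≡ ηs πs g
  hrT-η {τ = πs ⇒ a} R x y eq =
    cong lam (trans (cong (λ p → appP p (hrA (liftP πs R) (ηs πs (injL πs))))
                      (trans (liftP-wkR πs R x) (trans (cong (renP (wkR πs)) eq) (renP-varP (wkR πs) y))))
                    (cong (var (wkR πs y) ∙_) (hrA-ηs πs (liftP πs R) (injL πs) (injL πs) (liftP-injL πs R))))
  hrA-ηs [] R f g eq = refl
  hrA-ηs (π ∷ πs) R f g eq =
    cong₂ _∷ₐ_ (hrT-η R (f here) (g here) (eq here))
        (hrA-ηs πs R (λ z → f (there z)) (λ z → g (there z)) (λ i → eq (there i)))

  expand-appP : ∀ {Δ τs a} (q : PApp Δ (τs ⇒ a)) → expand q ≡ lam (appP (renP (wkR τs) q) (ηs τs (injL τs)))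
  expand-appP (papp h ss) = refl

  hrT-expand : ∀ {Δ Δ' τ} (R : PSub Δ Δ') (p : PApp Δ τ) → hrT R (expand p) ≡ expand (hrP R p)
  hrT-expand R (papp {σs} {τs} h ss) =
    trans (cong lam (trans (hrB-appP (liftP τs R) (renP (wkR τs) (papp h ss)) (ηs τs (injL τs)))
            (cong₂ appP
              (trans (hrP-ren (liftP τs R) (wkR τs) (papp h ss))
                (trans (hrP-ext (liftP-wkR τs R) (papp h ss)) (sym (renP-hrP (wkR τs) R (papp h ss)))))
              (hrA-ηs τs (liftP τs R) (injL τs) (injL τs) (liftP-injL τs R)))))
    (sym (expand-appP (hrP R (papp h ss))))

  hrA-! : ∀ {Δ Δ' σs} (R : PSub Δ Δ') (ts : Args Δ σs) (i : Fin (length σs)) → hrA R ts ! i ≡ hrT R (ts ! i)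
  hrA-! R (t ∷ₐ ts) zero = refl
  hrA-! R (t ∷ₐ ts) (suc i) = hrA-! R ts i

  ContainsB : ∀ {Δ a ρs b} → Bd Δ a → PApp Δ (ρs ⇒ b) → Set
  ContainsB {Δ} {ρs = ρs} c p =
    Σ Ctx λ Ω → Σ (Δ ⊑ Ω) λ e → Σ (Args Ω ρs) λ rest → OccB c e (appP (renP (wkE e) p) rest)

  occB-appP-arg : ∀ {Δ L a Ξ a' σ} (p : PApp Δ (L ⇒ a)) (X : Args Δ L) {t : Tm Δ σ} {e : Δ ⊑ Ξ} {c : Bd Ξ a'} →
                 t ∈ₐ X → OccT t e c → OccB (appP p X) e c
  occB-appP-arg (papp h ss) X m o = argO (∈-++ʳ ss m) o

  renP-wkE-step : ∀ {Γ Ξ} (σs : Ctx) (e : (σs ++ Γ) ⊑ Ξ) {τ} (p : PApp Γ τ) →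
                  renP (wkE (step σs base ⊙ e)) p ≡ renP (wkE e) (renP (wkR σs) p)
  renP-wkE-step σs e p = trans (renP-ext (wkE-⊙ (step σs base) e) p) (sym (renP-comp (wkE e) (wkR σs) p))

  contains-hrT-fv : ∀ {Δ Δ' τ ρs b} (R : PSub Δ Δ') (t : Tm Δ τ) {z : Δ ∋ (ρs ⇒ b)} → FvT z t →
                    Contains (hrT R t) (R z)
  containsB-hrB-fv : ∀ {Δ Δ' a ρs b} (R : PSub Δ Δ') (c : Bd Δ a) {z : Δ ∋ (ρs ⇒ b)} → FvB z c →
                     ContainsB (hrB R c) (R z)
  contains-hrA-fv : ∀ {Δ Δ' σ L ρs b} (R : PSub Δ Δ') (ts : Args Δ L) {z : Δ ∋ (ρs ⇒ b)} {t : Tm Δ σ} →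
                    t ∈ₐ ts → FvT z t → Σ (Tm Δ' σ) λ t' → (t' ∈ₐ hrA R ts) × Contains t' (R z)
  contains-hrT-fv R (lam {σs} b) {z} (lamF f) with containsB-hrB-fv (liftP σs R) b f
  ... | Ω , e , rest , o =
    Ω , step σs base ⊙ e , rest ,
    lamO (subst (λ q → OccB (hrB (liftP σs R) b) e (appP q rest))
            (trans (cong (renP (wkE e)) (liftP-wkR σs R z)) (sym (renP-wkE-step σs e (R z)))) o)
  containsB-hrB-fv R (h ∙ ts) {z} f with fvB-∙⁻ f
  ... | inj₁ (y , refl , e) with varEq-type e
  ... | refl with varEq-≡ e
  ... | refl = _ , base , hrA R ts ,
               subst (λ q → OccB (appP (R z) (hrA R ts)) base (appP q (hrA R ts))) (sym (renP-id (λ x → refl) (R z))) hereO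
  containsB-hrB-fv R (h ∙ ts) {z} f | inj₂ (σ , t , m , f') with contains-hrA-fv R ts m f'
  ... | t' , m' , Ω , e , rest , o = Ω , e , rest , occB-appP-arg (hrH R h) (hrA R ts) m' o
  contains-hrA-fv R (t ∷ₐ ts) hereₐ f = hrT R t , hereₐ , contains-hrT-fv R t f
  contains-hrA-fv R (u ∷ₐ ts) (thereₐ m) f with contains-hrA-fv R ts m f
  ... | t' , m' , k = t' , thereₐ m' , k

  fvB-appP⁻ : ∀ {Δ L a ρ} {v : Δ ∋ ρ} (p : PApp Δ (L ⇒ a)) (X : Args Δ L) → FvB v (appP p X) →
                 FvP v p ⊎ (Σ Type λ σ → Σ (Tm Δ σ) λ t → (t ∈ₐ X) × FvT v t)
  fvB-appP⁻ (papp h ss) X f with fvB-∙⁻ f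
  ... | inj₁ (y , refl , e) = inj₁ (fvHead e)
  ... | inj₂ (σ , t , m , f') with ∈-++ ss X m
  ... | inj₁ m₁ = inj₁ (fvArg m₁ f')
  ... | inj₂ m₂ = inj₂ (σ , t , m₂ , f')

  FvVia : ∀ {Δ Δ'} → PSub Δ Δ' → ∀ {ρ} → Δ' ∋ ρ → (∀ {τ'} → Δ ∋ τ' → Set) → Set
  FvVia R v fv = Σ Type λ τ' → Σ (_ ∋ τ') λ z → fv z × FvP v (R z)

  wkR-injL-distinct : ∀ (σs : Ctx) {Δ ρ τ} (v : Δ ∋ ρ) (i : σs ∋ τ) → VarEq (wkR σs v) (injL σs i) → ⊥
  wkR-injL-distinct σs v i e with varEq-type e
  ... | refl = injL≢wkR σs i v (sym (varEq-≡ e))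

  fvT-hrT⁻ : ∀ {Δ Δ' τ ρ} (R : PSub Δ Δ') (t : Tm Δ τ) {v : Δ' ∋ ρ} → FvT v (hrT R t) →
             FvVia R v (λ z → FvT z t)
  fvB-hrB⁻ : ∀ {Δ Δ' a ρ} (R : PSub Δ Δ') (c : Bd Δ a) {v : Δ' ∋ ρ} → FvB v (hrB R c) →
             FvVia R v (λ z → FvB z c)
  fvA-hrA⁻ : ∀ {Δ Δ' L L' a ρ σ} (R : PSub Δ Δ') (h : Head Δ (L ⇒ a)) (ts : Args Δ L') (ts₀ : Args Δ L)
             (sub : ∀ {σ'} {u : Tm Δ σ'} → u ∈ₐ ts → u ∈ₐ ts₀) {v : Δ' ∋ ρ} {t' : Tm Δ' σ} →
             t' ∈ₐ hrA R ts → FvT v t' → FvVia R v (λ z → FvB z (h ∙ ts₀))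
  fvT-hrT⁻ R (lam {σs} b) {v} (lamF f) with fvB-hrB⁻ (liftP σs R) b f
  ... | τ' , z' , fz , ip with blockView σs z'
  ... | inBlock i =
        ⊥-elim (wkR-injL-distinct σs v i (fvP-varP (injL σs i) (subst (FvP (wkR σs v)) (liftP-injL σs R i) ip)))
  ... | inOuter z =
        τ' , z , lamF fz , fvP-renP⁻ (wkR-injective σs) (R z) (subst (FvP (wkR σs v)) (liftP-wkR σs R z) ip)
  fvB-hrB⁻ R (h ∙ ts) f with fvB-appP⁻ (hrH R h) (hrA R ts) f
  fvB-hrB⁻ R (var z ∙ ts) f | inj₁ ip = _ , z , headF , ip
  fvB-hrB⁻ {Δ} R (fun g ∙ ts) f | inj₁ ip = ⊥-elim (noFun ip)
    where
    noFun : ∀ {Δ' ρ τs a} {v : Δ' ∋ ρ} {g : F (τs ⇒ a)} → FvP v (papp {σs = []} (fun g) nil) → ⊥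
    noFun (fvArg () _)
  ... | inj₂ (σ , t' , m , f') = fvA-hrA⁻ R h ts ts (λ m → m) m f'
  fvA-hrA⁻ R h (t ∷ₐ ts) ts₀ sub hereₐ f with fvT-hrT⁻ R t f
  ... | τ' , z , fz , ip = τ' , z , argF (sub hereₐ) fz , ip
  fvA-hrA⁻ R h (t ∷ₐ ts) ts₀ sub (thereₐ m) f = fvA-hrA⁻ R h ts ts₀ (λ m' → sub (thereₐ m')) m f

  -- Occurrences in the image of a substitution

  data LiftP {Δ Δ' : Ctx} : PSub Δ Δ' → ∀ {Ω Ω'} → Δ ⊑ Ω → Δ' ⊑ Ω' → PSub Ω Ω' → Set where
    pbase : ∀ {R : PSub Δ Δ'} → LiftP R base base R
    pstep : ∀ {R : PSub Δ Δ'} {Ω Ω'} {e : Δ ⊑ Ω} {e' : Δ' ⊑ Ω'} {R' : PSub Ω Ω'} (σs : Ctx) →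
            LiftP R e e' R' → LiftP R (step σs e) (step σs e') (liftP σs R')

  LiftP-⊙ : ∀ {Δ Δ' Ω₁ Ω₁' Ω₂ Ω₂'} {R : PSub Δ Δ'} {e₁ : Δ ⊑ Ω₁} {e₁' : Δ' ⊑ Ω₁'} {R₁ : PSub Ω₁ Ω₁'}
            {e₂ : Ω₁ ⊑ Ω₂} {e₂' : Ω₁' ⊑ Ω₂'} {R₂ : PSub Ω₂ Ω₂'} →
            LiftP R e₁ e₁' R₁ → LiftP R₁ e₂ e₂' R₂ → LiftP R (e₁ ⊙ e₂) (e₁' ⊙ e₂') R₂
  LiftP-⊙ l₁ pbase = l₁
  LiftP-⊙ l₁ (pstep σs l₂) = pstep σs (LiftP-⊙ l₁ l₂)

  LiftP-wkE : ∀ {Δ Δ' Ω Ω'} {R : PSub Δ Δ'} {e : Δ ⊑ Ω} {e' : Δ' ⊑ Ω'} {R' : PSub Ω Ω'} →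
               LiftP R e e' R' → ∀ {τ} (x : Δ ∋ τ) → R' (wkE e x) ≡ renP (wkE e') (R x)
  LiftP-wkE pbase x = sym (renP-id (λ z → refl) _)
  LiftP-wkE (pstep {e = e} {e' = e'} σs l) x =
    trans (liftP-wkR σs _ (wkE e x))
        (trans (cong (renP (wkR σs)) (LiftP-wkE l x)) (renP-comp (wkR σs) (wkE e') _))

  -- An occurrence in hrB R b is either the image of an occurrence in b (FromSource), or lies
  -- inside an argument of the partial application R x substituted for a head variable x of b
  -- (InsideImage).
  record FromSource {Δ Δ' Ω' a'} (R : PSub Δ Δ') (e' : Δ' ⊑ Ω') (c' : Bd Ω' a')
              (occ : ∀ {Ω b} → Δ ⊑ Ω → Bd Ω b → Set) : Set where
    constructor fromSource
    field
      {Ω} : Ctx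
      e : Δ ⊑ Ω
      R' : PSub Ω Ω'
      c : Bd Ω a'
      lift : LiftP R e e' R'
      occ' : occ e c
      eqc : c' ≡ hrB R' c

  record InsideImage {Δ Δ' Ω' a'} (R : PSub Δ Δ') (e' : Δ' ⊑ Ω') (c' : Bd Ω' a')
              (occ : ∀ {Ω b} → Δ ⊑ Ω → Bd Ω b → Set) : Set where
    constructor insideImage
    field
      {Ω₁ Ω₁'} : Ctx
      e₁ : Δ ⊑ Ω₁
      e₁' : Δ' ⊑ Ω₁'
      R₁ : PSub Ω₁ Ω₁'
      lift : LiftP R e₁ e₁' R₁
      {ρs} : Ctx
      {b} : S
      x : Ω₁ ∋ (ρs ⇒ b)
      as : Args Ω₁ ρs
      occ₁ : occ e₁ (var x ∙ as)
      {σ} : Type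
      s : Tm Ω₁' σ
      mem : s ∈P R₁ x
      e₂ : Ω₁' ⊑ Ω'
      occ₂ : OccT s e₂ c'
      eqe : e' ≡ e₁' ⊙ e₂

  data IsHere {Γ : Ctx} {a : S} (b : Bd Γ a) : ∀ {Ξ a'} → Γ ⊑ Ξ → Bd Ξ a' → Set where
    isHere : IsHere b base b

  occB-appP⁻ : ∀ {Δ L a Ξ a'} (p : PApp Δ (L ⇒ a)) (X : Args Δ L) {e : Δ ⊑ Ξ} {c : Bd Ξ a'} →
                 OccB (appP p X) e c →
                 IsHere (appP p X) e c ⊎ ((Σ Type λ σ → Σ (Tm Δ σ) λ t → (t ∈P p) × OccT t e c) ⊎
                                          (Σ Type λ σ → Σ (Tm Δ σ) λ t → (t ∈ₐ X) × OccT t e c))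
  occB-appP⁻ (papp h ss) X hereO = inj₁ isHere
  occB-appP⁻ (papp h ss) X (argO m o) with ∈-++ ss X m
  ... | inj₁ m₁ = inj₂ (inj₁ (_ , _ , inP m₁ , o))
  ... | inj₂ m₂ = inj₂ (inj₂ (_ , _ , m₂ , o))

  HrOcc : ∀ {Δ Δ' Ω' a'} (R : PSub Δ Δ') (e' : Δ' ⊑ Ω') (c' : Bd Ω' a')
        (occ : ∀ {Ω b} → Δ ⊑ Ω → Bd Ω b → Set) → Set
  HrOcc R e' c' occ = FromSource R e' c' occ ⊎ InsideImage R e' c' occ

  occT-hrT⁻ : ∀ {Δ Δ' τ Ω' a'} (R : PSub Δ Δ') (t : Tm Δ τ) {e' : Δ' ⊑ Ω'} {c' : Bd Ω' a'} →
         OccT (hrT R t) e' c' → HrOcc R e' c' (λ e c → OccT t e c)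
  occB-hrB⁻ : ∀ {Δ Δ' a Ω' a'} (R : PSub Δ Δ') (b : Bd Δ a) {e' : Δ' ⊑ Ω'} {c' : Bd Ω' a'} →
         OccB (hrB R b) e' c' → HrOcc R e' c' (λ e c → OccB b e c)
  occA-hrA⁻ : ∀ {Δ Δ' L L' a Ω' a' σ} (R : PSub Δ Δ') (h : Head Δ (L ⇒ a)) (ts : Args Δ L') (ts₀ : Args Δ L)
          (sub : ∀ {σ'} {u : Tm Δ σ'} → u ∈ₐ ts → u ∈ₐ ts₀) {t' : Tm Δ' σ} {e' : Δ' ⊑ Ω'} {c' : Bd Ω' a'} →
          t' ∈ₐ hrA R ts → OccT t' e' c' → HrOcc R e' c' (λ e c → OccB (h ∙ ts₀) e c)
  occT-hrT⁻ R (lam {σs} b) (lamO {e = e''} o) with occB-hrB⁻ (liftP σs R) b o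
  ... | inj₁ (fromSource e R' c l o' eq) =
    inj₁ (fromSource (step σs base ⊙ e) R' c (LiftP-⊙ (pstep σs pbase) l) (lamO o') eq)
  ... | inj₂ (insideImage e₁ e₁' R₁ l x as o₁ s mem e₂ o₂ eqe) =
    inj₂ (insideImage (step σs base ⊙ e₁) (step σs base ⊙ e₁') R₁ (LiftP-⊙ (pstep σs pbase) l) x as
            (lamO o₁) s mem e₂ o₂ (trans (cong (step σs base ⊙_) eqe) (sym (⊙-assoc (step σs base) e₁' e₂))))
  occB-hrB⁻ R (h ∙ ts) o with occB-appP⁻ (hrH R h) (hrA R ts) o
  ... | inj₁ isHere = inj₁ (fromSource base R (h ∙ ts) pbase hereO refl)
  occB-hrB⁻ R (var x ∙ ts) {e'} o | inj₂ (inj₁ (σ , t , mem , o')) =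
    inj₂ (insideImage base base R pbase x ts hereO t mem e' o' (sym (⊙-idˡ e')))
  occB-hrB⁻ R (fun f ∙ ts) o | inj₂ (inj₁ (σ , t , inP () , o'))
  ... | inj₂ (inj₂ (σ , t , m , o')) = occA-hrA⁻ R h ts ts (λ m → m) m o'
  occA-hrA⁻ R h (t ∷ₐ ts) ts₀ sub hereₐ o with occT-hrT⁻ R t o
  ... | inj₁ (fromSource e R' c l o' eq) = inj₁ (fromSource e R' c l (argO (sub hereₐ) o') eq)
  ... | inj₂ (insideImage e₁ e₁' R₁ l x as o₁ s mem e₂ o₂ eqe) = inj₂
      (insideImage e₁ e₁' R₁ l x as (argO (sub hereₐ) o₁) s mem e₂ o₂ eqe)
  occA-hrA⁻ R h (t ∷ₐ ts) ts₀ sub (thereₐ m) o = occA-hrA⁻ R h ts ts₀ (λ m' → sub (thereₐ m')) m o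

  data Prefix {Δ : Ctx} : ∀ {τ τ'} → PApp Δ τ → PApp Δ τ' → Set where
    prefix : ∀ {N L a} (p : PApp Δ ((N ++ L) ⇒ a)) (c : Args Δ N) → Prefix p (supplyP p c)

  ∙-injective-≅ : ∀ {Γ a} {L L' : Ctx} {h : Head Γ (L ⇒ a)} {h' : Head Γ (L' ⇒ a)} {as : Args Γ L} {as' : Args Γ L'} →
            h ∙ as ≡ h' ∙ as' → (L ≡ L') × (h ≅ h') × (as ≅ as')
  ∙-injective-≅ refl = refl , H.refl , H.refl

  ∷ₐ-injective-≅ : ∀ {Γ σ} {A B : Ctx} {x y : Tm Γ σ} {T₁ : Args Γ A} {T₂ : Args Γ B} →
            A ≡ B → (x ∷ₐ T₁) ≅ (y ∷ₐ T₂) → (x ≡ y) × (T₁ ≅ T₂)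
  ∷ₐ-injective-≅ refl H.refl = refl , H.refl

  ArgsPrefix : ∀ {Γ} {L₁ M₁ L₂ M₂ : Ctx} → Args Γ L₁ → Args Γ L₂ → Set
  ArgsPrefix {Γ} {L₁} {M₁} {L₂} {M₂} a₁ a₂ =
    Σ Ctx λ N → Σ (Args Γ N) λ c → (L₂ ≡ L₁ ++ N) × (M₁ ≡ N ++ M₂) × (a₂ ≅ (a₁ ++ₐ c))

  ++ₐ-prefix : ∀ {Γ} {L₁ M₁ L₂ M₂ : Ctx} (a₁ : Args Γ L₁) (b₁ : Args Γ M₁) (a₂ : Args Γ L₂) (b₂ : Args Γ M₂) →
           L₁ ++ M₁ ≡ L₂ ++ M₂ → (a₁ ++ₐ b₁) ≅ (a₂ ++ₐ b₂) →
           ArgsPrefix {M₁ = M₁} {M₂ = M₂} a₁ a₂ ⊎ ArgsPrefix {M₁ = M₂} {M₂ = M₁} a₂ a₁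
  ++ₐ-prefix nil b₁ a₂ b₂ eq heq = inj₁ (_ , a₂ , refl , eq , H.refl)
  ++ₐ-prefix {L₁ = σ ∷ L₁} (x ∷ₐ a₁) b₁ nil b₂ eq heq = inj₂ (_ , x ∷ₐ a₁ , refl , sym eq , H.refl)
  ++ₐ-prefix {L₁ = σ ∷ L₁} {M₁} {σ' ∷ L₂} {M₂} (x ∷ₐ a₁) b₁ (y ∷ₐ a₂) b₂ eq heq with ∷-injectiveˡ eq
  ... | refl with ∷ₐ-injective-≅ (∷-injectiveʳ eq) heq
  ... | refl , heq' with ++ₐ-prefix a₁ b₁ a₂ b₂ (∷-injectiveʳ eq) heq'
  ... | inj₁ (N , c , e₁ , e₂ , h) = inj₁ (N , c , cong (σ ∷_) e₁ , e₂ , ∷ₐ-≅ e₁ h)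
  ... | inj₂ (N , c , e₁ , e₂ , h) = inj₂ (N , c , cong (σ ∷_) e₁ , e₂ , ∷ₐ-≅ e₁ h)

  appP-prefix : ∀ {Δ Lx Ly a} (p : PApp Δ (Lx ⇒ a)) (p' : PApp Δ (Ly ⇒ a)) (X : Args Δ Lx) (Y : Args Δ Ly) →
       appP p X ≡ appP p' Y → Prefix p p' ⊎ Prefix p' p
  appP-prefix {Lx = Lx} {Ly} (papp {σ₁} h₁ ss₁) (papp {σ₂} h₂ ss₂) X Y eq with ∙-injective-≅ eq
  ... | eqL , hh , ha with ++ₐ-prefix ss₁ X ss₂ Y eqL ha
  ... | inj₁ (N , c , refl , refl , hs) with H.≅-to-≡ hs
  ...   | refl = inj₁ (subst (Prefix (papp h₁ ss₁))
                         (cong (λ z → papp z (ss₁ ++ₐ c))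
                           (H.≅-to-≡ (H.trans (castH-≅ (sym (++-assoc σ₁ N Ly)) h₁) hh)))
                         (prefix (papp h₁ ss₁) c))
  appP-prefix {Lx = Lx} {Ly} (papp {σ₁} h₁ ss₁) (papp {σ₂} h₂ ss₂) X Y eq
    | eqL , hh , ha | inj₂ (N , c , refl , refl , hs) with H.≅-to-≡ hs
  ...   | refl = inj₂ (subst (Prefix (papp h₂ ss₂))
                         (cong (λ z → papp z (ss₂ ++ₐ c))
                           (H.≅-to-≡ (H.trans (castH-≅ (sym (++-assoc σ₂ N Lx)) h₂) (H.sym hh))))
                         (prefix (papp h₂ ss₂) c))

  prefix-contains : ∀ {Δ L L' a} {p : PApp Δ (L ⇒ a)} {p' : PApp Δ (L' ⇒ a)} → Prefix p p' →
                    Contains (expand p') p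
  prefix-contains {L' = L'} (prefix p c) =
    _ , step L' base , renA (wkR L') c ++ₐ ηs L' (injL L') ,
    subst (λ z → OccT z (step L' base ⊙ base) (appP (renP (wkR L') p) (renA (wkR L') c ++ₐ ηs L' (injL L'))))
      (sym (trans (expand-appP (supplyP p c))
        (cong lam (trans (cong (λ q → appP q (ηs L' (injL L'))) (renP-supplyP (wkR L') p c))
                         (appP-supplyP (renP (wkR L') p) (renA (wkR L') c) (ηs L' (injL L')))))))
      (lamO hereO)

  lookupP : ∀ {Δ τs τ} → PArgs Δ τs → τs ∋ τ → PApp Δ τ
  lookupP (p ∷ₚ ps) here = p
  lookupP (p ∷ₚ ps) (there k) = lookupP ps k

  instP-injL : ∀ {Δ τs τ} (ps : PArgs Δ τs) (k : τs ∋ τ) → instP ps (injL τs k) ≡ lookupP ps k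
  instP-injL (p ∷ₚ ps) here = refl
  instP-injL (p ∷ₚ ps) (there k) = instP-injL ps k

  varEq? : ∀ {Γ τ τ'} (x : Γ ∋ τ) (y : Γ ∋ τ') → VarEq x y ⊎ ¬ VarEq x y
  varEq? here here = inj₁ vrefl
  varEq? here (there y) = inj₂ (λ ())
  varEq? (there x) here = inj₂ (λ ())
  varEq? (there x) (there y) with varEq? x y
  ... | inj₁ vrefl = inj₁ vrefl
  ... | inj₂ ne = inj₂ (λ { vrefl → ne vrefl })

  PAppEq : ∀ {Δ τs a} {σs σs' : Ctx} → σs ≡ σs' → Head Δ ((σs ++ τs) ⇒ a) → Head Δ ((σs' ++ τs) ⇒ a) →
          Args Δ σs → Args Δ σs' → Set
  PAppEq refl h h' ss ss' = (h ≡ h') × (ss ≡ ss')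

  papp-injective : ∀ {Δ τs a} {σs σs' : Ctx} {h : Head Δ ((σs ++ τs) ⇒ a)} {h' : Head Δ ((σs' ++ τs) ⇒ a)}
                   {ss : Args Δ σs} {ss' : Args Δ σs'} →
                   papp h ss ≡ papp h' ss' → Σ (σs ≡ σs') λ e → PAppEq e h h' ss ss'
  papp-injective refl = refl , refl , refl

  renP-injective : ∀ {Δ Δ' τ} {ρ : Ren Δ Δ'} → InjectiveR ρ → (p p' : PApp Δ τ) → renP ρ p ≡ renP ρ p' → p ≡ p'
  renP-injective inj (papp h ss) (papp h' ss') eq with papp-injective eq
  ... | refl , e₁ , e₂ rewrite renH-injective inj e₁ | renA-injective inj ss ss' e₂ = refl

  varP-injective : ∀ {Δ τ} (x y : Δ ∋ τ) → varP x ≡ varP y → x ≡ y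
  varP-injective {τ = τs ⇒ a} x y refl = refl

  varP≢renP-wkR : ∀ {Δ τ} (σs : Ctx) (i : σs ∋ τ) (p : PApp Δ τ) →
                  varP {Δ = σs ++ Δ} (injL σs i) ≡ renP (wkR σs) p → ⊥
  varP≢renP-wkR {τ = τs ⇒ a} σs i (papp (var w) ss) eq with papp-injective eq
  ... | refl , e₁ , e₂ = injL≢wkR σs i w (var-injective e₁)
  varP≢renP-wkR {τ = τs ⇒ a} σs i (papp (fun f) ss) eq with papp-injective eq
  ... | refl , () , e₂

  injL-injective : ∀ (σs : Ctx) {Δ τ} {i j : σs ∋ τ} → injL {Δ} σs i ≡ injL σs j → i ≡ j
  injL-injective (σ ∷ σs) {i = here} {here} eq = refl
  injL-injective (σ ∷ σs) {i = here} {there j} ()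
  injL-injective (σ ∷ σs) {i = there i} {here} ()
  injL-injective (σ ∷ σs) {i = there i} {there j} eq = cong there (injL-injective σs (there-injective eq))

  record RenOcc⁺ {Δ Δ' Ω a} (ρ : Ren Δ Δ') (e : Δ ⊑ Ω) (c : Bd Ω a)
      (occ : ∀ {Ω'} → Δ' ⊑ Ω' → Bd Ω' a → Set) : Set where
    constructor renOcc⁺
    field
      {Ω'} : Ctx
      e' : Δ' ⊑ Ω'
      ρ' : Ren Ω Ω'
      lift : LiftR ρ e e' ρ'
      occ' : occ e' (renB ρ' c)

  occT-renT⁺ : ∀ {Δ Δ' τ Ω a} (ρ : Ren Δ Δ') {t : Tm Δ τ} {e : Δ ⊑ Ω} {c : Bd Ω a} →
                 OccT t e c → RenOcc⁺ ρ e c (OccT (renT ρ t))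
  occB-renB⁺ : ∀ {Δ Δ' b Ω a} (ρ : Ren Δ Δ') {t : Bd Δ b} {e : Δ ⊑ Ω} {c : Bd Ω a} →
                 OccB t e c → RenOcc⁺ ρ e c (OccB (renB ρ t))
  occT-renT⁺ ρ (lamO {σs = σs} o) with occB-renB⁺ (liftR σs ρ) o
  ... | renOcc⁺ e' ρ' l o' = renOcc⁺ (step σs base ⊙ e') ρ' (LiftR-⊙ (lstep σs lbase) l) (lamO o')
  occB-renB⁺ ρ hereO = renOcc⁺ base ρ lbase hereO
  occB-renB⁺ ρ (argO m o) with occT-renT⁺ ρ o
  ... | renOcc⁺ e' ρ' l o' = renOcc⁺ e' ρ' l (argO (∈-renA⁺ ρ m) o')

  contains-renT⁺ : ∀ {Δ Δ' τ ρs a} (ρ : Ren Δ Δ') (t : Tm Δ τ) (p : PApp Δ (ρs ⇒ a)) → Contains t p →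
                   Contains (renT ρ t) (renP ρ p)
  contains-renT⁺ ρ t p (Ω , e , rest , o) with occT-renT⁺ ρ o
  ... | renOcc⁺ e' ρ' l o' =
    _ , e' , renA ρ' rest ,
    subst (OccT (renT ρ t) e')
      (trans (renB-appP ρ' (renP (wkE e) p) rest)
        (cong (λ q → appP q (renA ρ' rest))
          (trans (renP-comp ρ' (wkE e) p)
            (trans (renP-ext (LiftR-wkE l) p) (sym (renP-comp (wkE e') ρ p)))))) o'

  fvP⇒fvB-appP : ∀ {Δ ρ L a} {w : Δ ∋ ρ} (P : PApp Δ (L ⇒ a)) (X : Args Δ L) → FvP w P → FvB w (appP P X)
  fvP⇒fvB-appP (papp (var y) ss) X (fvHead vrefl) = headF
  fvP⇒fvB-appP (papp h ss) X (fvArg m f) = argF (∈-++ˡ X m) f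

  contains-fv : ∀ {Δ τ ρs a ρ} {w : Δ ∋ ρ} (t : Tm Δ τ) (P : PApp Δ (ρs ⇒ a)) → Contains t P → FvP w P → FvT w t
  contains-fv {w = w} t P (Ω , e , rest , o) ip = occT-fv w o
      (fvP⇒fvB-appP (renP (wkE e) P) rest (fvP-renP⁺ (wkE e) P ip))

  ∈P⇒fvP : ∀ {Δ σ τ ρ} {w : Δ ∋ ρ} {s : Tm Δ σ} {P : PApp Δ τ} → s ∈P P → FvT w s → FvP w P
  ∈P⇒fvP (inP m) f = fvArg m f

  ∈P-varP : ∀ {Δ σ τ} {s : Tm Δ σ} (v : Δ ∋ τ) → s ∈P varP v → ⊥
  ∈P-varP {τ = τs ⇒ a} v (inP ())

  ∈P-renP⁻ : ∀ {Δ Δ' σ τ} (ρ : Ren Δ Δ') {s : Tm Δ' σ} (P : PApp Δ τ) → s ∈P renP ρ P →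
            Σ (Tm Δ σ) λ s₀ → (s₀ ∈P P) × (s ≡ renT ρ s₀)
  ∈P-renP⁻ ρ (papp h ss) (inP m) with ∈-renA⁻ ρ ss m
  ... | s₀ , m' , eq = s₀ , inP m' , eq

  appP-cancel : ∀ {Δ L a} (p : PApp Δ (L ⇒ a)) (X Y : Args Δ L) → appP p X ≡ appP p Y → X ≡ Y
  appP-cancel (papp h ss) X Y eq with ∙-injective eq
  ... | refl , _ , ea = proj₂ (++ₐ-cancel ss ss X Y ea)

  expand-injective : ∀ {Δ τs a} (p p' : PApp Δ (τs ⇒ a)) → expand p ≡ expand p' → p ≡ p'
  expand-injective {τs = τs} (papp {σ₁} h₁ ss₁) (papp {σ₂} h₂ ss₂) eq with ∙-injective-≅ (lam-injective eq)
  ... | eqL , hh , ha with ++-cancelʳ τs σ₁ σ₂ eqL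
  ... | refl with H.≅-to-≡ hh | H.≅-to-≡ ha
  ... | eh | ea with ++ₐ-cancel (renA (wkR τs) ss₁) (renA (wkR τs) ss₂) _ _ ea
  ... | e₁ , _ rewrite renH-injective (wkR-injective τs) eh | renA-injective
      (wkR-injective τs) ss₁ ss₂ e₁ = refl

  HeadName : Ctx → Set
  HeadName Δ = (Σ Type λ ρ → Δ ∋ ρ) ⊎ (Σ Type λ τ → F τ)

  headName : ∀ {Δ τ} → Head Δ τ → HeadName Δ
  headName (var x) = inj₁ (_ , x)
  headName (fun f) = inj₂ (_ , f)

  headName-castH : ∀ {Δ a} {L L' : Ctx} (e : L ≡ L') (h : Head Δ (L ⇒ a)) → headName (castH e h) ≡ headName h
  headName-castH refl h = refl

  headName-var : ∀ {Δ ρ ρ'} {x : Δ ∋ ρ} {y : Δ ∋ ρ'} →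
                 _≡_ {A = HeadName Δ} (inj₁ (ρ , x)) (inj₁ (ρ' , y)) → VarEq x y
  headName-var refl = vrefl

  argTypesP : ∀ {Δ τ} → PApp Δ τ → Ctx
  argTypesP (papp {σs} h ss) = σs

  argsP : ∀ {Δ τ} (p : PApp Δ τ) → Args Δ (argTypesP p)
  argsP (papp h ss) = ss

  headNameP : ∀ {Δ τ} → PApp Δ τ → HeadName Δ
  headNameP (papp h ss) = headName h

  record PrefixView {Δ τ τ'} (p : PApp Δ τ) (p' : PApp Δ τ') : Set where
    constructor prefixView
    field
      N : Ctx
      c : Args Δ N
      eqσ : argTypesP p' ≡ argTypesP p ++ N
      eqa : argsP p' ≅ (argsP p ++ₐ c)
      eqh : headNameP p ≡ headNameP p'

  prefix-view : ∀ {Δ τ τ'} {p : PApp Δ τ} {p' : PApp Δ τ'} → Prefix p p' → PrefixView p p'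
  prefix-view {Δ} (prefix {N} {L} (papp {σs} h ss) c) = prefixView N c refl H.refl
      (sym (headName-castH (sym (++-assoc σs N L)) h))

  ∈-≅ : ∀ {Δ σ} {L L' : Ctx} {as : Args Δ L} {as' : Args Δ L'} {t : Tm Δ σ} → L ≡ L' → as ≅ as' → t ∈ₐ as →
        t ∈ₐ as'
  ∈-≅ refl H.refl m = m

  varEq-sym : ∀ {Δ ρ ρ'} {x : Δ ∋ ρ} {y : Δ ∋ ρ'} → VarEq x y → VarEq y x
  varEq-sym vrefl = vrefl

  prefix-refl : ∀ {Δ L a} (p : PApp Δ (L ⇒ a)) → Prefix p p
  prefix-refl p = subst (Prefix p) (supplyP-nil p) (prefix {N = []} p nil)

  liftSE : ∀ {Γ Ξ} → Γ ⊑ Ξ → Subst Γ → Subst Ξ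
  liftSE base θ = θ
  liftSE (step σs e) θ = liftS σs (liftSE e θ)

  liftS-just⁻ : ∀ {Γ} (σs : Ctx) (θ : Subst Γ) {τ} (v : σs ++ Γ ∋ τ) (t : Tm (σs ++ Γ) τ) →
                liftS σs θ v ≡ just t →
               Σ (Γ ∋ τ) λ v₀ → Σ (Tm Γ τ) λ t₀ → (v ≡ wkR σs v₀) × (θ v₀ ≡ just t₀) × (t ≡ renT (wkR σs) t₀)
  liftS-just⁻ [] θ v t eq = v , t , refl , eq , sym (renT-id (λ x → refl) t)
  liftS-just⁻ (σ ∷ σs) θ here t ()
  liftS-just⁻ (σ ∷ σs) θ (there v) t eq with liftS σs θ v in e
  ... | just t₁ with liftS-just⁻ σs θ v t₁ e
  ...   | v₀ , t₀ , refl , e₂ , refl = v₀ , t₀ , refl , e₂ ,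
            trans (sym (just-injective eq)) (renT-comp there (wkR σs) t₀)

  liftSE-just⁻ : ∀ {Γ Ξ} (e₀ : Γ ⊑ Ξ) (θ : Subst Γ) {τ} (v : Ξ ∋ τ) (t : Tm Ξ τ) → liftSE e₀ θ v ≡ just t →
               Σ (Γ ∋ τ) λ g → Σ (Tm Γ τ) λ t₀ → (v ≡ wkE e₀ g) × (θ g ≡ just t₀) × (t ≡ renT (wkE e₀) t₀)
  liftSE-just⁻ base θ v t eq = v , t , refl , eq , sym (renT-id (λ x → refl) t)
  liftSE-just⁻ (step σs e) θ v t eq with liftS-just⁻ σs (liftSE e θ) v t eq
  ... | v₁ , t₁ , refl , e₂ , refl with liftSE-just⁻ e θ v₁ t₁ e₂
  ...   | g , t₀ , refl , e₃ , refl = g , t₀ , refl , e₃ , renT-comp (wkR σs) (wkE e) t₀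

  []T-fresh : ∀ {Δ τ} (θ : Subst Δ) (t : Tm Δ τ) → (∀ {ρ} (v : Δ ∋ ρ) → FvT v t → θ v ≡ nothing) → t [ θ ]T ≡ t
  []B-fresh : ∀ {Δ a} (θ : Subst Δ) (b : Bd Δ a) → (∀ {ρ} (v : Δ ∋ ρ) → FvB v b → θ v ≡ nothing) → b [ θ ]B ≡ b
  []A-fresh : ∀ {Δ σs} (θ : Subst Δ) (ts : Args Δ σs) →
              (∀ {σ} {t : Tm Δ σ} → t ∈ₐ ts → ∀ {ρ} (v : Δ ∋ ρ) → FvT v t → θ v ≡ nothing) → ts [ θ ]A ≡ ts
  []T-fresh θ (lam {σs} b) fresh = cong lam ([]B-fresh (liftS σs θ) b fresh′)
    where
    fresh′ : ∀ {ρ} (v : σs ++ _ ∋ ρ) → FvB v b → liftS σs θ v ≡ nothing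
    fresh′ v f with liftS σs θ v in θv
    ... | nothing = refl
    ... | just t with liftS-just⁻ σs θ v t θv
    ...   | v₀ , t₀ , refl , θv₀ , _ with trans (sym θv₀) (fresh v₀ (lamF f))
    ...     | ()
  []B-fresh θ (fun f ∙ ts) fresh = cong (fun f ∙_) ([]A-fresh θ ts (λ m v f → fresh v (argF m f)))
  []B-fresh θ (var x ∙ ts) fresh rewrite fresh x headF = cong (var x ∙_)
      ([]A-fresh θ ts (λ m v f → fresh v (argF m f)))
  []A-fresh θ nil fresh = refl
  []A-fresh θ (t ∷ₐ ts) fresh = cong₂ _∷ₐ_ ([]T-fresh θ t (fresh hereₐ))
      ([]A-fresh θ ts (λ m → fresh (thereₐ m)))

  []A-bound : ∀ {Γ Ξ σs} (θ : Subst Γ) (e₀ : Γ ⊑ Ξ) (as : Args Ξ σs) →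
              (∀ i {ρ} (g : Γ ∋ ρ) → ¬ FvT (wkE e₀ g) (as ! i)) → as [ liftSE e₀ θ ]A ≡ as
  []A-bound θ e₀ nil bound = refl
  []A-bound θ e₀ (t ∷ₐ as) bound =
    cong₂ _∷ₐ_ ([]T-fresh (liftSE e₀ θ) t fresh) ([]A-bound θ e₀ as (λ i → bound (suc i)))
    where
    fresh : ∀ {ρ} (v : _ ∋ ρ) → FvT v t → liftSE e₀ θ v ≡ nothing
    fresh v f with liftSE e₀ θ v in θv
    ... | nothing = refl
    ... | just u with liftSE-just⁻ e₀ θ v u θv
    ...   | g , _ , refl , _ , _ = ⊥-elim (bound zero g f)

  lookupA : ∀ {Δ L τ} → Args Δ L → L ∋ τ → Tm Δ τ
  lookupA (t ∷ₐ ts) here = t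
  lookupA (t ∷ₐ ts) (there k) = lookupA ts k

  toFin : ∀ {L τ} → L ∋ τ → Fin (length L)
  toFin here = zero
  toFin (there k) = suc (toFin k)

  lookupA-! : ∀ {Δ L τ} (ts : Args Δ L) (k : L ∋ τ) → Σ (lookup L (toFin k) ≡ τ) λ e →
              subst (Tm Δ) e (ts ! toFin k) ≡ lookupA ts k
  lookupA-! (t ∷ₐ ts) here = refl , refl
  lookupA-! (t ∷ₐ ts) (there k) = lookupA-! ts k

  toFin-injective : ∀ {L τ τ'} (k : L ∋ τ) (l : L ∋ τ') → toFin k ≡ toFin l → VarEq k l
  toFin-injective here here eq = vrefl
  toFin-injective here (there l) ()
  toFin-injective (there k) here ()
  toFin-injective (there k) (there l) eq with toFin-injective k l (Fin.suc-injective eq)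
  ... | vrefl = vrefl

  lookupA-expandAll : ∀ {Δ τs τ} (ps : PArgs Δ τs) (k : τs ∋ τ) →
                      lookupA (expandAll ps) k ≡ expand (lookupP ps k)
  lookupA-expandAll (p ∷ₚ ps) here = refl
  lookupA-expandAll (p ∷ₚ ps) (there k) = lookupA-expandAll ps k

  fvT-subst : ∀ {Δ σ σ' ρ} (e : σ ≡ σ') {z : Δ ∋ ρ} {u : Tm Δ σ} → FvT z u → FvT z (subst (Tm Δ) e u)
  fvT-subst refl f = f

  fvT-subst⁻ : ∀ {Δ σ σ' ρ} (e : σ ≡ σ') {z : Δ ∋ ρ} {u : Tm Δ σ} → FvT z (subst (Tm Δ) e u) → FvT z u
  fvT-subst⁻ refl f = f

  ⊵E-subst⁻ : ∀ {Δ σ σ' τ τ'} (e₁ : σ ≡ σ') (e₂ : τ ≡ τ') {u : Tm Δ σ} {v : Tm Δ τ} →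
               subst (Tm Δ) e₁ u ⊵E subst (Tm Δ) e₂ v → u ⊵E v
  ⊵E-subst⁻ refl refl x = x

  contains⇒⊵E : ∀ {Δ τ ρs a} (t : Tm Δ τ) (p : PApp Δ (ρs ⇒ a)) → Contains t p → t ⊵E expand p
  contains⇒⊵E t (papp h ss) (Ω , e , rest , o) = _ , h , ss , refl , Ω , e , rest , o

  expanded-args : ∀ {Δ L} (ts : Args Δ L) → (∀ i → Expanded (ts ! i)) → Σ (PArgs Δ L) λ ps → ts ≡ expandAll ps
  expanded-args nil ex = pnil , refl
  expanded-args {L = (ρs ⇒ a) ∷ L} (t ∷ₐ ts) ex with ex zero | expanded-args ts (λ i → ex (suc i))
  ... | σs , h , ss , refl | ps , refl = (papp h ss ∷ₚ ps) , refl

  -- DHPBelow e t: the DHP conditions for those subterms of t whose head is bound outside the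
  -- binder prefix e, i.e. in Γ.
  DHPBelow : ∀ {Γ Ξ τ} → Γ ⊑ Ξ → Tm Ξ τ → Set
  DHPBelow {Γ} {Ξ} e₀ t = ∀ {Ω σs a} (e : Ξ ⊑ Ω) (y : Γ ∋ (σs ⇒ a)) (ts : Args Ω σs) →
                          OccT t e (var (wkE (e₀ ⊙ e) y) ∙ ts) → DHPArgs (e₀ ⊙ e) ts

  DHPBelowB : ∀ {Γ Ξ a} → Γ ⊑ Ξ → Bd Ξ a → Set
  DHPBelowB {Γ} {Ξ} e₀ b = ∀ {Ω σs a} (e : Ξ ⊑ Ω) (y : Γ ∋ (σs ⇒ a)) (ts : Args Ω σs) →
                           OccB b e (var (wkE (e₀ ⊙ e) y) ∙ ts) → DHPArgs (e₀ ⊙ e) ts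

  DHP⇒DHPBelow : ∀ {Γ τ} {s : Tm Γ τ} → DHP s → DHPBelow base s
  DHP⇒DHPBelow {s = s} dhp e y ts o =
    subst (λ E → DHPArgs E ts) (sym (⊙-idˡ e))
      (dhp e y ts (subst (λ E → OccT s e (var (wkE E y) ∙ ts)) (⊙-idˡ e) o))

  DHPBelow⇒DHP : ∀ {Γ τ} {s : Tm Γ τ} → DHPBelow base s → DHP s
  DHPBelow⇒DHP {s = s} dhp e y ts o =
    subst (λ E → DHPArgs E ts) (⊙-idˡ e)
      (dhp e y ts (subst (λ E → OccT s e (var (wkE E y) ∙ ts)) (sym (⊙-idˡ e)) o))

  DHPBelow-lam : ∀ {Γ Ξ σs a} {e₀ : Γ ⊑ Ξ} {b : Bd (σs ++ Ξ) a} →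
                 DHPBelow e₀ (lam b) → DHPBelowB (step σs e₀) b
  DHPBelow-lam {σs = σs} {e₀ = e₀} {b} dhp e y ts o =
    subst (λ E → DHPArgs E ts) (sym (⊙-assoc e₀ (step σs base) e))
      (dhp (step σs base ⊙ e) y ts
        (lamO (subst (λ E → OccB b e (var (wkE E y) ∙ ts)) (⊙-assoc e₀ (step σs base) e) o)))

  DHPBelow-lam⁻ : ∀ {Γ Ξ σs a} {e₀ : Γ ⊑ Ξ} {b : Bd (σs ++ Ξ) a} →
                  DHPBelowB (step σs e₀) b → DHPBelow e₀ (lam b)
  DHPBelow-lam⁻ {σs = σs} {e₀ = e₀} {b} dhp _ y ts (lamO {e = e} o) =
    subst (λ E → DHPArgs E ts) (⊙-assoc e₀ (step σs base) e)
      (dhp e y ts (subst (λ E → OccB b e (var (wkE E y) ∙ ts)) (sym (⊙-assoc e₀ (step σs base) e)) o))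

  DHPBelowB-arg : ∀ {Γ Ξ σs a σ} {e₀ : Γ ⊑ Ξ} {h : Head Ξ (σs ⇒ a)} {ts : Args Ξ σs} {t : Tm Ξ σ} →
                  DHPBelowB e₀ (h ∙ ts) → t ∈ₐ ts → DHPBelow e₀ t
  DHPBelowB-arg dhp m e y ts o = dhp e y ts (argO m o)

  contains-supplyP : ∀ {Δ τ σq ρs c} (t : Tm Δ τ) (P : PApp Δ ((σq ++ ρs) ⇒ c)) (X : Args Δ σq) →
                     Contains t (supplyP P X) → Contains t P
  contains-supplyP t P X (Ω , e , rest , o) =
    Ω , e , renA (wkE e) X ++ₐ rest ,
    subst (OccT t e) (trans (cong (λ q → appP q rest) (renP-supplyP (wkE e) P X))
        (appP-supplyP (renP (wkE e) P) (renA (wkE e) X) rest)) o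

  LiftP-renP-hrP : ∀ {Δ Δ' Ω Ω'} {R : PSub Δ Δ'} {e : Δ ⊑ Ω} {e' : Δ' ⊑ Ω'} {R' : PSub Ω Ω'} →
                   LiftP R e e' R' → ∀ {τ} (q : PApp Δ τ) → renP (wkE e') (hrP R q) ≡ hrP R' (renP (wkE e) q)
  LiftP-renP-hrP {R = R} {e} {e'} {R'} l q =
    trans (renP-hrP (wkE e') R q) (trans (hrP-ext (λ x → sym (LiftP-wkE l x)) q) (sym (hrP-ren R' (wkE e) q)))

  expand-Expanded : ∀ {Δ ρs a} (P : PApp Δ (ρs ⇒ a)) → Expanded (expand P)
  expand-Expanded (papp h ss) = _ , h , ss , refl

  -- Instantiating a block of DHP arguments

  -- Under binders e₀ over Γ, a subterm y(expand p⃗) with arguments satisfying the DHP conditions D;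
  -- substituting θ(y) = z⃗.w at y yields hrB R₀ w, where R₀ sends z_k to p_k.
  module Block {Γ Ξ : Ctx} (e₀ : Γ ⊑ Ξ) {τs : Ctx} (ps : PArgs Ξ τs) (D : DHPArgs e₀ (expandAll ps)) where

    block-fv : ∀ {τ} (k : τs ∋ τ) → Σ Type λ ρ → Σ (Ξ ∋ ρ) λ v → FvP v (lookupP ps k)
    block-fv k with lookupA-! (expandAll ps) k | D (toFin k)
    ... | e , eq | ((ρ , z , f) , _) , _ =
      ρ , z , fvT-expand⇒fvP (lookupP ps k) (subst (FvT z) (trans eq (lookupA-expandAll ps k)) (fvT-subst e f))

    block-bound : ∀ {τ ρ} (k : τs ∋ τ) (g : Γ ∋ ρ) → ¬ FvP (wkE e₀ g) (lookupP ps k)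
    block-bound k g fv with lookupA-! (expandAll ps) k | D (toFin k)
    ... | e , eq | (_ , bound) , _ =
      bound g (fvT-subst⁻ e (subst (FvT (wkE e₀ g)) (sym (trans eq (lookupA-expandAll ps k)))
                               (fvP⇒fvT-expand (lookupP ps k) fv)))

    block-⋭ : ∀ {τ ρs a} (k : τs ∋ τ) (l : τs ∋ (ρs ⇒ a)) → ¬ VarEq k l →
              ¬ Contains (expand (lookupP ps k)) (lookupP ps l)
    block-⋭ k l k≢l c with lookupA-! (expandAll ps) k | lookupA-! (expandAll ps) l | D (toFin k)
    ... | e₁ , eq₁ | e₂ , eq₂ | _ , _ , ⋭ =
      ⋭ (toFin l) (λ q → k≢l (toFin-injective k l q))
        (⊵E-subst⁻ e₁ e₂
          (subst₂ _⊵E_ (sym (trans eq₁ (lookupA-expandAll ps k))) (sym (trans eq₂ (lookupA-expandAll ps l)))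
            (contains⇒⊵E (expand (lookupP ps k)) (lookupP ps l) c)))

    OutsideW : ∀ {Ω' τ} → Ren Ξ Ω' → Ω' ∋ τ → Set
    OutsideW {τ = τ} W v = ∀ {u : Ξ ∋ τ} → W u ≢ v

    PlainVar : ∀ {Ω' τ} → Ren Ξ Ω' → Ω' ∋ τ → Set
    PlainVar {τ = τ} W v = OutsideW W v ⊎ Σ (Γ ∋ τ) λ g → v ≡ W (wkE e₀ g)

    data VarClass {Ω Ω'} (R : PSub Ω Ω') (W : Ren Ξ Ω') (Es : Γ ⊑ Ω) {τ} (z : Ω ∋ τ) : Set where
      blockVar : (k : τs ∋ τ) → R z ≡ renP W (lookupP ps k) → VarClass R W Es z
      plainVar : (v : Ω' ∋ τ) → R z ≡ varP v →
                 OutsideW W v ⊎ (Σ (Γ ∋ τ) λ g → (v ≡ W (wkE e₀ g)) × (z ≡ wkE Es g)) → VarClass R W Es z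

    -- The invariant of hrB R₀ w while it descends through the binders of w.  Es and Et are the
    -- binder prefixes over Γ in source and target, and W embeds the context Ξ of the arguments p⃗.
    -- Every variable is sent either to a block argument p_k (weakened by W) or to a variable, which
    -- can be a Γ-variable only if the source variable is that same Γ-variable.
    record Admissible {Ω Ω'} (R : PSub Ω Ω') (Es : Γ ⊑ Ω) (Et : Γ ⊑ Ω') : Set where
      field
        W : Ren Ξ Ω'
        W-injective : InjectiveR W
        Et-W : ∀ {ρ} (g : Γ ∋ ρ) → wkE Et g ≡ W (wkE e₀ g)
        varClass : ∀ {τ} (z : Ω ∋ τ) → VarClass R W Es z
        R-injective : ∀ {τ} (z₁ z₂ : Ω ∋ τ) → R z₁ ≡ R z₂ → z₁ ≡ z₂

    admissible-liftP : ∀ {Ω Ω'} {R : PSub Ω Ω'} {Es : Γ ⊑ Ω} {Et : Γ ⊑ Ω'} (σs : Ctx) →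
                       Admissible R Es Et → Admissible (liftP σs R) (Es ⊙ step σs base) (Et ⊙ step σs base)
    admissible-liftP {Ω} {Ω'} {R = R} {Es} {Et} σs G = record
      { W = W′
      ; W-injective = λ eq → G.W-injective (wkR-injective σs eq)
      ; Et-W = λ g → cong (wkR σs) (G.Et-W g)
      ; varClass = varClass′
      ; R-injective = R-injective′
      }
      where
      module G = Admissible G
      W′ : Ren Ξ (σs ++ Ω')
      W′ u = wkR σs (G.W u)
      liftP-varP : ∀ {τ} {x : Ω ∋ τ} {v : Ω' ∋ τ} → R x ≡ varP v → liftP σs R (wkR σs x) ≡ varP (wkR σs v)
      liftP-varP {x = x} {v} eq = trans (liftP-wkR σs R x) (trans (cong (renP (wkR σs)) eq) (renP-varP (wkR σs) v))
      varClass′ : ∀ {τ} (z : σs ++ Ω ∋ τ) → VarClass (liftP σs R) W′ (Es ⊙ step σs base) z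
      varClass′ z with blockView σs z
      ... | inBlock i = plainVar (injL σs i) (liftP-injL σs R i) (inj₁ (λ eq → injL≢wkR σs i (G.W _) (sym eq)))
      ... | inOuter x with G.varClass x
      ...   | blockVar k eq =
              blockVar k (trans (liftP-wkR σs R x) (trans (cong (renP (wkR σs)) eq) (renP-comp (wkR σs) G.W _)))
      ...   | plainVar v eq (inj₁ v∉W) = plainVar (wkR σs v) (liftP-varP eq) (inj₁ (λ e → v∉W (wkR-injective σs e)))
      ...   | plainVar v eq (inj₂ (g , e₁ , e₂)) =
              plainVar (wkR σs v) (liftP-varP eq) (inj₂ (g , cong (wkR σs) e₁ , cong (wkR σs) e₂))
      R-injective′ : ∀ {τ} (z₁ z₂ : σs ++ Ω ∋ τ) → liftP σs R z₁ ≡ liftP σs R z₂ → z₁ ≡ z₂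
      R-injective′ z₁ z₂ eq with blockView σs z₁ | blockView σs z₂
      ... | inBlock i | inBlock j =
            cong (injL σs) (injL-injective σs (varP-injective (injL σs i) (injL σs j)
              (trans (sym (liftP-injL σs R i)) (trans eq (liftP-injL σs R j)))))
      ... | inBlock i | inOuter x =
            ⊥-elim (varP≢renP-wkR σs i (R x) (trans (sym (liftP-injL σs R i)) (trans eq (liftP-wkR σs R x))))
      ... | inOuter x | inBlock j =
            ⊥-elim (varP≢renP-wkR σs j (R x) (trans (sym (liftP-injL σs R j)) (trans (sym eq) (liftP-wkR σs R x))))
      ... | inOuter x | inOuter y =
            cong (wkR σs) (G.R-injective x y (renP-injective (wkR-injective σs) (R x) (R y)
              (trans (sym (liftP-wkR σs R x)) (trans eq (liftP-wkR σs R y)))))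

    admissible-LiftP : ∀ {Ω Ω' Ω₁ Ω₁'} {R : PSub Ω Ω'} {Es : Γ ⊑ Ω} {Et : Γ ⊑ Ω'} {e : Ω ⊑ Ω₁} {e' : Ω' ⊑ Ω₁'}
                       {R' : PSub Ω₁ Ω₁'} → LiftP R e e' R' → Admissible R Es Et → Admissible R' (Es ⊙ e) (Et ⊙ e')
    admissible-LiftP pbase G = G
    admissible-LiftP (pstep σs l) G = admissible-liftP σs (admissible-LiftP l G)

    -- For k = m this is the size argument, for k ≠ m condition (iii).
    block-subterm-uncontained : ∀ {τ ρs a σ} (k : τs ∋ τ) (m : τs ∋ (ρs ⇒ a)) {s : Tm Ξ σ} →
                                s ∈P lookupP ps k → Contains s (lookupP ps m) → ⊥
    block-subterm-uncontained k m {s} s∈ c with varEq? k m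
    ... | inj₁ k≡m with varEq-type k≡m
    ...   | refl with varEq-≡ k≡m
    ...     | refl = smaller (lookupP ps k) s∈ c
      where
      smaller : ∀ {L a} (p : PApp Ξ (L ⇒ a)) → s ∈P p → Contains s p → ⊥
      smaller (papp h ss) (inP m′) (Ω , e , rest , o) =
        no-occ-with-larger-argument (renH (wkE e) h) (renA (wkE e) ss ++ₐ rest) o
          (∈-++ˡ rest (∈-renA⁺ (wkE e) m′)) (≤-reflexive (sym (sizeT-ren (wkE e) s)))
    block-subterm-uncontained k m {s} s∈ c | inj₂ k≢m = block-⋭ k m k≢m (lift (lookupP ps k) s∈)
      where
      lift : ∀ {τ} (p : PApp Ξ τ) → s ∈P p → Contains (expand p) (lookupP ps m)
      lift (papp {τs = L} h ss) (inP m′) with contains-renT⁺ (wkR L) s (lookupP ps m) c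
      ... | Ω , e , rest , o =
        Ω , step L base ⊙ e , rest ,
        lamO (argO (∈-++ˡ (ηs L (injL L)) (∈-renA⁺ (wkR L) m′))
          (subst (λ q → OccT (renT (wkR L) s) e (appP q rest)) (sym (renP-wkE-step L e (lookupP ps m))) o))

    distinct-blocks-not-prefix : ∀ {ρs a ρs'} {Ω'} (W : Ren Ξ Ω') → InjectiveR W →
                                 (k : τs ∋ (ρs ⇒ a)) (l : τs ∋ (ρs' ⇒ a)) → ¬ VarEq k l →
                                 ¬ Prefix (renP W (lookupP ps k)) (renP W (lookupP ps l))
    distinct-blocks-not-prefix W inj k l k≢l ex =
      block-⋭ l k (λ e → k≢l (varEq-sym e))
        (contains-renT⁻ inj (expand (lookupP ps l)) (lookupP ps k)
          (subst (λ t → Contains t (renP W (lookupP ps k))) (sym (renT-expand W (lookupP ps l))) (prefix-contains ex)))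

    distinct-blocks-incomparable : ∀ {ρs a ρs'} {Ω'} (W : Ren Ξ Ω') → InjectiveR W →
                                   (k : τs ∋ (ρs ⇒ a)) (l : τs ∋ (ρs' ⇒ a)) → ¬ VarEq k l →
                                   ¬ (Prefix (renP W (lookupP ps k)) (renP W (lookupP ps l)) ⊎
                                      Prefix (renP W (lookupP ps l)) (renP W (lookupP ps k)))
    distinct-blocks-incomparable W inj k l k≢l (inj₁ ex) = distinct-blocks-not-prefix W inj k l k≢l ex
    distinct-blocks-incomparable W inj k l k≢l (inj₂ ex) =
      distinct-blocks-not-prefix W inj l k (λ e → k≢l (varEq-sym e)) ex

    R₀ : PSub (τs ++ Γ) Ξ
    R₀ = instP ps ∘PR liftR τs (wkE e₀)

    admissible₀ : Admissible R₀ (step τs base) e₀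
    admissible₀ = record
      { W = idR
      ; W-injective = λ eq → eq
      ; Et-W = λ g → refl
      ; varClass = varClass₀
      ; R-injective = R₀-injective
      }
      where
      R₀-injL : ∀ {τ} (k : τs ∋ τ) → R₀ (injL τs k) ≡ lookupP ps k
      R₀-injL k = trans (cong (instP ps) (liftR-injL τs (wkE e₀) k)) (instP-injL ps k)
      R₀-wkR : ∀ {τ} (g : Γ ∋ τ) → R₀ (wkR τs g) ≡ varP (wkE e₀ g)
      R₀-wkR g = trans (cong (instP ps) (liftR-wkR τs (wkE e₀) g)) (instP-wkR ps (wkE e₀ g))
      varClass₀ : ∀ {τ} (z : τs ++ Γ ∋ τ) → VarClass R₀ idR (step τs base) z
      varClass₀ z with blockView τs z
      ... | inBlock k = blockVar k (trans (R₀-injL k) (sym (renP-id (λ x → refl) (lookupP ps k))))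
      ... | inOuter g = plainVar (wkE e₀ g) (R₀-wkR g) (inj₂ (g , refl , refl))
      block≢varP : ∀ {L a} (k : τs ∋ (L ⇒ a)) (g : Γ ∋ (L ⇒ a)) → lookupP ps k ≡ varP (wkE e₀ g) → ⊥
      block≢varP k g eq = block-bound k g (subst (FvP (wkE e₀ g)) (sym eq) (fvHead vrefl))
      R₀-injective : ∀ {τ} (z₁ z₂ : τs ++ Γ ∋ τ) → R₀ z₁ ≡ R₀ z₂ → z₁ ≡ z₂
      R₀-injective {L ⇒ a} z₁ z₂ eq with blockView τs z₁ | blockView τs z₂
      ... | inBlock k | inBlock l with varEq? k l
      ...   | inj₁ e = cong (injL τs) (varEq-≡ e)
      ...   | inj₂ ne = ⊥-elim (block-⋭ k l ne (subst (λ q → Contains (expand q) (lookupP ps l))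
                                (sym (trans (sym (R₀-injL k)) (trans eq (R₀-injL l))))
                                    (prefix-contains (prefix-refl (lookupP ps l)))))
      R₀-injective {L ⇒ a} z₁ z₂ eq | inBlock k | inOuter g = ⊥-elim
          (block≢varP k g (trans (sym (R₀-injL k)) (trans eq (R₀-wkR g))))
      R₀-injective {L ⇒ a} z₁ z₂ eq | inOuter g | inBlock k = ⊥-elim
          (block≢varP k g (trans (sym (R₀-injL k)) (trans (sym eq) (R₀-wkR g))))
      R₀-injective {L ⇒ a} z₁ z₂ eq | inOuter g | inOuter g' =
        cong (wkR τs) (wkE-injective e₀ (varP-injective _ _ (trans (sym (R₀-wkR g)) (trans eq (R₀-wkR g')))))

    module Under {Ω Ω'} {R : PSub Ω Ω'} {Es : Γ ⊑ Ω} {Et : Γ ⊑ Ω'} (G : Admissible R Es Et) where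
      open Admissible G

      block-subterm-fv : ∀ {τ σ ρ} (k : τs ∋ τ) {s₀ : Tm Ξ σ} → s₀ ∈P lookupP ps k → (v : Ω' ∋ ρ) →
                         PlainVar W v → FvT v (renT W s₀) → ⊥
      block-subterm-fv k ms v c f with fvT-renT⁻ W _ f
      ... | u , eq , f′ with c
      ...   | inj₁ v∉W = v∉W (sym eq)
      ...   | inj₂ (g , eg) =
              block-bound k g (∈P⇒fvP ms (subst (λ z → FvT z _) (W-injective (trans (sym eq) eg)) f′))

      block-subterm-uncontained-image : ∀ {τ σ ρs a} (k : τs ∋ τ) {s₀ : Tm Ξ σ} → s₀ ∈P lookupP ps k →
                                        (w : Ω ∋ (ρs ⇒ a)) → Contains (renT W s₀) (R w) → ⊥
      block-subterm-uncontained-image k {s₀} ms w c with varClass w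
      ... | blockVar m eq =
            block-subterm-uncontained k m ms
              (contains-renT⁻ W-injective s₀ (lookupP ps m) (subst (Contains (renT W s₀)) eq c))
      ... | plainVar v eq cls =
            block-subterm-fv k ms v (Sum.map₂ (λ { (g , e₁ , _) → g , e₁ }) cls)
              (contains-fv (renT W s₀) (varP v) (subst (Contains (renT W s₀)) eq c) (fvHead vrefl))

      hrT-fv≢block-subterm : ∀ {τ σ ρs b} {a : Tm Ω σ} {v : Ω ∋ (ρs ⇒ b)} → FvT v a →
                             (k : τs ∋ τ) {s : Tm Ξ σ} → s ∈P lookupP ps k → hrT R a ≢ renT W s
      hrT-fv≢block-subterm {a = a} {v} f k ms eq =
        block-subterm-uncontained-image k ms v (subst (λ t → Contains t (R v)) eq (contains-hrT-fv R a f))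

      hrT≢block-subterm : ∀ {τ σ ρ} (k : τs ∋ τ) {s : Tm Ξ σ} → s ∈P lookupP ps k → {u : Ξ ∋ ρ} → FvT u s →
                          (a : Tm Ω σ) → hrT R a ≢ renT W s
      hrT≢block-subterm k ms {u} f a eq with fvT-hrT⁻ R a (subst (FvT (W u)) (sym eq) (fvT-renT⁺ W f))
      ... | (ρs ⇒ b) , z , fz , _ = hrT-fv≢block-subterm fz k ms eq

    data HeadView {Ω Ω'} {R : PSub Ω Ω'} {Es : Γ ⊑ Ω} {Et : Γ ⊑ Ω'} (G : Admissible R Es Et) {L c}
                  (h : Head Ω (L ⇒ c)) : Set where
      funHead   : (f : F (L ⇒ c)) → h ≡ fun f → HeadView G h
      plainHead : (x : Ω ∋ (L ⇒ c)) (v : Ω' ∋ (L ⇒ c)) → h ≡ var x → R x ≡ varP v →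
                  PlainVar (Admissible.W G) v → HeadView G h
      blockHead : (x : Ω ∋ (L ⇒ c)) (k : τs ∋ (L ⇒ c)) → h ≡ var x →
                  R x ≡ renP (Admissible.W G) (lookupP ps k) → HeadView G h

    headView : ∀ {Ω Ω'} {R : PSub Ω Ω'} {Es : Γ ⊑ Ω} {Et : Γ ⊑ Ω'} (G : Admissible R Es Et) {L c}
               (h : Head Ω (L ⇒ c)) → HeadView G h
    headView G (fun f) = funHead f refl
    headView G (var x) with Admissible.varClass G x
    ... | blockVar k eq = blockHead x k refl eq
    ... | plainVar v eq c = plainHead x v refl eq (Sum.map₂ (λ { (g , e₁ , _) → g , e₁ }) c)

    RigidHead : ∀ {Ω' L c} → Ren Ξ Ω' → Head Ω' (L ⇒ c) → Set
    RigidHead {Ω'} {L} {c} W hd =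
      (Σ (F (L ⇒ c)) λ f → hd ≡ fun f) ⊎ (Σ (Ω' ∋ (L ⇒ c)) λ v → (hd ≡ var v) × PlainVar W v)

    -- A variable head of p_k is bound, so it is neither outside W nor a Γ-variable; and if
    -- p_k = g(s⃗), some s_i has a free variable by (i), while no image hrT R a is such an s_i.
    rigid≢block : ∀ {Ω Ω'} {R : PSub Ω Ω'} {Es : Γ ⊑ Ω} {Et : Γ ⊑ Ω'} (G : Admissible R Es Et)
                  {L ρs c} {hd : Head Ω' (L ⇒ c)} → RigidHead (Admissible.W G) hd →
                  (as : Args Ω L) (k : τs ∋ (ρs ⇒ c)) (Y : Args Ω' ρs) →
                  hd ∙ hrA R as ≢ appP (renP (Admissible.W G) (lookupP ps k)) Y
    rigid≢block G rigid as k Y eq with lookupP ps k in pk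
    rigid≢block G rigid as k Y eq | papp (var u) ssk with ∙-injective eq
    ... | refl , eh , _ with rigid
    ...   | inj₁ (f , refl) = fun≢var eh
    ...   | inj₂ (v , refl , inj₁ v∉W) = v∉W (sym (var-injective eh))
    ...   | inj₂ (v , refl , inj₂ (g , eg)) with Admissible.W-injective G (trans (sym eg) (var-injective eh))
    ...     | refl = block-bound k g (subst (FvP (wkE e₀ g)) (sym pk) (fvHead vrefl))
    rigid≢block {R = R} G rigid as k Y eq | papp {σk} (fun g) ssk with ∙-injective eq
    ... | refl , _ , ea with splitArgs σk as
    ...   | as₁ , as₂ , refl with block-fv k
    ...     | _ , w , fv with subst (FvP w) pk fv
    ...       | fvArg {s = s} m fvs
                with ++ₐ-cancel (hrA R as₁) (renA (Admissible.W G) ssk) (hrA R as₂) Y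
                       (trans (sym (hrA-++ R as₁ as₂)) ea)
    ...         | e₁ , _ with ∈-hrA⁻ R as₁ (subst (renT (Admissible.W G) s ∈ₐ_) (sym e₁) (∈-renA⁺ (Admissible.W G) m))
    ...           | a , _ , ea′ = Under.hrT≢block-subterm G k (subst (s ∈P_) (sym pk) (inP m)) fvs a (sym ea′)

    hrT-injective : ∀ {Ω Ω'} {R : PSub Ω Ω'} {Es : Γ ⊑ Ω} {Et : Γ ⊑ Ω'} (G : Admissible R Es Et) {τ}
                    (a a' : Tm Ω τ) → hrT R a ≡ hrT R a' → a ≡ a'
    hrB-injective : ∀ {Ω Ω'} {R : PSub Ω Ω'} {Es : Γ ⊑ Ω} {Et : Γ ⊑ Ω'} (G : Admissible R Es Et) {c}
                    (b b' : Bd Ω c) → hrB R b ≡ hrB R b' → b ≡ b'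
    hrA-injective : ∀ {Ω Ω'} {R : PSub Ω Ω'} {Es : Γ ⊑ Ω} {Et : Γ ⊑ Ω'} (G : Admissible R Es Et) {L}
                    (as as' : Args Ω L) → hrA R as ≡ hrA R as' → as ≡ as'
    hrT-injective G (lam {σs} b) (lam b') eq =
      cong lam (hrB-injective (admissible-liftP σs G) b b' (lam-injective eq))
    hrA-injective G nil nil eq = refl
    hrA-injective G (t ∷ₐ ts) (t' ∷ₐ ts') eq with ∷ₐ-injective eq
    ... | e₁ , e₂ = cong₂ _∷ₐ_ (hrT-injective G t t' e₁) (hrA-injective G ts ts' e₂)
    hrB-injective {R = R} G (h ∙ as) (h' ∙ as') eq with headView G h | headView G h'
    ... | funHead f refl | funHead f' refl with ∙-injective eq
    ...   | refl , ef , ea rewrite fun-injective ef = cong (fun f' ∙_) (hrA-injective G as as' ea)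
    hrB-injective G (h ∙ as) (h' ∙ as') eq | funHead f refl | plainHead x' v' refl ex' _ =
      ⊥-elim (fun∙≢var∙ (trans eq (hrB-var as' ex')))
    hrB-injective G (h ∙ as) (h' ∙ as') eq | plainHead x v refl ex _ | funHead f' refl =
      ⊥-elim (fun∙≢var∙ (trans (sym eq) (hrB-var as ex)))
    hrB-injective G (h ∙ as) (h' ∙ as') eq | plainHead x v refl ex _ | plainHead x' v' refl ex' _
      with ∙-injective (trans (sym (hrB-var as ex)) (trans eq (hrB-var as' ex')))
    ... | refl , ev , ea with Admissible.R-injective G x x' (trans ex (trans (cong varP (var-injective ev)) (sym ex')))
    ...   | refl = cong (var x ∙_) (hrA-injective G as as' ea)
    hrB-injective {R = R} G (h ∙ as) (h' ∙ as') eq | blockHead x k refl ex | blockHead x' l refl ex'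
      with varEq? k l
    ... | inj₂ k≢l =
          ⊥-elim (distinct-blocks-incomparable (Admissible.W G) (Admissible.W-injective G) k l k≢l
                   (appP-prefix _ _ (hrA R as) (hrA R as') (trans (sym (hrB-var as ex)) (trans eq (hrB-var as' ex')))))
    ... | inj₁ k≡l with varEq-type k≡l
    ...   | refl with varEq-≡ k≡l
    ...     | refl with Admissible.R-injective G x x' (trans ex (sym ex'))
    ...       | refl = cong (var x ∙_) (hrA-injective G as as' (appP-cancel (R x) _ _ eq))
    hrB-injective {R = R} G (h ∙ as) (h' ∙ as') eq | funHead f refl | blockHead x' l refl ex' =
      ⊥-elim (rigid≢block G (inj₁ (f , refl)) as l (hrA R as') (trans eq (hrB-var as' ex')))
    hrB-injective {R = R} G (h ∙ as) (h' ∙ as') eq | plainHead x v refl ex c | blockHead x' l refl ex' =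
      ⊥-elim (rigid≢block G (inj₂ (v , refl , c)) as l (hrA R as')
               (trans (sym (hrB-var as ex)) (trans eq (hrB-var as' ex'))))
    hrB-injective {R = R} G (h ∙ as) (h' ∙ as') eq | blockHead x k refl ex | funHead f' refl =
      ⊥-elim (rigid≢block G (inj₁ (f' , refl)) as' k (hrA R as) (sym (trans (sym (hrB-var as ex)) eq)))
    hrB-injective {R = R} G (h ∙ as) (h' ∙ as') eq | blockHead x k refl ex | plainHead x' v' refl ex' c' =
      ⊥-elim (rigid≢block G (inj₂ (v' , refl , c')) as' k (hrA R as)
               (sym (trans (sym (hrB-var as ex)) (trans eq (hrB-var as' ex')))))

    rigid≢block-head : ∀ {Ω'} (W : Ren Ξ Ω') → InjectiveR W → ∀ {τ ρ L c} (k : τs ∋ τ) (u : Ξ ∋ ρ) →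
                       FvP u (lookupP ps k) →
           {hd : Head Ω' (L ⇒ c)} → RigidHead W hd → headName hd ≡ inj₁ (ρ , W u) → ⊥
    rigid≢block-head W Winj k u ip (inj₁ (f , refl)) ()
    rigid≢block-head W Winj k u ip (inj₂ (v , refl , c)) e with headName-var e
    ... | e' with varEq-type e'
    ... | refl with varEq-≡ e'
    ... | refl with c
    ...   | inj₁ nw = nw refl
    ...   | inj₂ (g , eg) = block-bound k g (subst (λ z → FvP z (lookupP ps k)) (Winj eg) ip)

    block≢rigid : ∀ {Ω Ω'} {R : PSub Ω Ω'} {Es : Γ ⊑ Ω} {Et : Γ ⊑ Ω'} (G : Admissible R Es Et) {L σq ρs c}
                  (k : τs ∋ (L ⇒ c)) (as : Args Ω L) {hdq : Head Ω' ((σq ++ ρs) ⇒ c)} →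
                  RigidHead (Admissible.W G) hdq → (ssq : Args Ω σq) →
                  (∀ {f} → hdq ≡ fun f → Σ Type λ ρ → Σ (Ω ∋ ρ) λ w → FvP w (papp (fun f) ssq)) →
                  (rest : Args Ω' ρs) →
                  appP (renP (Admissible.W G) (lookupP ps k)) (hrA R as) ≢ appP (papp hdq (hrA R ssq)) rest
    block≢rigid G k as rigid ssq fun-fv rest eq with lookupP ps k in pk
    block≢rigid {R = R} G k as {hdq} rigid ssq fun-fv rest eq | papp (var u) ssk
      with appP-prefix (renP (Admissible.W G) (papp (var u) ssk)) (papp hdq (hrA R ssq)) (hrA R as) rest eq
    ... | inj₁ ex = rigid≢block-head (Admissible.W G) (Admissible.W-injective G) k u
                      (subst (FvP u) (sym pk) (fvHead vrefl)) rigid (sym (PrefixView.eqh (prefix-view ex)))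
    ... | inj₂ ex = rigid≢block-head (Admissible.W G) (Admissible.W-injective G) k u
                      (subst (FvP u) (sym pk) (fvHead vrefl)) rigid (PrefixView.eqh (prefix-view ex))
    block≢rigid {R = R} G k as {hdq} rigid ssq fun-fv rest eq | papp (fun g) ssk
      with appP-prefix (renP (Admissible.W G) (papp (fun g) ssk)) (papp hdq (hrA R ssq)) (hrA R as) rest eq
    ... | inj₁ ex with prefix-view ex
    ...   | prefixView N c eqσ eqa _ with block-fv k
    ...     | _ , w , fv with subst (FvP w) pk fv
    ...       | fvArg {s = s} m fvs
                with ∈-hrA⁻ R ssq (∈-≅ (sym eqσ) (H.sym eqa) (∈-++ˡ c (∈-renA⁺ (Admissible.W G) m)))
    ...         | a , _ , ea = Under.hrT≢block-subterm G k (subst (s ∈P_) (sym pk) (inP m)) fvs a (sym ea)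
    block≢rigid {R = R} G k as rigid ssq fun-fv rest eq | papp (fun g) ssk | inj₂ ex with prefix-view ex
    ... | prefixView N c eqσ eqa eqh with rigid
    ...   | inj₂ (v , refl , _) = var≢fun eqh
      where
      var≢fun : ∀ {Δ} {x : Σ Type (λ ρ → Δ ∋ ρ)} {y : Σ Type F} → _≡_ {A = HeadName Δ} (inj₁ x) (inj₂ y) → ⊥
      var≢fun ()
    ...   | inj₁ (f , refl) with fun-fv refl
    ...     | (ρs′ ⇒ b′) , w , fvArg m fv
              with ∈-renA⁻ (Admissible.W G) ssk (∈-≅ (sym eqσ) (H.sym eqa) (∈-++ˡ c (∈-hrA⁺ R m)))
    ...       | s , m′ , es = Under.hrT-fv≢block-subterm G fv k (subst (s ∈P_) (sym pk) (inP m′)) es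

    hrA-++⁻ : ∀ {Ω Ω'} {R : PSub Ω Ω'} {Es : Γ ⊑ Ω} {Et : Γ ⊑ Ω'} (G : Admissible R Es Et) {σq ρs}
              (as : Args Ω (σq ++ ρs)) (ssq : Args Ω σq) (rest : Args Ω' ρs) →
              hrA R as ≡ hrA R ssq ++ₐ rest → Σ (Args Ω ρs) λ rest₀ → as ≡ ssq ++ₐ rest₀
    hrA-++⁻ {R = R} G {σq} as ssq rest eq with splitArgs σq as
    ... | as₁ , as₂ , refl
      with ++ₐ-cancel (hrA R as₁) (hrA R ssq) (hrA R as₂) rest (trans (sym (hrA-++ R as₁ as₂)) eq)
    ...   | e₁ , _ rewrite hrA-injective G as₁ ssq e₁ = as₂ , refl

    hrB-appP⁻ : ∀ {Ω Ω'} {R : PSub Ω Ω'} {Es : Γ ⊑ Ω} {Et : Γ ⊑ Ω'} (G : Admissible R Es Et) {ρs c}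
                (b : Bd Ω c) (q : PApp Ω (ρs ⇒ c)) (rest : Args Ω' ρs) → (Σ Type λ ρ → Σ (Ω ∋ ρ) λ w → FvP w q) →
                hrB R b ≡ appP (hrP R q) rest → Σ (Args Ω ρs) λ rest₀ → b ≡ appP q rest₀
    hrB-appP⁻ {R = R} G (h ∙ as) (papp {σq} hq ssq) rest fq eq with headView G h | headView G hq
    ... | blockHead x k refl ex | blockHead xq l refl exq with varEq? k l
    ...   | inj₂ k≢l =
            ⊥-elim (distinct-blocks-incomparable (Admissible.W G) (Admissible.W-injective G) k l k≢l
                     (appP-prefix _ _ (hrA R as) (hrA R ssq ++ₐ rest)
                       (trans (sym (hrB-var as ex)) (trans eq (appP-hrP-var ssq rest exq)))))
    ...   | inj₁ k≡l with varEq-type k≡l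
    ...     | refl with varEq-≡ k≡l
    ...       | refl with Admissible.R-injective G x xq (trans ex (sym exq))
    ...         | refl = map₂ (cong (var x ∙_))
                           (hrA-++⁻ G as ssq rest (appP-cancel (R x) _ _ (trans eq (appP-hrP-var ssq rest refl))))
    hrB-appP⁻ G (h ∙ as) (papp hq ssq) rest fq eq | blockHead x k refl ex | funHead f refl =
      ⊥-elim (block≢rigid G k as (inj₁ (f , refl)) ssq (λ { refl → fq }) rest (trans (sym (hrB-var as ex)) eq))
    hrB-appP⁻ G (h ∙ as) (papp hq ssq) rest fq eq | blockHead x k refl ex | plainHead xq v refl exq c =
      ⊥-elim (block≢rigid G k as (inj₂ (v , refl , c)) ssq (λ ()) rest
               (trans (sym (hrB-var as ex)) (trans eq (appP-hrP-var ssq rest exq))))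
    hrB-appP⁻ {R = R} G (h ∙ as) (papp hq ssq) rest fq eq | funHead f refl | blockHead xq l refl exq =
      ⊥-elim (rigid≢block G (inj₁ (f , refl)) as l (hrA R ssq ++ₐ rest) (trans eq (appP-hrP-var ssq rest exq)))
    hrB-appP⁻ {R = R} G (h ∙ as) (papp hq ssq) rest fq eq | plainHead x v refl ex c | blockHead xq l refl exq =
      ⊥-elim (rigid≢block G (inj₂ (v , refl , c)) as l (hrA R ssq ++ₐ rest)
               (trans (sym (hrB-var as ex)) (trans eq (appP-hrP-var ssq rest exq))))
    hrB-appP⁻ G (h ∙ as) (papp hq ssq) rest fq eq | funHead f refl | funHead f' refl with ∙-injective eq
    ... | refl , ef , ea with fun-injective ef
    ...   | refl = map₂ (cong (fun f ∙_)) (hrA-++⁻ G as ssq rest ea)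
    hrB-appP⁻ G (h ∙ as) (papp hq ssq) rest fq eq | funHead f refl | plainHead xq v refl exq c =
      ⊥-elim (fun∙≢var∙ (trans eq (appP-hrP-var ssq rest exq)))
    hrB-appP⁻ G (h ∙ as) (papp hq ssq) rest fq eq | plainHead x v refl ex c | funHead f refl =
      ⊥-elim (fun∙≢var∙ (trans (sym eq) (hrB-var as ex)))
    hrB-appP⁻ G (h ∙ as) (papp hq ssq) rest fq eq | plainHead x v refl ex c | plainHead xq v' refl exq c'
      with ∙-injective (trans (sym (hrB-var as ex)) (trans eq (appP-hrP-var ssq rest exq)))
    ... | refl , ev , ea with Admissible.R-injective G x xq (trans ex (trans (cong varP (var-injective ev)) (sym exq)))
    ...   | refl = map₂ (cong (var x ∙_)) (hrA-++⁻ G as ssq rest ea)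

    block-subterm-uncontained-hrP : ∀ {Ω Ω'} {R : PSub Ω Ω'} {Es : Γ ⊑ Ω} {Et : Γ ⊑ Ω'} (G : Admissible R Es Et)
                                    {τ σ ρs c} (k : τs ∋ τ) {s₀ : Tm Ξ σ} → s₀ ∈P lookupP ps k →
                                    (q : PApp Ω (ρs ⇒ c)) → (Σ Type λ ρ → Σ (Ω ∋ ρ) λ w → FvP w q) →
                                    ¬ Contains (renT (Admissible.W G) s₀) (hrP R q)
    block-subterm-uncontained-hrP {R = R} G k {s₀} ms (papp (var x) ssq) _ c =
      Under.block-subterm-uncontained-image G k ms x (contains-supplyP (renT (Admissible.W G) s₀) (R x) (hrA R ssq) c)
    block-subterm-uncontained-hrP {R = R} G k {s₀} ms (papp (fun f) ssq) ((ρs′ ⇒ b′) , w , fvArg {s = a} m fv)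
      (Ω₂ , e , rest , o) with contains-renT⁺ (wkE e) (hrT R a) (R w) (contains-hrT-fv R a fv)
    ... | Ω₃ , e₃ , rest₃ , o₃ =
      Under.block-subterm-uncontained-image G k ms w
        (_ , e ⊙ e₃ , rest₃ ,
         subst (OccT (renT (Admissible.W G) s₀) (e ⊙ e₃))
           (cong (λ p → appP p rest₃) (trans (renP-comp (wkE e₃) (wkE e) (R w)) (sym (renP-ext (wkE-⊙ e e₃) (R w)))))
           (occT-trans o (argO (∈-++ˡ rest (∈-renA⁺ (wkE e) (∈-hrA⁺ R m))) o₃)))

    -- An occurrence of the image of q in hrT R a is either the image of an occurrence in a, which
    -- then matches q itself (hrB-appP⁻), or lies inside a block argument, which cannot contain it.
    contains-hrT⁻ : ∀ {Ω Ω'} {R : PSub Ω Ω'} {Es : Γ ⊑ Ω} {Et : Γ ⊑ Ω'} (G : Admissible R Es Et) {τ ρs c}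
                    (a : Tm Ω τ) (q : PApp Ω (ρs ⇒ c)) → (Σ Type λ ρ → Σ (Ω ∋ ρ) λ w → FvP w q) →
                    Contains (hrT R a) (hrP R q) → Contains a q
    contains-hrT⁻ {R = R} G a q (ρ , w , fv) (Ω₂ , e′ , rest , o) with occT-hrT⁻ R a o
    ... | inj₁ (fromSource e R′ c l o′ eq)
          with hrB-appP⁻ (admissible-LiftP l G) c (renP (wkE e) q) rest (ρ , wkE e w , fvP-renP⁺ (wkE e) q fv)
                 (trans (sym eq) (cong (λ p → appP p rest) (LiftP-renP-hrP l q)))
    ...   | rest₀ , refl = _ , e , rest₀ , o′
    contains-hrT⁻ {R = R} G a q (ρ , w , fv) (Ω₂ , e′ , rest , o) | inj₂ (insideImage e₁ e₁′ R₁ l x as o₁ s mem e₂ o₂ eqe)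
      with Admissible.varClass (admissible-LiftP l G) x
    ... | plainVar v eq _ = ⊥-elim (∈P-varP v (subst (s ∈P_) eq mem))
    ... | blockVar k eq with ∈P-renP⁻ (Admissible.W (admissible-LiftP l G)) (lookupP ps k) (subst (s ∈P_) eq mem)
    ...   | s₀ , ms₀ , refl =
      ⊥-elim (block-subterm-uncontained-hrP (admissible-LiftP l G) k ms₀ (renP (wkE e₁) q)
                (ρ , wkE e₁ w , fvP-renP⁺ (wkE e₁) q fv)
                (_ , e₂ , rest ,
                 subst (OccT (renT (Admissible.W (admissible-LiftP l G)) s₀) e₂)
                   (cong (λ p → appP p rest)
                     (trans (cong (λ z → renP (wkE z) (hrP R q)) eqe)
                       (trans (renP-ext (wkE-⊙ e₁′ e₂) (hrP R q))
                         (trans (sym (renP-comp (wkE e₂) (wkE e₁′) (hrP R q))) (cong (renP (wkE e₂)) (LiftP-renP-hrP l q))))))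
                   o₂))

    module Transfer {Ω Ω'} {R : PSub Ω Ω'} {Es : Γ ⊑ Ω} {Et : Γ ⊑ Ω'} (G : Admissible R Es Et) where
      open Admissible G

      hrT-fv-nonempty : ∀ {τ} (u : Tm Ω τ) → (Σ Type λ ρ → Σ (Ω ∋ ρ) λ z → FvT z u) →
                        Σ Type λ ρ → Σ (Ω' ∋ ρ) λ v → FvT v (hrT R u)
      hrT-fv-nonempty u ((ρs ⇒ b) , z , f) with varClass z
      ... | blockVar k eq with block-fv k
      ...   | _ , w , fv =
              _ , W w , contains-fv (hrT R u) (R z) (contains-hrT-fv R u f)
                          (subst (FvP (W w)) (sym eq) (fvP-renP⁺ W (lookupP ps k) fv))
      hrT-fv-nonempty u ((ρs ⇒ b) , z , f) | plainVar v eq _ =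
        _ , v , contains-fv (hrT R u) (R z) (contains-hrT-fv R u f) (subst (FvP v) (sym eq) (fvHead vrefl))

      hrT-fv-bound : ∀ {τ} (u : Tm Ω τ) → (∀ {ρ} (g : Γ ∋ ρ) → ¬ FvT (wkE Es g) u) →
                     ∀ {ρ} (g : Γ ∋ ρ) → ¬ FvT (wkE Et g) (hrT R u)
      hrT-fv-bound u bound g f with fvT-hrT⁻ R u f
      ... | _ , z , fz , fv with varClass z
      ...   | blockVar k eq =
              block-bound k g (fvP-renP⁻ W-injective (lookupP ps k)
                (subst (λ y → FvP y (renP W (lookupP ps k))) (Et-W g) (subst (FvP (wkE Et g)) eq fv)))
      ...   | plainVar v eq c with fvP-varP v (subst (FvP (wkE Et g)) eq fv)
      ...     | g≡v with varEq-type g≡v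
      ...       | refl with varEq-≡ g≡v
      ...         | refl with c
      ...           | inj₁ v∉W = v∉W (sym (Et-W g))
      ...           | inj₂ (g′ , e₁ , refl) with wkE-injective e₀ (W-injective (trans (sym (Et-W g)) e₁))
      ...             | refl = bound g fz

      hrT-Expanded : ∀ {τ} (u : Tm Ω τ) → Expanded u → Expanded (hrT R u)
      hrT-Expanded {ρs ⇒ a} u (σs , h , ss , refl) =
        subst Expanded (sym (hrT-expand R (papp h ss))) (expand-Expanded (hrP R (papp h ss)))

      hrT-⋭E : ∀ {τ τ'} (u : Tm Ω τ) (u' : Tm Ω τ') → Expanded u' → (Σ Type λ ρ → Σ (Ω ∋ ρ) λ z → FvT z u') →
               ¬ (u ⊵E u') → ¬ (hrT R u ⊵E hrT R u')
      hrT-⋭E {τ' = ρs ⇒ a} u u' (σq , hq , ssq , refl) (ρ , z , fz) ⋭ (σs' , h' , ss' , eqj , Ω₂ , e , rest , o)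
        with expand-injective (hrP R (papp hq ssq)) (papp h' ss') (trans (sym (hrT-expand R (papp hq ssq))) eqj)
      ... | eqP with contains-hrT⁻ G u (papp hq ssq) (ρ , z , fvT-expand⇒fvP (papp hq ssq) fz)
                       (Ω₂ , e , rest , subst (λ P → OccT (hrT R u) e (appP (renP (wkE e) P) rest)) (sym eqP) o)
      ...   | Ω₃ , e₃ , rest₃ , o₃ = ⋭ (σq , hq , ssq , refl , Ω₃ , e₃ , rest₃ , o₃)

      DHPArgs-hrA : ∀ {L} (as : Args Ω L) → DHPArgs Es as → DHPArgs Et (hrA R as)
      DHPArgs-hrA as dhp i with dhp i
      ... | (fv , bound) , ex , ⋭ rewrite hrA-! R as i =
        (hrT-fv-nonempty (as ! i) fv , hrT-fv-bound (as ! i) bound) , hrT-Expanded (as ! i) ex ,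
        λ j i≢j → subst (λ t → ¬ (hrT R (as ! i) ⊵E t)) (sym (hrA-! R as j))
                    (hrT-⋭E (as ! i) (as ! j) (proj₁ (proj₂ (dhp j))) (proj₁ (proj₁ (dhp j))) (⋭ j i≢j))

    outer-var≢block : ∀ {Ω Ω'} {R : PSub Ω Ω'} {Es : Γ ⊑ Ω} {Et : Γ ⊑ Ω'} (G : Admissible R Es Et)
                      {σs ρs a} (y : Γ ∋ (σs ⇒ a)) (ts : Args Ω' σs) (k : τs ∋ (ρs ⇒ a)) (Y : Args Ω' ρs) →
                      var (wkE Et y) ∙ ts ≢ appP (renP (Admissible.W G) (lookupP ps k)) Y
    outer-var≢block G y ts k Y eq with lookupP ps k in pk
    ... | papp (fun g) ssk = fun∙≢var∙ (sym eq)
    ... | papp (var u) ssk with ∙-injective eq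
    ...   | refl , ev , _ with Admissible.W-injective G (trans (sym (Admissible.Et-W G y)) (var-injective ev))
    ...     | refl = block-bound k y (subst (FvP (wkE e₀ y)) (sym pk) (fvHead vrefl))

    -- A Γ-headed occurrence in hrB R b cannot lie inside a block argument (those mention no
    -- Γ-variable), so it is the image of a Γ-headed occurrence in b, whose arguments transfer.
    DHP-hrB : ∀ {Ω Ω'} {R : PSub Ω Ω'} {Es : Γ ⊑ Ω} {Et : Γ ⊑ Ω'} (G : Admissible R Es Et) {c} (b : Bd Ω c) →
              DHPBelowB Es b → DHPBelowB Et (hrB R b)
    DHP-hrB {R = R} {Et = Et} G b dhp e′ y ts o with occB-hrB⁻ R b o
    ... | inj₁ (fromSource e R′ (fun f ∙ as) l o′ eq) = ⊥-elim (fun∙≢var∙ (sym eq))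
    ... | inj₁ (fromSource e R′ (var x ∙ as) l o′ eq) with admissible-LiftP l G
    ...   | G′ with Admissible.varClass G′ x
    ...     | blockVar k ex = ⊥-elim (outer-var≢block G′ y ts k (hrA R′ as) (trans eq (hrB-var as ex)))
    ...     | plainVar v ex c with ∙-injective (trans eq (hrB-var as ex))
    ...       | refl , ev , refl with c
    ...         | inj₁ v∉W = ⊥-elim (v∉W (trans (sym (Admissible.Et-W G′ y)) (var-injective ev)))
    ...         | inj₂ (g , e₁ , refl)
                  with wkE-injective e₀ (Admissible.W-injective G′
                         (trans (sym (Admissible.Et-W G′ y)) (trans (var-injective ev) e₁)))
    ...           | refl = Transfer.DHPArgs-hrA G′ as (dhp e y as o′)
    DHP-hrB {R = R} {Et = Et} G b dhp e′ y ts o | inj₂ (insideImage e₁ e₁′ R₁ l x as o₁ s mem e₂ o₂ eqe)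
      with Admissible.varClass (admissible-LiftP l G) x
    ... | plainVar v eq c = ⊥-elim (∈P-varP v (subst (s ∈P_) eq mem))
    ... | blockVar k eq with ∈P-renP⁻ (Admissible.W (admissible-LiftP l G)) (lookupP ps k) (subst (s ∈P_) eq mem)
    ...   | s₀ , ms₀ , refl =
      ⊥-elim (Under.block-subterm-fv (admissible-LiftP l G) k ms₀ (wkE (Et ⊙ e₁′) y)
                (inj₂ (y , Admissible.Et-W (admissible-LiftP l G) y))
                (occT-fv (wkE (Et ⊙ e₁′) y) o₂ (subst (λ z → FvB z (var (wkE (Et ⊙ e′) y) ∙ ts)) y-wk headF)))
      where
      y-wk : wkE (Et ⊙ e′) y ≡ wkE e₂ (wkE (Et ⊙ e₁′) y)
      y-wk = trans (cong (λ z → wkE (Et ⊙ z) y) eqe)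
               (trans (cong (λ z → wkE z y) (sym (⊙-assoc Et e₁′ e₂))) (wkE-⊙ (Et ⊙ e₁′) e₂ y))

    DHPBelowB-inst : ∀ {a} (w : Bd (τs ++ Γ) a) → DHPBelowB (step τs base) w →
                     DHPBelowB e₀ (inst τs (renB (liftR τs (wkE e₀)) w) (expandAll ps))
    DHPBelowB-inst w dhp
      rewrite inst-expandAll τs (renB (liftR τs (wkE e₀)) w) ps | hrB-ren (instP ps) (liftR τs (wkE e₀)) w =
      DHP-hrB admissible₀ w dhp

  -- Preservation under substitution

  module _ {Γ : Ctx} (θ : Subst Γ) (θ-DHP : ∀ {σ} (x : Γ ∋ σ) (t : Tm Γ σ) → θ x ≡ just t → DHP t) where

    DHP-[]T : ∀ {Ξ τ} (e₀ : Γ ⊑ Ξ) (t : Tm Ξ τ) → DHPBelow e₀ t → DHPBelow e₀ (t [ liftSE e₀ θ ]T)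
    DHP-[]B : ∀ {Ξ a} (e₀ : Γ ⊑ Ξ) (b : Bd Ξ a) → DHPBelowB e₀ b → DHPBelowB e₀ (b [ liftSE e₀ θ ]B)
    DHP-[]A : ∀ {Ξ σs σ} (e₀ : Γ ⊑ Ξ) (as : Args Ξ σs) → (∀ {ρ} {t : Tm Ξ ρ} → t ∈ₐ as → DHPBelow e₀ t) →
              {t : Tm Ξ σ} → t ∈ₐ as [ liftSE e₀ θ ]A → DHPBelow e₀ t
    DHP-[]T e₀ (lam {σs} b) dhp = DHPBelow-lam⁻ (DHP-[]B (step σs e₀) b (DHPBelow-lam dhp))
    DHP-[]B e₀ (fun f ∙ as) dhp e y ts (argO m o) = DHP-[]A e₀ as (DHPBelowB-arg dhp) m e y ts o
    DHP-[]B e₀ (var x ∙ as) dhp e y ts o with liftSE e₀ θ x in θx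
    DHP-[]B e₀ (var x ∙ as) dhp e y ts (argO m o) | nothing = DHP-[]A e₀ as (DHPBelowB-arg dhp) m e y ts o
    DHP-[]B e₀ (var x ∙ as) dhp _ y _ hereO | nothing =
      subst (DHPArgs e₀) (sym ([]A-bound θ e₀ as (λ i → proj₂ (proj₁ (D i))))) D
      where D = dhp base y as hereO
    ... | just (lam w′) with liftSE-just⁻ e₀ θ x (lam w′) θx
    ...   | g , lam {τs} w , refl , θg , refl with dhp base g as hereO
    ...     | D with expanded-args as (λ i → proj₁ (proj₂ (D i)))
    ...       | ps , refl =
      subst (λ as′ → DHPBelowB e₀ (inst τs (renB (liftR τs (wkE e₀)) w) as′))
        (sym ([]A-bound θ e₀ (expandAll ps) (λ i → proj₂ (proj₁ (D i)))))
        (Block.DHPBelowB-inst e₀ ps D w (DHPBelow-lam (DHP⇒DHPBelow (θ-DHP g (lam w) θg))))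
        e y ts o
    DHP-[]A e₀ (t ∷ₐ as) dhp hereₐ = DHP-[]T e₀ t (dhp hereₐ)
    DHP-[]A e₀ (t ∷ₐ as) dhp (thereₐ m) = DHP-[]A e₀ as (λ m′ → dhp (thereₐ m′)) m

lemma13 : (S : Set) (F : Ty S → Set) → let open Terms S F in
    ∀ {Γ τ} (s : Tm Γ τ) (θ : Subst Γ) →
    DHP s →
    (∀ {σ} (x : Γ ∋ σ) (t : Tm Γ σ) → θ x ≡ just t → DHP t) →
    DHP (s [ θ ]T)
lemma13 S F s θ dhp θ-DHP =
  DHPBelow⇒DHP S F (DHP-[]T S F θ θ-DHP Terms.base s (DHP⇒DHPBelow S F dhp))
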